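{- For every $n\ge0$, $\mathcal D_n(0)^{ -1}=\sqrt2\,\mathcal B\,\mathcal B^*$, where $\mathcal B=(b_{k,\ell})_{0\le k,\ell\le n}$ is the upper triangular matrix whose entries are the coefficients of the polynomials $\mathcal P_\ell(x)=\sum_k b_{k,\ell}x^k$, and $\mathcal B^*$ is its conjugate transpose.
   Context: $c_0(2k):=(-1)^k\frac{d^{2k}}{dx^{2k}}(e^x+e^{ -x})^{ -1/2}|_{x=0}$, $c_0(2k+1):=0$, and $\mathcal D_n(0):=(c_0(i+j))_{0\le i,j\le n}$. For $m\ge0$, $\mathcal P_m(x):=\sqrt{(2m)!}\sum_{k=0}^m(-1)^k2^{3k-m}\frac{\prod_{j=0}^{k-1}(j-\frac{ix}{2}+\frac14)}{(2k)!\,(m-k)!}$. -}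

module Defs where

open import Data.Nat as ℕ using (ℕ; zero; suc; _!; _≤_; _∸_)
open import Data.Nat.Properties using (_!≢0; m*n≢0; m^n≢0)
open import Data.Integer as ℤ using (ℤ; +_; -[1+_])
open import Data.Rational as ℚ using (ℚ; 0ℚ; 1ℚ; ½)
open import Data.Bool using (Bool; true; false; if_then_else_)
open import Data.Product using (_×_)
open import Relation.Binary.PropositionalEquality using (_≡_)

sumℚ : ℕ → (ℕ → ℚ) → ℚ
sumℚ zero    f = 0ℚ
sumℚ (suc n) f = sumℚ n f ℚ.+ f n

signℚ : ℕ → ℚ
signℚ zero    = 1ℚ
signℚ (suc k) = ℚ.- signℚ k

natℚ : ℕ → ℚ
natℚ n = (+ n) ℚ./ 1

inv! : ℕ → ℚ
inv! n = ℚ._/_ (+ 1) (n !) {{n !≢0}}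

record ℚ[i] : Set where
  constructor _+i_
  field
    re : ℚ
    im : ℚ
open ℚ[i] public

0G : ℚ[i]
0G = 0ℚ +i 0ℚ

_+G_ : ℚ[i] → ℚ[i] → ℚ[i]
(a +i b) +G (c +i d) = (a ℚ.+ c) +i (b ℚ.+ d)

_*G_ : ℚ[i] → ℚ[i] → ℚ[i]
(a +i b) *G (c +i d) = ((a ℚ.* c) ℚ.- (b ℚ.* d)) +i ((a ℚ.* d) ℚ.+ (b ℚ.* c))

_·G_ : ℚ → ℚ[i] → ℚ[i]
q ·G (a +i b) = (q ℚ.* a) +i (q ℚ.* b)

conj : ℚ[i] → ℚ[i]
conj (a +i b) = a +i (ℚ.- b)

sumG : ℕ → (ℕ → ℚ[i]) → ℚ[i]
sumG zero    f = 0G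
sumG (suc n) f = sumG n f +G f n

-- The field ℚ(i, √2) : a + b·√2 with a b ∈ ℚ(i)

record 𝕂 : Set where
  constructor _+√2_
  field
    ratPart  : ℚ[i]
    sqrtPart : ℚ[i]
open 𝕂 public

0K : 𝕂
0K = 0G +√2 0G

1K : 𝕂
1K = (1ℚ +i 0ℚ) +√2 0G

√2 : 𝕂
√2 = 0G +√2 (1ℚ +i 0ℚ)

_+K_ : 𝕂 → 𝕂 → 𝕂
(a +√2 b) +K (c +√2 d) = (a +G c) +√2 (b +G d)

_*K_ : 𝕂 → 𝕂 → 𝕂
(a +√2 b) *K (c +√2 d) =
  ((a *G c) +G ((natℚ 2) ·G (b *G d))) +√2 ((a *G d) +G (b *G c))

fromG : ℚ[i] → 𝕂
fromG a = a +√2 0G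

sumK : ℕ → (ℕ → 𝕂) → 𝕂
sumK zero    f = 0K
sumK (suc n) f = sumK n f +K f n

-- Formal power series over ℚ (coefficient sequences), used to compute
-- Taylor coefficients at 0 of (e^x + e^{-x})^{-1/2}.

Series : Set
Series = ℕ → ℚ

_⊛_ : Series → Series → Series
(f ⊛ g) n = sumℚ (suc n) (λ i → f i ℚ.* g (n ∸ i))

unitS : Series
unitS zero    = 1ℚ
unitS (suc _) = 0ℚ

_^S_ : Series → ℕ → Series
f ^S zero    = unitS
f ^S (suc m) = f ⊛ (f ^S m)

expS : Series
expS n = inv! n

expNegS : Series
expNegS n = signℚ n ℚ.* inv! n

coshSum : Series
coshSum n = expS n ℚ.+ expNegS n

-- binomial coefficient binom(-1/2, m) = Π_{j<m} (-1/2 - j)/(j+1)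
binomNegHalf : ℕ → ℚ
binomNegHalf zero    = 1ℚ
binomNegHalf (suc j) =
  binomNegHalf j ℚ.* (ℚ.- ((+ (suc (2 ℕ.* j))) ℚ./ (suc (suc (2 ℕ.* j)))))

-- For a series g with g(0) = 2 (here g = e^x + e^{-x}):
--   g^{-1/2} = 2^{-1/2} (1 + u)^{-1/2},  u = g/2 - 1  (u(0) = 0),
--   (1+u)^{-1/2} = Σ_m binom(-1/2,m) u^m   (only m ≤ n contribute to x^n).
-- rootFreeCoeff g n is the x^n-coefficient of (1+u)^{-1/2} (a rational).
rootFreeCoeff : Series → ℕ → ℚ
rootFreeCoeff g n = sumℚ (suc n) (λ m → binomNegHalf m ℚ.* ((u ^S m) n))
  where
  u : Series
  u k = (½ ℚ.* g k) ℚ.- unitS k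

-- x^n-coefficient of (e^x + e^{-x})^{-1/2}, an element of ℚ(√2):
-- 2^{-1/2} · r = (r/2) · √2
invSqrtCoshCoeff : ℕ → 𝕂
invSqrtCoshCoeff n = 0G +√2 ((½ ℚ.* rootFreeCoeff coshSum n) +i 0ℚ)

deriv0InvSqrtCosh : ℕ → 𝕂
deriv0InvSqrtCosh k = fromG (natℚ (k !) +i 0ℚ) *K invSqrtCoshCoeff k

isEven : ℕ → Bool
isEven zero          = true
isEven (suc zero)    = false
isEven (suc (suc n)) = isEven n

half : ℕ → ℕ
half zero          = zero
half (suc zero)    = zero
half (suc (suc n)) = suc (half n)

c₀ : ℕ → 𝕂
c₀ n = if isEven n
         then fromG (signℚ (half n) +i 0ℚ) *K deriv0InvSqrtCosh n
         else 0K

-- matrices indexed by ℕ × ℕ, used with indices 0 ≤ i, j ≤ n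
Mat : Set
Mat = ℕ → ℕ → 𝕂

𝒟 : Mat
𝒟 i j = c₀ (i ℕ.+ j)

mul : ℕ → Mat → Mat → Mat
mul n A B i j = sumK (suc n) (λ l → A i l *K B l j)

idM : Mat
idM i j = if i ℕ.≡ᵇ j then 1K else 0K

scale : 𝕂 → Mat → Mat
scale c A i j = c *K A i j

IsInverse : ℕ → Mat → Mat → Set
IsInverse n A X =
  (∀ i j → i ≤ n → j ≤ n → mul n A X i j ≡ idM i j) ×
  (∀ i j → i ≤ n → j ≤ n → mul n X A i j ≡ idM i j)

-- polynomials over ℚ(i) as coefficient sequences (finitely supported)
Poly : Set
Poly = ℕ → ℚ[i]

_⊛P_ : Poly → Poly → Poly
(f ⊛P g) n = sumG (suc n) (λ i → f i *G g (n ∸ i))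

oneP : Poly
oneP zero    = 1ℚ +i 0ℚ
oneP (suc _) = 0G

-- the linear factor  j - (i x)/2 + 1/4
linFactor : ℕ → Poly
linFactor j zero             = (natℚ j ℚ.+ ((+ 1) ℚ./ 4)) +i 0ℚ
linFactor j (suc zero)       = 0ℚ +i (ℚ.- ½)
linFactor j (suc (suc _))    = 0G

prodLin : ℕ → Poly
prodLin zero    = oneP
prodLin (suc k) = prodLin k ⊛P linFactor k

-- 2^{3k-m} / ((2k)! (m-k)!)  (exponent possibly negative), for k ≤ m
weight : ℕ → ℕ → ℚ
weight m k =
  ℚ._/_ (+ (2 ℕ.^ (3 ℕ.* k))) ((2 ℕ.^ m) ℕ.* (((2 ℕ.* k) !) ℕ.* ((m ∸ k) !)))
    {{m*n≢0 _ _ {{m^n≢0 2 m}} {{m*n≢0 _ _ {{(2 ℕ.* k) !≢0}} {{(m ∸ k) !≢0}}}}}}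

-- 𝒫_m(x) / √((2m)!) = Σ_{k=0}^m (-1)^k 2^{3k-m} Π_{j<k}(j - ix/2 + 1/4) / ((2k)!(m-k)!)
-- normP m is this polynomial; 𝒫_m = √((2m)!) · normP m.
normP : ℕ → Poly
normP m = λ r → sumG (suc m) (λ k → (signℚ k ℚ.* weight m k) ·G prodLin k r)

-- b_{k,ℓ} = √((2ℓ)!) · a_{k,ℓ}, where a_{k,ℓ} = coefficient of x^k in normP ℓ
a : ℕ → ℕ → ℚ[i]
a k ℓ = normP ℓ k

-- (ℬ ℬ*)_{k,j} = Σ_{ℓ=0}^{n} b_{k,ℓ} · conj(b_{j,ℓ})
--              = Σ_{ℓ=0}^{n} (2ℓ)! · a_{k,ℓ} · conj(a_{j,ℓ})
-- (using √((2ℓ)!) real, so √((2ℓ)!) · conj(√((2ℓ)!)) = (2ℓ)!)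
BB* : ℕ → Mat
BB* n k j = fromG (sumG (suc n) (λ ℓ →
  natℚ ((2 ℕ.* ℓ) !) ·G (a k ℓ *G conj (a j ℓ))))

-- Let ν m = G⁽ᵐ⁾(0) for G(x) = cosh(x/2)^(-1/2), let H = (ν (r + s)) be its Hankel matrix, and
-- put ω = 2i, ζ = ω⁻¹ = -i/2. Since G is even, √2 c₀(m) = ω^m ν m, and 𝒫_ℓ(x) = √((2ℓ)!) p_ℓ(ζ x)
-- for the real polynomials p_ℓ(y) = Σ_t w_{ℓ,t} (¼ + y)(5/4 + y)⋯(t - ¾ + y), where
-- w_{ℓ,t} = (-1)^t 2^(3t-ℓ) / ((2t)! (ℓ-t)!). Hence
-- √2 𝒟ₙ(0) = Ω H Ω and ℬℬ* = Ω⁻¹ W Ω⁻¹ with Ω = diag(ω^k) and W = Σ_ℓ (2ℓ)! p̂_ℓ p̌_ℓᵀ, where p̂_ℓ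
-- and p̌_ℓ are the coefficient vectors of p_ℓ(y) and p_ℓ(-y); the theorem becomes H W = W H = I.
-- As p̂ and p̌ are triangular with nonzero diagonal, this follows from the biorthogonality
-- p̌_ℓᵀ H p̂_m = δ_{ℓm} / (2ℓ)!.
--
-- The functional φ(q) = (q(∂)G)(0), whose moments are the ν m, is evaluated on the products
-- Π_{t<k} (¼ + t - y) · Π_{s<j} (¼ + s + y). The equation (¼ + ∂)G = e^(-x) (¼ - ∂)G, a rescaling
-- of 2 cosh x · F′ + sinh x · F = 0 for F = cosh^(-1/2), moves one factor from the second product
-- to the first (e^(-x) is 1 at x = 0), so the value only depends on k + j; it is (½)_{k+j} / 2^(k+j).
-- The Gram matrix of the p_ℓ then becomes a sum of alternating binomial sums of polynomials of
-- degree below ℓ, which vanish off the diagonal.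

module Submission where

open import Algebra.Bundles using (CommutativeRing)
open import Algebra.Structures using (IsCommutativeRing)
open import Data.Bool using (true; false; if_then_else_)
import Data.Bool
open import Data.Empty using (⊥-elim)
import Data.Integer as ℤ
import Data.Integer.Properties as ℤP
open import Data.Nat as ℕ using (ℕ; zero; suc; _!; _≤_; _<_; _∸_; z≤n; s≤s)
open import Data.Nat.Combinatorics using (_C_; nCk+nC[k+1]≡[n+1]C[k+1]; k>n⇒nCk≡0; nCk≡n!/k![n-k]!; k![n∸k]!∣n!)
open import Data.Nat.DivMod using (m/n*n≡m)
import Data.Nat.Properties as ℕP
open import Data.Nat.Properties using (_!≢0; m*n≢0; m^n≢0)
open import Data.Product using (_,_)
open import Data.Rational as ℚ using (ℚ; 0ℚ; 1ℚ; ½; _+_; _*_; -_; _-_)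
import Data.Rational.Properties as ℚP
open import Data.Rational.Solver using (module +-*-Solver)
open +-*-Solver
import Data.Rational.Unnormalised as ℚᵘ
import Data.Rational.Unnormalised.Properties as ℚᵘP
open import Function using (_∘_)
open import Level using (0ℓ)
open import Relation.Binary.Definitions using (Tri; tri<; tri≈; tri>)
open import Relation.Binary.PropositionalEquality
open ≡-Reasoning
open import Relation.Nullary using (yes; no)

open import Algebra.Properties.CommutativeSemiring.Exp (CommutativeRing.commutativeSemiring ℚP.+-*-commutativeRing)
  using (_^_; ^-homo-*; ^-distrib-*)

open import Defs

*≡*⇒/≡/ : ∀ (i j : ℤ.ℤ) (c d : ℕ) .{{_ : ℕ.NonZero c}} .{{_ : ℕ.NonZero d}} →
      i ℤ.* ℤ.+ d ≡ j ℤ.* ℤ.+ c → i ℚ./ c ≡ j ℚ./ d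
*≡*⇒/≡/ i j (suc c) (suc d) eq = ℚP.fromℚᵘ-cong {ℚᵘ.mkℚᵘ i c} {ℚᵘ.mkℚᵘ j d} (ℚᵘ.*≡* eq)

toℚᵘ-/ : ∀ (i : ℤ.ℤ) (c : ℕ) .{{_ : ℕ.NonZero c}} → ℚ.toℚᵘ (i ℚ./ c) ℚᵘ.≃ i ℚᵘ./ c
toℚᵘ-/ i (suc c) = ℚP.toℚᵘ-fromℚᵘ (ℚᵘ.mkℚᵘ i c)

/-*-/ : ∀ (i j : ℤ.ℤ) (c d : ℕ) .{{_ : ℕ.NonZero c}} .{{_ : ℕ.NonZero d}} →
        (i ℚ./ c) * (j ℚ./ d) ≡ ((i ℤ.* j) ℚ./ (c ℕ.* d)) {{ℕP.m*n≢0 c d}}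
/-*-/ i j (suc c) (suc d) = ℚP.toℚᵘ-injective (ℚᵘP.≃-trans (ℚP.toℚᵘ-homo-* (i ℚ./ suc c) (j ℚ./ suc d))
  (ℚᵘP.≃-trans (ℚᵘP.*-cong (toℚᵘ-/ i (suc c)) (toℚᵘ-/ j (suc d)))
               (ℚᵘP.≃-sym (toℚᵘ-/ (i ℤ.* j) (suc c ℕ.* suc d) {{ℕP.m*n≢0 (suc c) (suc d)}}))))

/-+-/ : ∀ (i j : ℤ.ℤ) (c d : ℕ) .{{_ : ℕ.NonZero c}} .{{_ : ℕ.NonZero d}} →
        (i ℚ./ c) + (j ℚ./ d) ≡ ((i ℤ.* ℤ.+ d ℤ.+ j ℤ.* ℤ.+ c) ℚ./ (c ℕ.* d)) {{ℕP.m*n≢0 c d}}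
/-+-/ i j (suc c) (suc d) = ℚP.toℚᵘ-injective (ℚᵘP.≃-trans (ℚP.toℚᵘ-homo-+ (i ℚ./ suc c) (j ℚ./ suc d))
  (ℚᵘP.≃-trans (ℚᵘP.+-cong (toℚᵘ-/ i (suc c)) (toℚᵘ-/ j (suc d)))
               (ℚᵘP.≃-sym (toℚᵘ-/ (i ℤ.* ℤ.+ suc d ℤ.+ j ℤ.* ℤ.+ suc c) (suc c ℕ.* suc d) {{ℕP.m*n≢0 (suc c) (suc d)}}))))

1/ℕ : (n : ℕ) .{{_ : ℕ.NonZero n}} → ℚ
1/ℕ n = ℤ.+ 1 ℚ./ n

1/ℕ-* : ∀ m n .{{_ : ℕ.NonZero m}} .{{_ : ℕ.NonZero n}} →
        1/ℕ (m ℕ.* n) {{ℕP.m*n≢0 m n}} ≡ 1/ℕ m * 1/ℕ n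
1/ℕ-* m n = sym (/-*-/ (ℤ.+ 1) (ℤ.+ 1) m n)

natℚ-+ : ∀ m n → natℚ (m ℕ.+ n) ≡ natℚ m + natℚ n
natℚ-+ m n = trans (*≡*⇒/≡/ (ℤ.+ (m ℕ.+ n)) (ℤ.+ m ℤ.* ℤ.+ 1 ℤ.+ ℤ.+ n ℤ.* ℤ.+ 1) 1 1 (cong (ℤ._* ℤ.+ 1) (begin
    ℤ.+ (m ℕ.+ n)    ≡⟨ ℤP.pos-+ m n ⟩
    ℤ.+ m ℤ.+ ℤ.+ n  ≡⟨ sym (cong₂ ℤ._+_ (ℤP.*-identityʳ (ℤ.+ m)) (ℤP.*-identityʳ (ℤ.+ n))) ⟩
    ℤ.+ m ℤ.* ℤ.+ 1 ℤ.+ ℤ.+ n ℤ.* ℤ.+ 1 ∎)))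
  (sym (/-+-/ (ℤ.+ m) (ℤ.+ n) 1 1))

natℚ-* : ∀ m n → natℚ (m ℕ.* n) ≡ natℚ m * natℚ n
natℚ-* m n = sym (trans (/-*-/ (ℤ.+ m) (ℤ.+ n) 1 1) (ℚP./-cong (sym (ℤP.pos-* m n)) refl))

natℚ-suc : ∀ n → natℚ (suc n) ≡ 1ℚ + natℚ n
natℚ-suc = natℚ-+ 1

/≡natℚ*1/ℕ : ∀ a d .{{_ : ℕ.NonZero d}} → ℤ.+ a ℚ./ d ≡ natℚ a * 1/ℕ d
/≡natℚ*1/ℕ a d {{d≢0}} = trans (*≡*⇒/≡/ (ℤ.+ a) (ℤ.+ a ℤ.* ℤ.+ 1) d (1 ℕ.* d) {{d≢0}} {{ℕP.m*n≢0 1 d}}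
    (trans (cong (λ k → ℤ.+ a ℤ.* ℤ.+ k) (ℕP.*-identityˡ d)) (cong (ℤ._* ℤ.+ d) (sym (ℤP.*-identityʳ (ℤ.+ a))))))
  (sym (/-*-/ (ℤ.+ a) (ℤ.+ 1) 1 d))

natℚ*1/ℕ : ∀ n .{{_ : ℕ.NonZero n}} → natℚ n * 1/ℕ n ≡ 1ℚ
natℚ*1/ℕ n = trans (sym (/≡natℚ*1/ℕ n n)) (*≡*⇒/≡/ (ℤ.+ n) (ℤ.+ 1) n 1 (ℤP.*-comm (ℤ.+ n) (ℤ.+ 1)))

1/ℕ*natℚ : ∀ n .{{_ : ℕ.NonZero n}} → 1/ℕ n * natℚ n ≡ 1ℚ
1/ℕ*natℚ n = trans (ℚP.*-comm (1/ℕ n) (natℚ n)) (natℚ*1/ℕ n)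

natℚ*inv!-suc : ∀ n → natℚ (suc n) * inv! (suc n) ≡ inv! n
natℚ*inv!-suc n = begin
  natℚ (suc n) * inv! (suc n)            ≡⟨ cong (natℚ (suc n) *_) (1/ℕ-* (suc n) (n !) {{_}} {{n !≢0}}) ⟩
  natℚ (suc n) * (1/ℕ (suc n) * inv! n)  ≡⟨ sym (ℚP.*-assoc (natℚ (suc n)) (1/ℕ (suc n)) (inv! n)) ⟩
  natℚ (suc n) * 1/ℕ (suc n) * inv! n    ≡⟨ cong (_* inv! n) (natℚ*1/ℕ (suc n)) ⟩
  1ℚ * inv! n                            ≡⟨ ℚP.*-identityˡ (inv! n) ⟩
  inv! n ∎

inv!≢0 : ∀ n → inv! n ≢ 0ℚ
inv!≢0 n inv!≡0 = ℚP.1≢0 (begin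
  1ℚ                   ≡⟨ sym (natℚ*1/ℕ (n !) {{n !≢0}}) ⟩
  natℚ (n !) * inv! n  ≡⟨ cong (natℚ (n !) *_) inv!≡0 ⟩
  natℚ (n !) * 0ℚ      ≡⟨ ℚP.*-zeroʳ (natℚ (n !)) ⟩
  0ℚ ∎)

x*y≡0⇒y≡0 : ∀ {x y} → x ≢ 0ℚ → x * y ≡ 0ℚ → y ≡ 0ℚ
x*y≡0⇒y≡0 {x} {y} x≢0 xy≡0 = begin
  y              ≡⟨ sym (ℚP.*-identityˡ y) ⟩
  1ℚ * y         ≡⟨ cong (_* y) (sym (ℚP.*-inverseˡ x)) ⟩
  x⁻¹ * x * y    ≡⟨ ℚP.*-assoc x⁻¹ x y ⟩
  x⁻¹ * (x * y)  ≡⟨ cong (x⁻¹ *_) xy≡0 ⟩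
  x⁻¹ * 0ℚ       ≡⟨ ℚP.*-zeroʳ x⁻¹ ⟩
  0ℚ ∎
  where
  instance _ = ℚ.≢-nonZero x≢0
  x⁻¹ = ℚ.1/ x

1^n : ∀ n → 1ℚ ^ n ≡ 1ℚ
1^n zero    = refl
1^n (suc n) = trans (ℚP.*-identityˡ (1ℚ ^ n)) (1^n n)

^-inverse : ∀ a b n → a * b ≡ 1ℚ → a ^ n * b ^ n ≡ 1ℚ
^-inverse a b n ab≡1 = trans (sym (^-distrib-* a b n)) (trans (cong (_^ n) ab≡1) (1^n n))

signℚ≡-1^ : ∀ n → signℚ n ≡ (- 1ℚ) ^ n
signℚ≡-1^ zero    = refl
signℚ≡-1^ (suc n) = trans (cong -_ (signℚ≡-1^ n)) (solve 1 (λ x → :- x := (:- con 1ℚ) :* x) refl ((- 1ℚ) ^ n))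

signℚ-square : ∀ n → signℚ n * signℚ n ≡ 1ℚ
signℚ-square zero    = refl
signℚ-square (suc n) = trans (solve 1 (λ s → (:- s) :* (:- s) := s :* s) refl (signℚ n)) (signℚ-square n)

signℚ-odd : ∀ n → isEven n ≡ false → signℚ n ≡ - 1ℚ
signℚ-odd (suc zero)    _   = refl
signℚ-odd (suc (suc n)) odd = trans (solve 1 (λ s → :- (:- s) := s) refl (signℚ n)) (signℚ-odd n odd)

sum-cong< : ∀ n {f g : ℕ → ℚ} → (∀ i → i < n → f i ≡ g i) → sumℚ n f ≡ sumℚ n g
sum-cong< zero    f≡g = refl
sum-cong< (suc n) f≡g = cong₂ _+_ (sum-cong< n (λ i i<n → f≡g i (ℕP.m<n⇒m<1+n i<n))) (f≡g n ℕP.≤-refl)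

sum-cong : ∀ n {f g : ℕ → ℚ} → (∀ i → f i ≡ g i) → sumℚ n f ≡ sumℚ n g
sum-cong n f≡g = sum-cong< n (λ i _ → f≡g i)

sum-zero : ∀ n {f : ℕ → ℚ} → (∀ i → i < n → f i ≡ 0ℚ) → sumℚ n f ≡ 0ℚ
sum-zero zero    f≡0 = refl
sum-zero (suc n) f≡0 = cong₂ _+_ (sum-zero n (λ i i<n → f≡0 i (ℕP.m<n⇒m<1+n i<n))) (f≡0 n ℕP.≤-refl)

sum-+ : ∀ n (f g : ℕ → ℚ) → sumℚ n (λ i → f i + g i) ≡ sumℚ n f + sumℚ n g
sum-+ zero    f g = refl
sum-+ (suc n) f g = trans (cong (_+ (f n + g n)) (sum-+ n f g))
  (solve 4 (λ a b c d → (a :+ b) :+ (c :+ d) := (a :+ c) :+ (b :+ d)) refl (sumℚ n f) (sumℚ n g) (f n) (g n))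

*-distribˡ-sum : ∀ n (c : ℚ) (f : ℕ → ℚ) → c * sumℚ n f ≡ sumℚ n (λ i → c * f i)
*-distribˡ-sum zero    c f = ℚP.*-zeroʳ c
*-distribˡ-sum (suc n) c f = trans (ℚP.*-distribˡ-+ c (sumℚ n f) (f n)) (cong (_+ c * f n) (*-distribˡ-sum n c f))

*-distribʳ-sum : ∀ n (c : ℚ) (f : ℕ → ℚ) → sumℚ n f * c ≡ sumℚ n (λ i → f i * c)
*-distribʳ-sum n c f = trans (ℚP.*-comm (sumℚ n f) c)
  (trans (*-distribˡ-sum n c f) (sum-cong n (λ i → ℚP.*-comm c (f i))))

neg-distrib-sum : ∀ n (f : ℕ → ℚ) → - sumℚ n f ≡ sumℚ n (λ i → - f i)
neg-distrib-sum zero    f = refl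
neg-distrib-sum (suc n) f = trans (ℚP.neg-distrib-+ (sumℚ n f) (f n)) (cong (_+ - f n) (neg-distrib-sum n f))

sum-shift : ∀ n (f : ℕ → ℚ) → sumℚ (suc n) f ≡ f 0 + sumℚ n (λ i → f (suc i))
sum-shift zero    f = trans (ℚP.+-identityˡ (f 0)) (sym (ℚP.+-identityʳ (f 0)))
sum-shift (suc n) f = trans (cong (_+ f (suc n)) (sum-shift n f))
  (ℚP.+-assoc (f 0) (sumℚ n (λ i → f (suc i))) (f (suc n)))

sum-swap : ∀ m n (f : ℕ → ℕ → ℚ) →
           sumℚ m (λ i → sumℚ n (λ j → f i j)) ≡ sumℚ n (λ j → sumℚ m (λ i → f i j))
sum-swap zero    n f = sym (sum-zero n (λ _ _ → refl))
sum-swap (suc m) n f = trans (cong (_+ sumℚ n (f m)) (sum-swap m n f))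
  (sym (sum-+ n (λ j → sumℚ m (λ i → f i j)) (f m)))

sum-*-sum : ∀ m n (a b : ℕ → ℚ) (c : ℕ → ℕ → ℚ) →
  sumℚ m (λ i → a i * sumℚ n (λ j → b j * c i j)) ≡ sumℚ n (λ j → b j * sumℚ m (λ i → a i * c i j))
sum-*-sum m n a b c = begin
  sumℚ m (λ i → a i * sumℚ n (λ j → b j * c i j))
    ≡⟨ sum-cong m (λ i → *-distribˡ-sum n (a i) (λ j → b j * c i j)) ⟩
  sumℚ m (λ i → sumℚ n (λ j → a i * (b j * c i j)))
    ≡⟨ sum-swap m n (λ i j → a i * (b j * c i j)) ⟩
  sumℚ n (λ j → sumℚ m (λ i → a i * (b j * c i j)))
    ≡⟨ sum-cong n (λ j → trans (sum-cong m (λ i → solve 3 (λ a b c → a :* (b :* c) := b :* (a :* c)) refl (a i) (b j) (c i j)))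
                               (sym (*-distribˡ-sum m (b j) (λ i → a i * c i j)))) ⟩
  sumℚ n (λ j → b j * sumℚ m (λ i → a i * c i j)) ∎

sum-reverse : ∀ n (f : ℕ → ℚ) → sumℚ n f ≡ sumℚ n (λ i → f (n ∸ suc i))
sum-reverse zero    f = refl
sum-reverse (suc n) f = trans (cong (_+ f n) (sum-reverse n f))
  (trans (ℚP.+-comm (sumℚ n (λ i → f (n ∸ suc i))) (f n)) (sym (sum-shift n (λ i → f (suc n ∸ suc i)))))

sum-truncate : ∀ n m (f : ℕ → ℚ) → m ≤ n → (∀ i → m ≤ i → i < n → f i ≡ 0ℚ) → sumℚ n f ≡ sumℚ m f
sum-truncate n m f m≤n f≡0 with m ℕP.≟ n
... | yes refl = refl
sum-truncate (suc n) m f m≤1+n f≡0 | no m≢1+n =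
  trans (cong₂ _+_ (sum-truncate n m f m≤n (λ i m≤i i<n → f≡0 i m≤i (ℕP.m<n⇒m<1+n i<n))) (f≡0 n m≤n ℕP.≤-refl))
        (ℚP.+-identityʳ (sumℚ m f))
  where
  m≤n : m ≤ n
  m≤n = ℕP.≤-pred (ℕP.≤∧≢⇒< m≤1+n m≢1+n)
sum-truncate zero .zero f z≤n f≡0 | no 0≢0 = ⊥-elim (0≢0 refl)

sum-triangle : ∀ n (f : ℕ → ℕ → ℚ) →
  sumℚ (suc n) (λ i → sumℚ (suc i) (λ a → f a (i ∸ a))) ≡ sumℚ (suc n) (λ a → sumℚ (suc (n ∸ a)) (f a))
sum-triangle zero    f = refl
sum-triangle (suc n) f = begin
  sumℚ (suc n) (λ i → sumℚ (suc i) (λ a → f a (i ∸ a))) + (diagonal + f (suc n) (n ∸ n))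
    ≡⟨ cong (_+ (diagonal + f (suc n) (n ∸ n))) (sum-triangle n f) ⟩
  rows + (diagonal + f (suc n) (n ∸ n))
    ≡⟨ sym (ℚP.+-assoc rows diagonal _) ⟩
  (rows + diagonal) + f (suc n) (n ∸ n)
    ≡⟨ cong₂ _+_ (sym (sum-+ (suc n) (λ a → sumℚ (suc (n ∸ a)) (f a)) (λ a → f a (suc n ∸ a))))
                 (trans (sym (ℚP.+-identityˡ _)) (cong (λ k → sumℚ k (f (suc n)) + f (suc n) (n ∸ n)) (sym (ℕP.n∸n≡0 n)))) ⟩
  sumℚ (suc n) (λ a → sumℚ (suc (n ∸ a)) (f a) + f a (suc n ∸ a)) + sumℚ (suc (n ∸ n)) (f (suc n))
    ≡⟨ cong (_+ sumℚ (suc (n ∸ n)) (f (suc n))) (sum-cong< (suc n) (λ a a<1+n →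
         cong (λ k → sumℚ k (f a) + f a (suc n ∸ a)) (sym (ℕP.+-∸-assoc 1 (ℕP.≤-pred a<1+n))))) ⟩
  sumℚ (suc (suc n)) (λ a → sumℚ (suc (suc n ∸ a)) (f a)) ∎
  where
  rows = sumℚ (suc n) (λ a → sumℚ (suc (n ∸ a)) (f a))
  diagonal = sumℚ (suc n) (λ a → f a (suc n ∸ a))

δ : ℕ → ℕ → ℚ
δ i j = if i ℕ.≡ᵇ j then 1ℚ else 0ℚ

δ-refl : ∀ i → δ i i ≡ 1ℚ
δ-refl zero    = refl
δ-refl (suc i) = δ-refl i

δ-≢ : ∀ {i j} → i ≢ j → δ i j ≡ 0ℚ
δ-≢ {i} {j} i≢j with i ℕ.≡ᵇ j in eq
... | true  = ⊥-elim (i≢j (ℕP.≡ᵇ⇒≡ i j (subst Data.Bool.T (sym eq) _)))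
... | false = refl

δ-sym : ∀ i j → δ i j ≡ δ j i
δ-sym i j with i ℕP.≟ j
... | yes refl = refl
... | no i≢j   = trans (δ-≢ i≢j) (sym (δ-≢ (i≢j ∘ sym)))

δ*-swap : ∀ l m (f : ℕ → ℚ) → δ m l * f m ≡ δ l m * f l
δ*-swap l m f with l ℕP.≟ m
... | yes refl = refl
... | no l≢m   = trans (cong (_* f m) (δ-≢ (l≢m ∘ sym))) (trans (ℚP.*-zeroˡ (f m)) (sym (trans (cong (_* f l) (δ-≢ l≢m)) (ℚP.*-zeroˡ (f l)))))

sum-δ : ∀ n j (f : ℕ → ℚ) → j < n → sumℚ n (λ i → f i * δ i j) ≡ f j
sum-δ (suc n) j f j<1+n with j ℕP.≟ n
... | yes refl = begin
  sumℚ j (λ i → f i * δ i j) + f j * δ j j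
    ≡⟨ cong₂ _+_ (sum-zero j (λ i i<j → trans (cong (f i *_) (δ-≢ (ℕP.<⇒≢ i<j))) (ℚP.*-zeroʳ (f i))))
                 (trans (cong (f j *_) (δ-refl j)) (ℚP.*-identityʳ (f j))) ⟩
  0ℚ + f j  ≡⟨ ℚP.+-identityˡ (f j) ⟩
  f j ∎
... | no j≢n = begin
  sumℚ n (λ i → f i * δ i j) + f n * δ n j
    ≡⟨ cong₂ _+_ (sum-δ n j f (ℕP.≤∧≢⇒< (ℕP.≤-pred j<1+n) j≢n))
                 (trans (cong (f n *_) (δ-≢ (j≢n ∘ sym))) (ℚP.*-zeroʳ (f n))) ⟩
  f j + 0ℚ  ≡⟨ ℚP.+-identityʳ (f j) ⟩
  f j ∎

-- Inverting a matrix through a biorthogonality relation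

module _ (L : ℕ) (P Q V : ℕ → ℕ → ℚ) (h w : ℕ → ℚ)
         (P-upper : ∀ r l → l < r → P r l ≡ 0ℚ)
         (P-diagonal≢0 : ∀ l → P l l ≢ 0ℚ)
         (h*w≡1 : ∀ l → l < L → h l * w l ≡ 1ℚ)
         (biorthogonal : ∀ l m → l < L → m < L → sumℚ L (λ r → P r l * sumℚ L (λ s → V r s * Q s m)) ≡ δ l m * h l)
         where

  private
    W : ℕ → ℕ → ℚ
    W s j = sumℚ L (λ ℓ → Q s ℓ * w ℓ * P j ℓ)

    VW-error : ℕ → ℕ → ℚ
    VW-error i j = sumℚ L (λ s → V i s * W s j) - δ i j

    Pᵀ-VW : ∀ p j → p < L → sumℚ L (λ i → P i p * sumℚ L (λ s → V i s * W s j)) ≡ P j p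
    Pᵀ-VW p j p<L = begin
      sumℚ L (λ i → P i p * sumℚ L (λ s → V i s * W s j))
        ≡⟨ sum-cong L (λ i → cong (P i p *_) (trans (sum-cong L (λ s → cong (V i s *_)
             (sum-cong L (λ ℓ → solve 3 (λ q w p → q :* w :* p := w :* p :* q) refl (Q s ℓ) (w ℓ) (P j ℓ)))))
             (sum-*-sum L L (V i) (λ ℓ → w ℓ * P j ℓ) Q))) ⟩
      sumℚ L (λ i → P i p * sumℚ L (λ ℓ → w ℓ * P j ℓ * sumℚ L (λ s → V i s * Q s ℓ)))
        ≡⟨ sum-*-sum L L (λ i → P i p) (λ ℓ → w ℓ * P j ℓ) (λ i ℓ → sumℚ L (λ s → V i s * Q s ℓ)) ⟩
      sumℚ L (λ ℓ → w ℓ * P j ℓ * sumℚ L (λ i → P i p * sumℚ L (λ s → V i s * Q s ℓ)))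
        ≡⟨ sum-cong< L (λ ℓ ℓ<L → trans (cong (w ℓ * P j ℓ *_) (trans (biorthogonal p ℓ p<L ℓ<L) (cong (_* h p) (δ-sym p ℓ))))
                                        (solve 4 (λ a b d c → a :* b :* (d :* c) := a :* b :* c :* d) refl (w ℓ) (P j ℓ) (δ ℓ p) (h p))) ⟩
      sumℚ L (λ ℓ → w ℓ * P j ℓ * h p * δ ℓ p)
        ≡⟨ sum-δ L p (λ ℓ → w ℓ * P j ℓ * h p) p<L ⟩
      w p * P j p * h p
        ≡⟨ trans (solve 3 (λ a b c → a :* b :* c := b :* (c :* a)) refl (w p) (P j p) (h p))
                 (trans (cong (P j p *_) (h*w≡1 p p<L)) (ℚP.*-identityʳ (P j p))) ⟩
      P j p ∎

    Pᵀ-error : ∀ p j → p < L → j < L → sumℚ L (λ i → P i p * VW-error i j) ≡ 0ℚ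
    Pᵀ-error p j p<L j<L = begin
      sumℚ L (λ i → P i p * VW-error i j)
        ≡⟨ sum-cong L (λ i → ℚP.*-distribˡ-+ (P i p) (sumℚ L (λ s → V i s * W s j)) (- δ i j)) ⟩
      sumℚ L (λ i → P i p * sumℚ L (λ s → V i s * W s j) + P i p * - δ i j)
        ≡⟨ sum-+ L (λ i → P i p * sumℚ L (λ s → V i s * W s j)) (λ i → P i p * - δ i j) ⟩
      sumℚ L (λ i → P i p * sumℚ L (λ s → V i s * W s j)) + sumℚ L (λ i → P i p * - δ i j)
        ≡⟨ cong₂ _+_ (Pᵀ-VW p j p<L) (trans (sum-cong L (λ i → sym (ℚP.neg-distribʳ-* (P i p) (δ i j))))
                                       (trans (sym (neg-distrib-sum L (λ i → P i p * δ i j))) (cong -_ (sum-δ L j (λ i → P i p) j<L)))) ⟩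
      P j p + - P j p
        ≡⟨ ℚP.+-inverseʳ (P j p) ⟩
      0ℚ ∎

    -- Row i of Pᵀ(VW - I) reduces to P i i times row i of VW - I, the earlier rows vanishing
    -- by induction and the later entries of column i of P being zero.
    error-vanishes : ∀ j → j < L → ∀ n → n ≤ L → ∀ i → i < n → VW-error i j ≡ 0ℚ
    error-vanishes j j<L (suc n) 1+n≤L i i<1+n with i ℕP.≟ n
    ... | no i≢n   = error-vanishes j j<L n (ℕP.<⇒≤ 1+n≤L) i (ℕP.≤∧≢⇒< (ℕP.≤-pred i<1+n) i≢n)
    ... | yes refl = x*y≡0⇒y≡0 (P-diagonal≢0 i) (begin
      P i i * VW-error i j
        ≡⟨ sym (ℚP.+-identityˡ _) ⟩
      0ℚ + P i i * VW-error i j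
        ≡⟨ cong (_+ P i i * VW-error i j) (sym (sum-zero i (λ k k<i → trans (cong (P k i *_) (error-vanishes j j<L i (ℕP.<⇒≤ 1+n≤L) k k<i))
                                                                          (ℚP.*-zeroʳ (P k i))))) ⟩
      sumℚ (suc i) (λ k → P k i * VW-error k j)
        ≡⟨ sym (sum-truncate L (suc i) (λ k → P k i * VW-error k j) 1+n≤L
                 (λ k i<k _ → trans (cong (_* VW-error k j) (P-upper k i i<k)) (ℚP.*-zeroˡ (VW-error k j)))) ⟩
      sumℚ L (λ k → P k i * VW-error k j)
        ≡⟨ Pᵀ-error i j 1+n≤L j<L ⟩
      0ℚ ∎)

  biorthogonal⇒right-inverse : ∀ i j → i < L → j < L → sumℚ L (λ s → V i s * sumℚ L (λ ℓ → Q s ℓ * w ℓ * P j ℓ)) ≡ δ i j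
  biorthogonal⇒right-inverse i j i<L j<L = begin
    VW                    ≡⟨ solve 2 (λ a d → a := (a :- d) :+ d) refl VW (δ i j) ⟩
    VW-error i j + δ i j  ≡⟨ cong (_+ δ i j) (error-vanishes j j<L L ℕP.≤-refl i i<L) ⟩
    0ℚ + δ i j            ≡⟨ ℚP.+-identityˡ (δ i j) ⟩
    δ i j ∎
    where VW = sumℚ L (λ s → V i s * W s j)

-G_ : ℚ[i] → ℚ[i]
-G (a +i b) = (- a) +i (- b)

1G : ℚ[i]
1G = 1ℚ +i 0ℚ

ι : ℚ → ℚ[i]
ι a = a +i 0ℚ

ℚ[i]-isCommutativeRing : IsCommutativeRing _≡_ _+G_ _*G_ -G_ 0G 1G
ℚ[i]-isCommutativeRing = record
  { isRing = record
    { +-isAbelianGroup = record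
      { isGroup = record
        { isMonoid = record
          { isSemigroup = record
            { isMagma = record { isEquivalence = isEquivalence ; ∙-cong = cong₂ _+G_ }
            ; assoc = λ { (a +i b) (c +i d) (e +i f) → cong₂ _+i_ (ℚP.+-assoc a c e) (ℚP.+-assoc b d f) } }
          ; identity = (λ { (a +i b) → cong₂ _+i_ (ℚP.+-identityˡ a) (ℚP.+-identityˡ b) })
                     , (λ { (a +i b) → cong₂ _+i_ (ℚP.+-identityʳ a) (ℚP.+-identityʳ b) }) }
        ; inverse = (λ { (a +i b) → cong₂ _+i_ (ℚP.+-inverseˡ a) (ℚP.+-inverseˡ b) })
                  , (λ { (a +i b) → cong₂ _+i_ (ℚP.+-inverseʳ a) (ℚP.+-inverseʳ b) })
        ; ⁻¹-cong = cong -G_ }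
      ; comm = λ { (a +i b) (c +i d) → cong₂ _+i_ (ℚP.+-comm a c) (ℚP.+-comm b d) } }
    ; *-cong = cong₂ _*G_
    ; *-assoc = λ { (a +i b) (c +i d) (e +i f) → cong₂ _+i_
        (solve 6 (λ a b c d e f → (a :* c :- b :* d) :* e :- (a :* d :+ b :* c) :* f := a :* (c :* e :- d :* f) :- b :* (c :* f :+ d :* e)) refl a b c d e f)
        (solve 6 (λ a b c d e f → (a :* c :- b :* d) :* f :+ (a :* d :+ b :* c) :* e := a :* (c :* f :+ d :* e) :+ b :* (c :* e :- d :* f)) refl a b c d e f) }
    ; *-identity = (λ { (a +i b) → cong₂ _+i_ (solve 2 (λ a b → con 1ℚ :* a :- con 0ℚ :* b := a) refl a b)
                                             (solve 2 (λ a b → con 1ℚ :* b :+ con 0ℚ :* a := b) refl a b) })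
                 , (λ { (a +i b) → cong₂ _+i_ (solve 2 (λ a b → a :* con 1ℚ :- b :* con 0ℚ := a) refl a b)
                                             (solve 2 (λ a b → a :* con 0ℚ :+ b :* con 1ℚ := b) refl a b) })
    ; distrib = (λ { (a +i b) (c +i d) (e +i f) → cong₂ _+i_
                    (solve 6 (λ a b c d e f → a :* (c :+ e) :- b :* (d :+ f) := (a :* c :- b :* d) :+ (a :* e :- b :* f)) refl a b c d e f)
                    (solve 6 (λ a b c d e f → a :* (d :+ f) :+ b :* (c :+ e) := (a :* d :+ b :* c) :+ (a :* f :+ b :* e)) refl a b c d e f) })
              , (λ { (a +i b) (c +i d) (e +i f) → cong₂ _+i_
                    (solve 6 (λ a b c d e f → (c :+ e) :* a :- (d :+ f) :* b := (c :* a :- d :* b) :+ (e :* a :- f :* b)) refl a b c d e f)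
                    (solve 6 (λ a b c d e f → (c :+ e) :* b :+ (d :+ f) :* a := (c :* b :+ d :* a) :+ (e :* b :+ f :* a)) refl a b c d e f) }) }
  ; *-comm = λ { (a +i b) (c +i d) → cong₂ _+i_ (solve 4 (λ a b c d → a :* c :- b :* d := c :* a :- d :* b) refl a b c d)
                                                (solve 4 (λ a b c d → a :* d :+ b :* c := c :* b :+ d :* a) refl a b c d) } }

ℚ[i]-commutativeRing : CommutativeRing 0ℓ 0ℓ
ℚ[i]-commutativeRing = record { isCommutativeRing = ℚ[i]-isCommutativeRing }

open CommutativeRing ℚ[i]-commutativeRing using ()
  renaming (*-comm to *G-comm; *-assoc to *G-assoc; *-identityˡ to *G-identityˡ; *-identityʳ to *G-identityʳ;
            zeroˡ to *G-zeroˡ; zeroʳ to *G-zeroʳ; +-identityˡ to +G-identityˡ; +-identityʳ to +G-identityʳ)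
open import Algebra.Properties.CommutativeSemiring.Exp (CommutativeRing.commutativeSemiring ℚ[i]-commutativeRing)
  using () renaming (_^_ to infixr 30 _^G_; ^-homo-* to ^G-homo-*; ^-distrib-* to ^G-distrib-*)
open import Algebra.Properties.CommutativeSemigroup (CommutativeRing.*-commutativeSemigroup ℚ[i]-commutativeRing)
  using (interchange)

·G≡ι*G : ∀ a z → a ·G z ≡ ι a *G z
·G≡ι*G a (x +i y) = cong₂ _+i_ (solve 3 (λ a x y → a :* x := a :* x :- con 0ℚ :* y) refl a x y)
                                (solve 3 (λ a x y → a :* y := a :* y :+ con 0ℚ :* x) refl a x y)

ι-* : ∀ a b → ι (a * b) ≡ ι a *G ι b
ι-* a b = cong₂ _+i_ (solve 2 (λ a b → a :* b := a :* b :- con 0ℚ :* con 0ℚ) refl a b)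
                      (solve 2 (λ a b → con 0ℚ := a :* con 0ℚ :+ con 0ℚ :* b) refl a b)

ι-^ : ∀ a n → ι a ^G n ≡ ι (a ^ n)
ι-^ a zero    = refl
ι-^ a (suc n) = trans (cong (ι a *G_) (ι-^ a n)) (sym (ι-* a (a ^ n)))

·G-assoc : ∀ a b z → a ·G (b ·G z) ≡ (a * b) ·G z
·G-assoc a b (x +i y) = cong₂ _+i_ (sym (ℚP.*-assoc a b x)) (sym (ℚP.*-assoc a b y))

·G-*G : ∀ a z w → (a ·G z) *G w ≡ a ·G (z *G w)
·G-*G a z w = begin
  (a ·G z) *G w    ≡⟨ cong (_*G w) (·G≡ι*G a z) ⟩
  (ι a *G z) *G w  ≡⟨ *G-assoc (ι a) z w ⟩
  ι a *G (z *G w)  ≡⟨ sym (·G≡ι*G a (z *G w)) ⟩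
  a ·G (z *G w) ∎

·G-*G-·G : ∀ a b z w → (a ·G z) *G (b ·G w) ≡ (a * b) ·G (z *G w)
·G-*G-·G a b z w = begin
  (a ·G z) *G (b ·G w)      ≡⟨ cong₂ _*G_ (·G≡ι*G a z) (·G≡ι*G b w) ⟩
  (ι a *G z) *G (ι b *G w)  ≡⟨ interchange (ι a) z (ι b) w ⟩
  (ι a *G ι b) *G (z *G w)  ≡⟨ cong (_*G (z *G w)) (sym (ι-* a b)) ⟩
  ι (a * b) *G (z *G w)     ≡⟨ sym (·G≡ι*G (a * b) (z *G w)) ⟩
  (a * b) ·G (z *G w) ∎

*G-ι : ∀ z a → z *G ι a ≡ a ·G z
*G-ι z a = trans (*G-comm z (ι a)) (sym (·G≡ι*G a z))

·G-distribʳ : ∀ a b z → (a ·G z) +G (b ·G z) ≡ (a + b) ·G z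
·G-distribʳ a b (x +i y) = cong₂ _+i_ (sym (ℚP.*-distribʳ-+ x a b)) (sym (ℚP.*-distribʳ-+ y a b))

0·G : ∀ z → 0ℚ ·G z ≡ 0G
0·G (x +i y) = cong₂ _+i_ (ℚP.*-zeroˡ x) (ℚP.*-zeroˡ y)

1·G : ∀ z → 1ℚ ·G z ≡ z
1·G (x +i y) = cong₂ _+i_ (ℚP.*-identityˡ x) (ℚP.*-identityˡ y)

·G-zeroʳ : ∀ a → a ·G 0G ≡ 0G
·G-zeroʳ a = cong₂ _+i_ (ℚP.*-zeroʳ a) (ℚP.*-zeroʳ a)

conj-*G : ∀ z w → conj (z *G w) ≡ conj z *G conj w
conj-*G (a +i b) (c +i d) = cong₂ _+i_ (solve 4 (λ a b c d → a :* c :- b :* d := a :* c :- (:- b) :* (:- d)) refl a b c d)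
                                       (solve 4 (λ a b c d → :- (a :* d :+ b :* c) := a :* (:- d) :+ (:- b) :* c) refl a b c d)

conj-^G : ∀ z n → conj (z ^G n) ≡ conj z ^G n
conj-^G z zero    = refl
conj-^G z (suc n) = trans (conj-*G z (z ^G n)) (cong (conj z *G_) (conj-^G z n))

conj-·G : ∀ a z → conj (a ·G z) ≡ a ·G conj z
conj-·G a (x +i y) = cong ((a * x) +i_) (ℚP.neg-distribʳ-* a y)

sumG-cong : ∀ n {f g : ℕ → ℚ[i]} → (∀ i → f i ≡ g i) → sumG n f ≡ sumG n g
sumG-cong zero    f≡g = refl
sumG-cong (suc n) f≡g = cong₂ _+G_ (sumG-cong n f≡g) (f≡g n)

sumG-zero : ∀ n {f : ℕ → ℚ[i]} → (∀ i → i < n → f i ≡ 0G) → sumG n f ≡ 0G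
sumG-zero zero    f≡0 = refl
sumG-zero (suc n) f≡0 = trans (cong₂ _+G_ (sumG-zero n (λ i i<n → f≡0 i (ℕP.m<n⇒m<1+n i<n))) (f≡0 n ℕP.≤-refl)) (+G-identityˡ 0G)

sumG-·G : ∀ n (c : ℕ → ℚ) z → sumG n (λ l → c l ·G z) ≡ sumℚ n c ·G z
sumG-·G zero    c (x +i y) = cong₂ _+i_ (sym (ℚP.*-zeroˡ x)) (sym (ℚP.*-zeroˡ y))
sumG-·G (suc n) c (x +i y) = trans (cong (_+G (c n ·G (x +i y))) (sumG-·G n c (x +i y)))
  (cong₂ _+i_ (sym (ℚP.*-distribʳ-+ x (sumℚ n c) (c n))) (sym (ℚP.*-distribʳ-+ y (sumℚ n c) (c n))))

1G^ : ∀ n → 1G ^G n ≡ 1G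
1G^ zero    = refl
1G^ (suc n) = trans (*G-identityˡ (1G ^G n)) (1G^ n)

^G-inverse : ∀ {x y} → x *G y ≡ 1G → ∀ n → x ^G n *G y ^G n ≡ 1G
^G-inverse {x} {y} xy≡1 n = trans (sym (^G-distrib-* x y n)) (trans (cong (_^G n) xy≡1) (1G^ n))

^G-cancel : ∀ {x y} → x *G y ≡ 1G → ∀ i l j → x ^G (i ℕ.+ l) *G y ^G (l ℕ.+ j) ≡ x ^G i *G y ^G j
^G-cancel {x} {y} xy≡1 i l j = begin
  x ^G (i ℕ.+ l) *G y ^G (l ℕ.+ j)          ≡⟨ cong₂ _*G_ (^G-homo-* x i l) (^G-homo-* y l j) ⟩
  (x ^G i *G x ^G l) *G (y ^G l *G y ^G j)  ≡⟨ *G-assoc (x ^G i) (x ^G l) (y ^G l *G y ^G j) ⟩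
  x ^G i *G (x ^G l *G (y ^G l *G y ^G j))  ≡⟨ cong (x ^G i *G_) (sym (*G-assoc (x ^G l) (y ^G l) (y ^G j))) ⟩
  x ^G i *G ((x ^G l *G y ^G l) *G y ^G j)  ≡⟨ cong (λ u → x ^G i *G (u *G y ^G j)) (^G-inverse xy≡1 l) ⟩
  x ^G i *G (1G *G y ^G j)                  ≡⟨ cong (x ^G i *G_) (*G-identityˡ (y ^G j)) ⟩
  x ^G i *G y ^G j ∎

-- Formal power series

infix 4 _≈_
_≈_ : Series → Series → Set
f ≈ g = ∀ n → f n ≡ g n

≈-trans : ∀ {f g h} → f ≈ g → g ≈ h → f ≈ h
≈-trans f≈g g≈h n = trans (f≈g n) (g≈h n)

infixl 6 _⊕_
_⊕_ : Series → Series → Series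
(f ⊕ g) n = f n + g n

infixr 7 _·_
_·_ : ℚ → Series → Series
(c · f) n = c * f n

∂ : Series → Series
∂ f n = natℚ (suc n) * f (suc n)

⊛-congˡ : ∀ {f f′} g → f ≈ f′ → f ⊛ g ≈ f′ ⊛ g
⊛-congˡ g f≈f′ n = sum-cong (suc n) (λ i → cong (_* g (n ∸ i)) (f≈f′ i))

⊛-congʳ : ∀ f {g g′} → g ≈ g′ → f ⊛ g ≈ f ⊛ g′
⊛-congʳ f g≈g′ n = sum-cong (suc n) (λ i → cong (f i *_) (g≈g′ (n ∸ i)))

⊛-cong≤ : ∀ f {g g′} n → (∀ i → i ≤ n → g i ≡ g′ i) → (f ⊛ g) n ≡ (f ⊛ g′) n
⊛-cong≤ f n g≡g′ = sum-cong (suc n) (λ i → cong (f i *_) (g≡g′ (n ∸ i) (ℕP.m∸n≤m n i)))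

⊛-comm : ∀ f g → f ⊛ g ≈ g ⊛ f
⊛-comm f g n = trans (sum-reverse (suc n) (λ i → f i * g (n ∸ i)))
  (sum-cong< (suc n) (λ i i<1+n → trans (cong (λ k → f (n ∸ i) * g k) (ℕP.m∸[m∸n]≡n (ℕP.≤-pred i<1+n)))
                                         (ℚP.*-comm (f (n ∸ i)) (g i))))

⊛-assoc : ∀ f g h → (f ⊛ g) ⊛ h ≈ f ⊛ (g ⊛ h)
⊛-assoc f g h n = begin
  sumℚ (suc n) (λ i → sumℚ (suc i) (λ a → f a * g (i ∸ a)) * h (n ∸ i))
    ≡⟨ sum-cong< (suc n) (λ i i<1+n → trans (*-distribʳ-sum (suc i) (h (n ∸ i)) (λ a → f a * g (i ∸ a)))
         (sum-cong< (suc i) (λ a a<1+i → cong (λ k → f a * g (i ∸ a) * h k) (split (ℕP.≤-pred a<1+i))))) ⟩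
  sumℚ (suc n) (λ i → sumℚ (suc i) (λ a → f a * g (i ∸ a) * h (n ∸ a ∸ (i ∸ a))))
    ≡⟨ sum-triangle n (λ a b → f a * g b * h (n ∸ a ∸ b)) ⟩
  sumℚ (suc n) (λ a → sumℚ (suc (n ∸ a)) (λ b → f a * g b * h (n ∸ a ∸ b)))
    ≡⟨ sum-cong (suc n) (λ a → trans (sum-cong (suc (n ∸ a)) (λ b → ℚP.*-assoc (f a) (g b) _))
                                      (sym (*-distribˡ-sum (suc (n ∸ a)) (f a) (λ b → g b * h (n ∸ a ∸ b))))) ⟩
  sumℚ (suc n) (λ a → f a * (g ⊛ h) (n ∸ a)) ∎
  where
  split : ∀ {a i} → a ≤ i → n ∸ i ≡ n ∸ a ∸ (i ∸ a)
  split {a} {i} a≤i = trans (cong (n ∸_) (sym (ℕP.m+[n∸m]≡n a≤i))) (sym (ℕP.∸-+-assoc n a (i ∸ a)))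

⊛-distribˡ-⊕ : ∀ f g h → f ⊛ (g ⊕ h) ≈ f ⊛ g ⊕ f ⊛ h
⊛-distribˡ-⊕ f g h n = trans (sum-cong (suc n) (λ i → ℚP.*-distribˡ-+ (f i) (g (n ∸ i)) (h (n ∸ i))))
  (sum-+ (suc n) (λ i → f i * g (n ∸ i)) (λ i → f i * h (n ∸ i)))

⊛-distribʳ-⊕ : ∀ f g h → (g ⊕ h) ⊛ f ≈ g ⊛ f ⊕ h ⊛ f
⊛-distribʳ-⊕ f g h n = trans (sum-cong (suc n) (λ i → ℚP.*-distribʳ-+ (f (n ∸ i)) (g i) (h i)))
  (sum-+ (suc n) (λ i → g i * f (n ∸ i)) (λ i → h i * f (n ∸ i)))

⊛-·ˡ : ∀ c f g → (c · f) ⊛ g ≈ c · (f ⊛ g)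
⊛-·ˡ c f g n = trans (sum-cong (suc n) (λ i → ℚP.*-assoc c (f i) (g (n ∸ i))))
  (sym (*-distribˡ-sum (suc n) c (λ i → f i * g (n ∸ i))))

⊛-·ʳ : ∀ c f g → f ⊛ (c · g) ≈ c · (f ⊛ g)
⊛-·ʳ c f g n = trans (sum-cong (suc n) (λ i → solve 3 (λ c x y → x :* (c :* y) := c :* (x :* y)) refl c (f i) (g (n ∸ i))))
  (sym (*-distribˡ-sum (suc n) c (λ i → f i * g (n ∸ i))))

⊛-identityˡ : ∀ f → unitS ⊛ f ≈ f
⊛-identityˡ f n = trans (sum-shift n (λ i → unitS i * f (n ∸ i)))
  (trans (cong₂ _+_ (ℚP.*-identityˡ (f n)) (sum-zero n (λ i _ → ℚP.*-zeroˡ (f (n ∸ suc i))))) (ℚP.+-identityʳ (f n)))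

⊛-identityʳ : ∀ f → f ⊛ unitS ≈ f
⊛-identityʳ f = ≈-trans (⊛-comm f unitS) (⊛-identityˡ f)

∂-cong : ∀ {f g} → f ≈ g → ∂ f ≈ ∂ g
∂-cong f≈g n = cong (natℚ (suc n) *_) (f≈g (suc n))

∂-⊕ : ∀ f g → ∂ (f ⊕ g) ≈ ∂ f ⊕ ∂ g
∂-⊕ f g n = ℚP.*-distribˡ-+ (natℚ (suc n)) (f (suc n)) (g (suc n))

∂-· : ∀ c f → ∂ (c · f) ≈ c · ∂ f
∂-· c f n = solve 3 (λ c k x → k :* (c :* x) := c :* (k :* x)) refl c (natℚ (suc n)) (f (suc n))

∂-unitS : ∀ n → ∂ unitS n ≡ 0ℚ
∂-unitS n = ℚP.*-zeroʳ (natℚ (suc n))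

∂-⊛ : ∀ f g → ∂ (f ⊛ g) ≈ ∂ f ⊛ g ⊕ f ⊛ ∂ g
∂-⊛ f g n = begin
  natℚ (suc n) * sumℚ (suc (suc n)) T
    ≡⟨ *-distribˡ-sum (suc (suc n)) (natℚ (suc n)) T ⟩
  sumℚ (suc (suc n)) (λ i → natℚ (suc n) * T i)
    ≡⟨ sum-cong< (suc (suc n)) (λ i i≤1+n → trans (cong (_* T i) (split (ℕP.≤-pred i≤1+n)))
                                                  (ℚP.*-distribʳ-+ (T i) (natℚ i) (natℚ (suc n ∸ i)))) ⟩
  sumℚ (suc (suc n)) (λ i → natℚ i * T i + natℚ (suc n ∸ i) * T i)
    ≡⟨ sum-+ (suc (suc n)) (λ i → natℚ i * T i) (λ i → natℚ (suc n ∸ i) * T i) ⟩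
  sumℚ (suc (suc n)) (λ i → natℚ i * T i) + sumℚ (suc (suc n)) (λ i → natℚ (suc n ∸ i) * T i)
    ≡⟨ cong₂ _+_ left right ⟩
  (∂ f ⊛ g) n + (f ⊛ ∂ g) n ∎
  where
  T : ℕ → ℚ
  T i = f i * g (suc n ∸ i)
  split : ∀ {i} → i ≤ suc n → natℚ (suc n) ≡ natℚ i + natℚ (suc n ∸ i)
  split {i} i≤1+n = trans (cong natℚ (sym (ℕP.m+[n∸m]≡n i≤1+n))) (natℚ-+ i (suc n ∸ i))
  S′ = sumℚ (suc n) (λ i → natℚ (suc i) * T (suc i))
  left : sumℚ (suc (suc n)) (λ i → natℚ i * T i) ≡ (∂ f ⊛ g) n
  left = begin
    sumℚ (suc (suc n)) (λ i → natℚ i * T i)  ≡⟨ sum-shift (suc n) (λ i → natℚ i * T i) ⟩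
    0ℚ * T 0 + sumℚ (suc n) (λ i → natℚ (suc i) * T (suc i))
      ≡⟨ trans (cong (_+ S′) (ℚP.*-zeroˡ (T 0))) (ℚP.+-identityˡ S′) ⟩
    sumℚ (suc n) (λ i → natℚ (suc i) * T (suc i))
      ≡⟨ sum-cong (suc n) (λ i → sym (ℚP.*-assoc (natℚ (suc i)) (f (suc i)) (g (n ∸ i)))) ⟩
    (∂ f ⊛ g) n ∎
  S = sumℚ (suc n) (λ i → natℚ (suc n ∸ i) * T i)
  right : sumℚ (suc (suc n)) (λ i → natℚ (suc n ∸ i) * T i) ≡ (f ⊛ ∂ g) n
  right = begin
    sumℚ (suc n) (λ i → natℚ (suc n ∸ i) * T i) + natℚ (n ∸ n) * T (suc n)
      ≡⟨ trans (cong (λ k → S + natℚ k * T (suc n)) (ℕP.n∸n≡0 n))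
               (trans (cong (λ x → S + x) (ℚP.*-zeroˡ (T (suc n)))) (ℚP.+-identityʳ S)) ⟩
    sumℚ (suc n) (λ i → natℚ (suc n ∸ i) * T i)
      ≡⟨ sum-cong< (suc n) (λ i i<1+n → trans (cong (λ k → natℚ k * (f i * g k)) (ℕP.+-∸-assoc 1 (ℕP.≤-pred i<1+n)))
           (solve 3 (λ k x y → k :* (x :* y) := x :* (k :* y)) refl (natℚ (suc (n ∸ i))) (f i) (g (suc (n ∸ i))))) ⟩
    (f ⊛ ∂ g) n ∎

^S-vanishes : ∀ f → f 0 ≡ 0ℚ → ∀ m n → n < m → (f ^S m) n ≡ 0ℚ
^S-vanishes f f0≡0 (suc m) n n<1+m = sum-zero (suc n) term
  where
  term : ∀ i → i < suc n → f i * (f ^S m) (n ∸ i) ≡ 0ℚ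
  term zero    _     = trans (cong (_* (f ^S m) n) f0≡0) (ℚP.*-zeroˡ ((f ^S m) n))
  term (suc i) i<1+n = trans (cong (f (suc i) *_) (^S-vanishes f f0≡0 m (n ∸ suc i)
                         (ℕP.<-≤-trans (ℕP.∸-monoʳ-< (s≤s z≤n) (ℕP.≤-pred i<1+n)) (ℕP.≤-pred n<1+m))))
                             (ℚP.*-zeroʳ (f (suc i)))

∂-^S : ∀ f m → ∂ (f ^S suc m) ≈ natℚ (suc m) · ((f ^S m) ⊛ ∂ f)
∂-^S f zero n = begin
  ∂ (f ⊛ unitS) n                    ≡⟨ ∂-⊛ f unitS n ⟩
  (∂ f ⊛ unitS) n + (f ⊛ ∂ unitS) n  ≡⟨ cong₂ _+_ (⊛-comm (∂ f) unitS n)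
                                                         (sum-zero (suc n) (λ i _ → trans (cong (f i *_) (∂-unitS (n ∸ i))) (ℚP.*-zeroʳ (f i)))) ⟩
  (unitS ⊛ ∂ f) n + 0ℚ  ≡⟨ trans (ℚP.+-identityʳ ((unitS ⊛ ∂ f) n)) (sym (ℚP.*-identityˡ ((unitS ⊛ ∂ f) n))) ⟩
  natℚ 1 * (unitS ⊛ ∂ f) n ∎
∂-^S f (suc m) n = begin
  ∂ (f ⊛ (f ^S suc m)) n  ≡⟨ ∂-⊛ f (f ^S suc m) n ⟩
  (∂ f ⊛ (f ^S suc m)) n + (f ⊛ ∂ (f ^S suc m)) n
    ≡⟨ cong₂ _+_ (⊛-comm (∂ f) (f ^S suc m) n)
                 (trans (⊛-congʳ f (∂-^S f m) n) (trans (⊛-·ʳ (natℚ (suc m)) f ((f ^S m) ⊛ ∂ f) n)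
                        (cong (natℚ (suc m) *_) (sym (⊛-assoc f (f ^S m) (∂ f) n))))) ⟩
  x + natℚ (suc m) * x     ≡⟨ solve 2 (λ x k → x :+ k :* x := (con 1ℚ :+ k) :* x) refl x (natℚ (suc m)) ⟩
  (1ℚ + natℚ (suc m)) * x  ≡⟨ cong (_* x) (sym (natℚ-suc (suc m))) ⟩
  natℚ (suc (suc m)) * x ∎
  where x = ((f ^S suc m) ⊛ ∂ f) n

∂^ : ℕ → Series → Series
∂^ zero    h = h
∂^ (suc r) h = ∂ (∂^ r h)

∂^-cong : ∀ r {h h′} → h ≈ h′ → ∂^ r h ≈ ∂^ r h′
∂^-cong zero    h≈h′ = h≈h′
∂^-cong (suc r) h≈h′ = ∂-cong (∂^-cong r h≈h′)

∂^-+ : ∀ r s h → ∂^ r (∂^ s h) ≈ ∂^ (r ℕ.+ s) h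
∂^-+ zero    s h n = refl
∂^-+ (suc r) s h   = ∂-cong (∂^-+ r s h)

∂-sum : ∀ L (p : ℕ → ℚ) (X : ℕ → Series) → ∂ (λ n → sumℚ L (λ s → p s * X s n)) ≈ (λ n → sumℚ L (λ s → p s * ∂ (X s) n))
∂-sum L p X n = trans (*-distribˡ-sum L (natℚ (suc n)) (λ s → p s * X s (suc n)))
  (sum-cong L (λ s → solve 3 (λ k a y → k :* (a :* y) := a :* (k :* y)) refl (natℚ (suc n)) (p s) (X s (suc n))))

∂^-sum : ∀ r L (p : ℕ → ℚ) (X : ℕ → Series) → ∂^ r (λ n → sumℚ L (λ s → p s * X s n)) ≈ (λ n → sumℚ L (λ s → p s * ∂^ r (X s) n))
∂^-sum zero    L p X n = refl
∂^-sum (suc r) L p X   = ≈-trans (∂-cong (∂^-sum r L p X)) (∂-sum L p (λ s → ∂^ r (X s)))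

∂^-coefficient : ∀ r h n → natℚ (n !) * ∂^ r h n ≡ natℚ ((r ℕ.+ n) !) * h (r ℕ.+ n)
∂^-coefficient zero    h n = refl
∂^-coefficient (suc r) h n = begin
  natℚ (n !) * (natℚ (suc n) * ∂^ r h (suc n))
    ≡⟨ sym (ℚP.*-assoc (natℚ (n !)) (natℚ (suc n)) (∂^ r h (suc n))) ⟩
  natℚ (n !) * natℚ (suc n) * ∂^ r h (suc n)
    ≡⟨ cong (_* ∂^ r h (suc n)) (trans (ℚP.*-comm (natℚ (n !)) (natℚ (suc n))) (sym (natℚ-* (suc n) (n !)))) ⟩
  natℚ (suc n !) * ∂^ r h (suc n)
    ≡⟨ ∂^-coefficient r h (suc n) ⟩
  natℚ ((r ℕ.+ suc n) !) * h (r ℕ.+ suc n)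
    ≡⟨ cong (λ k → natℚ (k !) * h k) (ℕP.+-suc r n) ⟩
  natℚ ((suc r ℕ.+ n) !) * h (suc r ℕ.+ n) ∎

exp : ℚ → Series
exp a n = a ^ n * inv! n

∂-exp : ∀ a → ∂ (exp a) ≈ a · exp a
∂-exp a n = trans (solve 4 (λ k a p i → k :* ((a :* p) :* i) := a :* (p :* (k :* i))) refl (natℚ (suc n)) a (a ^ n) (inv! (suc n)))
  (cong (λ x → a * (a ^ n * x)) (natℚ*inv!-suc n))

exp-0 : exp 0ℚ ≈ unitS
exp-0 zero    = refl
exp-0 (suc n) = trans (cong (_* inv! (suc n)) (ℚP.*-zeroˡ (0ℚ ^ n))) (ℚP.*-zeroˡ (inv! (suc n)))

linear-ode-unique : ∀ c {f g} → ∂ f ≈ c · f → ∂ g ≈ c · g → f 0 ≡ g 0 → f ≈ g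
linear-ode-unique c         f′≈cf g′≈cg f0≡g0 zero    = f0≡g0
linear-ode-unique c {f} {g} f′≈cf g′≈cg f0≡g0 (suc n) = begin
  f (suc n)                ≡⟨ sym (cancel (f (suc n))) ⟩
  1/ℕ (suc n) * ∂ f n      ≡⟨ cong (1/ℕ (suc n) *_) (f′≈cf n) ⟩
  1/ℕ (suc n) * (c * f n)  ≡⟨ cong (λ x → 1/ℕ (suc n) * (c * x)) (linear-ode-unique c f′≈cf g′≈cg f0≡g0 n) ⟩
  1/ℕ (suc n) * (c * g n)  ≡⟨ cong (1/ℕ (suc n) *_) (sym (g′≈cg n)) ⟩
  1/ℕ (suc n) * ∂ g n      ≡⟨ cancel (g (suc n)) ⟩
  g (suc n) ∎
  where
  cancel : ∀ x → 1/ℕ (suc n) * (natℚ (suc n) * x) ≡ x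
  cancel x = trans (sym (ℚP.*-assoc (1/ℕ (suc n)) (natℚ (suc n)) x))
                   (trans (cong (_* x) (1/ℕ*natℚ (suc n))) (ℚP.*-identityˡ x))

exp-+ : ∀ a b → exp a ⊛ exp b ≈ exp (a + b)
exp-+ a b = linear-ode-unique (a + b) ∂[exp-a⊛exp-b] (∂-exp (a + b)) refl
  where
  ∂[exp-a⊛exp-b] : ∂ (exp a ⊛ exp b) ≈ (a + b) · (exp a ⊛ exp b)
  ∂[exp-a⊛exp-b] n = begin
    ∂ (exp a ⊛ exp b) n  ≡⟨ ∂-⊛ (exp a) (exp b) n ⟩
    (∂ (exp a) ⊛ exp b) n + (exp a ⊛ ∂ (exp b)) n
      ≡⟨ cong₂ _+_ (trans (⊛-congˡ (exp b) (∂-exp a) n) (⊛-·ˡ a (exp a) (exp b) n))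
                   (trans (⊛-congʳ (exp a) (∂-exp b) n) (⊛-·ʳ b (exp a) (exp b) n)) ⟩
    a * (exp a ⊛ exp b) n + b * (exp a ⊛ exp b) n  ≡⟨ sym (ℚP.*-distribʳ-+ ((exp a ⊛ exp b) n) a b) ⟩
    (a + b) * (exp a ⊛ exp b) n ∎

dilate : ℚ → Series → Series
dilate l f n = l ^ n * f n

dilate-cong : ∀ l {f g} → f ≈ g → dilate l f ≈ dilate l g
dilate-cong l f≈g n = cong (l ^ n *_) (f≈g n)

dilate-⊕ : ∀ l f g → dilate l (f ⊕ g) ≈ dilate l f ⊕ dilate l g
dilate-⊕ l f g n = ℚP.*-distribˡ-+ (l ^ n) (f n) (g n)

dilate-· : ∀ l c f → dilate l (c · f) ≈ c · dilate l f
dilate-· l c f n = solve 3 (λ p c x → p :* (c :* x) := c :* (p :* x)) refl (l ^ n) c (f n)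

dilate-⊛ : ∀ l f g → dilate l (f ⊛ g) ≈ dilate l f ⊛ dilate l g
dilate-⊛ l f g n = trans (*-distribˡ-sum (suc n) (l ^ n) (λ i → f i * g (n ∸ i)))
  (sum-cong< (suc n) (λ i i<1+n → begin
    l ^ n * (f i * g (n ∸ i))                ≡⟨ cong (λ k → l ^ k * (f i * g (n ∸ i))) (sym (ℕP.m+[n∸m]≡n (ℕP.≤-pred i<1+n))) ⟩
    l ^ (i ℕ.+ (n ∸ i)) * (f i * g (n ∸ i))  ≡⟨ cong (_* (f i * g (n ∸ i))) (^-homo-* l i (n ∸ i)) ⟩
    l ^ i * l ^ (n ∸ i) * (f i * g (n ∸ i))
      ≡⟨ solve 4 (λ a b x y → (a :* b) :* (x :* y) := (a :* x) :* (b :* y)) refl (l ^ i) (l ^ (n ∸ i)) (f i) (g (n ∸ i)) ⟩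
    l ^ i * f i * (l ^ (n ∸ i) * g (n ∸ i)) ∎))

∂-dilate : ∀ l f → ∂ (dilate l f) ≈ l · dilate l (∂ f)
∂-dilate l f n = solve 4 (λ k l p y → k :* ((l :* p) :* y) := l :* (p :* (k :* y))) refl (natℚ (suc n)) l (l ^ n) (f (suc n))

dilate-exp : ∀ l a → dilate l (exp a) ≈ exp (l * a)
dilate-exp l a n = trans (sym (ℚP.*-assoc (l ^ n) (a ^ n) (inv! n))) (cong (_* inv! n) (sym (^-distrib-* l a n)))

Even : Series → Set
Even f = dilate (- 1ℚ) f ≈ f

Even-⊛ : ∀ {f g} → Even f → Even g → Even (f ⊛ g)
Even-⊛ {f} {g} f-even g-even = ≈-trans (dilate-⊛ (- 1ℚ) f g) (≈-trans (⊛-congˡ (dilate (- 1ℚ) g) f-even) (⊛-congʳ f g-even))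

Even-unitS : Even unitS
Even-unitS zero    = refl
Even-unitS (suc n) = ℚP.*-zeroʳ ((- 1ℚ) ^ suc n)

Even-^S : ∀ {f} → Even f → ∀ m → Even (f ^S m)
Even-^S f-even zero    = Even-unitS
Even-^S f-even (suc m) = Even-⊛ f-even (Even-^S f-even m)

Even-odd-vanishes : ∀ {f} → Even f → ∀ n → isEven n ≡ false → f n ≡ 0ℚ
Even-odd-vanishes {f} f-even n odd = begin
  f n                           ≡⟨ solve 1 (λ x → x := con ½ :* (x :+ x)) refl (f n) ⟩
  ½ * (f n + f n)               ≡⟨ cong (λ x → ½ * (f n + x)) (sym (f-even n)) ⟩
  ½ * (f n + (- 1ℚ) ^ n * f n)  ≡⟨ cong (λ s → ½ * (f n + s * f n)) (trans (sym (signℚ≡-1^ n)) (signℚ-odd n odd)) ⟩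
  ½ * (f n + - 1ℚ * f n)        ≡⟨ solve 1 (λ x → con ½ :* (x :+ (:- con 1ℚ) :* x) := con 0ℚ) refl (f n) ⟩
  0ℚ ∎

-- The series √sech x = (cosh x)^(-1/2) and its differential equation

cosh-1 : Series
cosh-1 k = ½ * coshSum k - unitS k

cosh : Series
cosh = unitS ⊕ cosh-1

√sech : Series
√sech = rootFreeCoeff coshSum

binomialPartialSum : ℕ → Series
binomialPartialSum M n = sumℚ (suc M) (λ m → binomNegHalf m * (cosh-1 ^S m) n)

√sech≡partialSum : ∀ M n → n ≤ M → √sech n ≡ binomialPartialSum M n
√sech≡partialSum M n n≤M = sym (sum-truncate (suc M) (suc n) (λ m → binomNegHalf m * (cosh-1 ^S m) n) (s≤s n≤M)
  (λ m n<m _ → trans (cong (binomNegHalf m *_) (^S-vanishes cosh-1 refl m n n<m)) (ℚP.*-zeroʳ (binomNegHalf m))))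

binomNegHalf-rec : ∀ j → (natℚ (suc j) + natℚ (suc j)) * binomNegHalf (suc j) ≡ - ((1ℚ + natℚ j + natℚ j) * binomNegHalf j)
binomNegHalf-rec j = begin
  (natℚ (suc j) + natℚ (suc j)) * (b * - (ℤ.+ suc (2 ℕ.* j) ℚ./ K))
    ≡⟨ cong₂ (λ x y → x * (b * - y)) 2[j+1]≡K (/≡natℚ*1/ℕ (suc (2 ℕ.* j)) K) ⟩
  natℚ K * (b * - (natℚ (suc (2 ℕ.* j)) * 1/ℕ K))
    ≡⟨ solve 4 (λ k b o i → k :* (b :* (:- (o :* i))) := :- ((o :* b) :* (k :* i))) refl (natℚ K) b (natℚ (suc (2 ℕ.* j))) (1/ℕ K) ⟩
  - ((natℚ (suc (2 ℕ.* j)) * b) * (natℚ K * 1/ℕ K))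
    ≡⟨ cong₂ (λ x y → - ((x * b) * y)) 2j+1 (natℚ*1/ℕ K) ⟩
  - (((1ℚ + natℚ j + natℚ j) * b) * 1ℚ)
    ≡⟨ cong -_ (ℚP.*-identityʳ _) ⟩
  - ((1ℚ + natℚ j + natℚ j) * b) ∎
  where
  b = binomNegHalf j
  K = suc (suc (2 ℕ.* j))
  2[j+1]≡K : natℚ (suc j) + natℚ (suc j) ≡ natℚ K
  2[j+1]≡K = trans (sym (natℚ-+ (suc j) (suc j))) (cong (natℚ ∘ suc) (trans (ℕP.+-suc j j) (cong (suc ∘ (j ℕ.+_)) (sym (ℕP.+-identityʳ j)))))
  2j+1 : natℚ (suc (2 ℕ.* j)) ≡ 1ℚ + natℚ j + natℚ j
  2j+1 = trans (natℚ-suc (2 ℕ.* j)) (trans (cong (λ k → 1ℚ + natℚ (j ℕ.+ k)) (ℕP.+-identityʳ j))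
               (trans (cong (1ℚ +_) (natℚ-+ j j)) (sym (ℚP.+-assoc 1ℚ (natℚ j) (natℚ j)))))

u^m∂u : ℕ → Series
u^m∂u m = (cosh-1 ^S m) ⊛ ∂ cosh-1

cosh⊛u^m∂u : ∀ m → cosh ⊛ u^m∂u m ≈ u^m∂u m ⊕ u^m∂u (suc m)
cosh⊛u^m∂u m n = trans (⊛-distribʳ-⊕ (u^m∂u m) unitS cosh-1 n)
  (cong₂ _+_ (⊛-identityˡ (u^m∂u m) n) (sym (⊛-assoc cosh-1 (cosh-1 ^S m) (∂ cosh-1) n)))

binomialPartialSum-zero : binomialPartialSum 0 ≈ unitS
binomialPartialSum-zero k = trans (ℚP.+-identityˡ (1ℚ * unitS k)) (ℚP.*-identityˡ (unitS k))

cosh⊛∂binomialPartialSum-suc : ∀ M n → let c = binomNegHalf (suc M) * natℚ (suc M) in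
  (cosh ⊛ ∂ (binomialPartialSum (suc M))) n ≡ (cosh ⊛ ∂ (binomialPartialSum M)) n + c * (u^m∂u M n + u^m∂u (suc M) n)
cosh⊛∂binomialPartialSum-suc M n = begin
  (cosh ⊛ ∂ (S ⊕ b′ · (cosh-1 ^S suc M))) n  ≡⟨ ⊛-congʳ cosh ∂S′≈ n ⟩
  (cosh ⊛ (∂ S ⊕ c · u^m∂u M)) n             ≡⟨ ⊛-distribˡ-⊕ cosh (∂ S) (c · u^m∂u M) n ⟩
  (cosh ⊛ ∂ S) n + (cosh ⊛ (c · u^m∂u M)) n
    ≡⟨ cong ((cosh ⊛ ∂ S) n +_) (trans (⊛-·ʳ c cosh (u^m∂u M) n) (cong (c *_) (cosh⊛u^m∂u M n))) ⟩
  (cosh ⊛ ∂ S) n + c * (u^m∂u M n + u^m∂u (suc M) n) ∎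
  where
  S = binomialPartialSum M
  b′ = binomNegHalf (suc M)
  c = b′ * natℚ (suc M)
  ∂S′≈ : ∂ (S ⊕ b′ · (cosh-1 ^S suc M)) ≈ ∂ S ⊕ c · u^m∂u M
  ∂S′≈ k = trans (∂-⊕ S (b′ · (cosh-1 ^S suc M)) k)
    (cong (∂ S k +_) (trans (∂-· b′ (cosh-1 ^S suc M) k)
      (trans (cong (b′ *_) (∂-^S cosh-1 M k)) (sym (ℚP.*-assoc b′ (natℚ (suc M)) (u^m∂u M k))))))

∂cosh-1⊛binomialPartialSum-suc : ∀ M n →
  (∂ cosh-1 ⊛ binomialPartialSum (suc M)) n ≡ (∂ cosh-1 ⊛ binomialPartialSum M) n + binomNegHalf (suc M) * u^m∂u (suc M) n
∂cosh-1⊛binomialPartialSum-suc M n = trans (⊛-distribˡ-⊕ (∂ cosh-1) (binomialPartialSum M) (b′ · (cosh-1 ^S suc M)) n)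
  (cong ((∂ cosh-1 ⊛ binomialPartialSum M) n +_)
        (trans (⊛-·ʳ b′ (∂ cosh-1) (cosh-1 ^S suc M) n) (cong (b′ *_) (⊛-comm (∂ cosh-1) (cosh-1 ^S suc M) n))))
  where b′ = binomNegHalf (suc M)

residual : ∀ M n → let S = binomialPartialSum M in
  (cosh ⊛ ∂ S) n + (cosh ⊛ ∂ S) n + (∂ cosh-1 ⊛ S) n ≡ (1ℚ + natℚ M + natℚ M) * binomNegHalf M * u^m∂u M n
residual zero n = begin
  X + X + (∂ cosh-1 ⊛ binomialPartialSum 0) n
    ≡⟨ cong₂ _+_ (cong₂ _+_ X≡0 X≡0) (trans (⊛-congʳ (∂ cosh-1) binomialPartialSum-zero n)
                 (trans (⊛-identityʳ (∂ cosh-1) n) (sym (⊛-identityˡ (∂ cosh-1) n)))) ⟩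
  0ℚ + 0ℚ + u^m∂u 0 n
    ≡⟨ solve 1 (λ p → con 0ℚ :+ con 0ℚ :+ p := (con 1ℚ :+ con 0ℚ :+ con 0ℚ) :* con 1ℚ :* p) refl (u^m∂u 0 n) ⟩
  (1ℚ + 0ℚ + 0ℚ) * 1ℚ * u^m∂u 0 n ∎
  where
  X = (cosh ⊛ ∂ (binomialPartialSum 0)) n
  X≡0 : X ≡ 0ℚ
  X≡0 = sum-zero (suc n) (λ i _ → trans (cong (cosh i *_) (trans (∂-cong binomialPartialSum-zero (n ∸ i)) (∂-unitS (n ∸ i))))
                                         (ℚP.*-zeroʳ (cosh i)))
residual (suc M) n = begin
  (cosh ⊛ ∂ S′) n + (cosh ⊛ ∂ S′) n + (∂ cosh-1 ⊛ S′) n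
    ≡⟨ cong₂ _+_ (cong₂ _+_ (cosh⊛∂binomialPartialSum-suc M n) (cosh⊛∂binomialPartialSum-suc M n))
                 (∂cosh-1⊛binomialPartialSum-suc M n) ⟩
  (X + b′ * k * (t + t′)) + (X + b′ * k * (t + t′)) + (Z + b′ * t′)
    ≡⟨ solve 6 (λ X Z b′ k t t′ → (X :+ b′ :* k :* (t :+ t′)) :+ (X :+ b′ :* k :* (t :+ t′)) :+ (Z :+ b′ :* t′)
                 := (X :+ X :+ Z) :+ ((k :+ k) :* b′) :* t :+ (con 1ℚ :+ k :+ k) :* b′ :* t′) refl X Z b′ k t t′ ⟩
  (X + X + Z) + ((k + k) * b′) * t + (1ℚ + k + k) * b′ * t′
    ≡⟨ cong₂ (λ x y → x + y * t + (1ℚ + k + k) * b′ * t′) (residual M n) (binomNegHalf-rec M) ⟩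
  ρ * t + - ρ * t + (1ℚ + k + k) * b′ * t′
    ≡⟨ solve 3 (λ a t r → a :* t :+ (:- a) :* t :+ r := r) refl ρ t ((1ℚ + k + k) * b′ * t′) ⟩
  (1ℚ + k + k) * b′ * t′ ∎
  where
  S′ = binomialPartialSum (suc M)
  X = (cosh ⊛ ∂ (binomialPartialSum M)) n
  Z = (∂ cosh-1 ⊛ binomialPartialSum M) n
  b′ = binomNegHalf (suc M)
  k = natℚ (suc M)
  t = u^m∂u M n
  t′ = u^m∂u (suc M) n
  ρ = (1ℚ + natℚ M + natℚ M) * binomNegHalf M

-- Coefficient n only involves the binomial partial sum of order n + 1, whose defect u^(n+1) u′
-- vanishes to order n + 1.
√sech-ode : ∀ n → (cosh ⊛ ∂ √sech) n + (cosh ⊛ ∂ √sech) n + (∂ cosh-1 ⊛ √sech) n ≡ 0ℚ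
√sech-ode n = begin
  (cosh ⊛ ∂ √sech) n + (cosh ⊛ ∂ √sech) n + (∂ cosh-1 ⊛ √sech) n
    ≡⟨ cong₂ _+_ (cong₂ _+_ cosh-part cosh-part) sinh-part ⟩
  (cosh ⊛ ∂ S) n + (cosh ⊛ ∂ S) n + (∂ cosh-1 ⊛ S) n
    ≡⟨ residual (suc n) n ⟩
  κ * u^m∂u (suc n) n
    ≡⟨ cong (κ *_) (sum-zero (suc n) (λ i i<1+n → trans (cong (_* ∂ cosh-1 (n ∸ i)) (^S-vanishes cosh-1 refl (suc n) i i<1+n))
                                                        (ℚP.*-zeroˡ (∂ cosh-1 (n ∸ i))))) ⟩
  κ * 0ℚ
    ≡⟨ ℚP.*-zeroʳ κ ⟩
  0ℚ ∎
  where
  S = binomialPartialSum (suc n)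
  κ = (1ℚ + natℚ (suc n) + natℚ (suc n)) * binomNegHalf (suc n)
  cosh-part : (cosh ⊛ ∂ √sech) n ≡ (cosh ⊛ ∂ S) n
  cosh-part = ⊛-cong≤ cosh n (λ i i≤n → cong (natℚ (suc i) *_) (√sech≡partialSum (suc n) (suc i) (s≤s i≤n)))
  sinh-part : (∂ cosh-1 ⊛ √sech) n ≡ (∂ cosh-1 ⊛ S) n
  sinh-part = ⊛-cong≤ (∂ cosh-1) n (λ i i≤n → √sech≡partialSum (suc n) i (ℕP.m≤n⇒m≤1+n i≤n))

Even-cosh-1 : Even cosh-1
Even-cosh-1 zero    = ℚP.*-identityˡ (cosh-1 0)
Even-cosh-1 (suc n) = begin
  (- 1ℚ) ^ suc n * (½ * (i + signℚ (suc n) * i) - 0ℚ)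
    ≡⟨ cong (λ s → s * (½ * (i + signℚ (suc n) * i) - 0ℚ)) (sym (signℚ≡-1^ (suc n))) ⟩
  s * (½ * (i + s * i) - 0ℚ)
    ≡⟨ solve 2 (λ s i → s :* (con ½ :* (i :+ s :* i) :- con 0ℚ) := con ½ :* (s :* i :+ (s :* s) :* i) :- con 0ℚ) refl s i ⟩
  ½ * (s * i + (s * s) * i) - 0ℚ
    ≡⟨ cong (λ x → ½ * (s * i + x * i) - 0ℚ) (signℚ-square (suc n)) ⟩
  ½ * (s * i + 1ℚ * i) - 0ℚ
    ≡⟨ solve 2 (λ s i → con ½ :* (s :* i :+ con 1ℚ :* i) :- con 0ℚ := con ½ :* (i :+ s :* i) :- con 0ℚ) refl s i ⟩
  ½ * (i + s * i) - 0ℚ ∎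
  where
  s = signℚ (suc n)
  i = inv! (suc n)

Even-√sech : Even √sech
Even-√sech n = trans (*-distribˡ-sum (suc n) ((- 1ℚ) ^ n) (λ m → binomNegHalf m * (cosh-1 ^S m) n))
  (sum-cong (suc n) (λ m → trans (solve 3 (λ s b x → s :* (b :* x) := b :* (s :* x)) refl ((- 1ℚ) ^ n) (binomNegHalf m) ((cosh-1 ^S m) n))
                                 (cong (binomNegHalf m *_) (Even-^S Even-cosh-1 m n))))

-- The series √sech½ x = (cosh (x/2))^(-1/2)

𝓛 : ℚ → ℚ → Series → Series
𝓛 c e h = c · h ⊕ e · ∂ h

√sech½ : Series
√sech½ = dilate ½ √sech

cosh½ : Series
cosh½ = dilate ½ cosh

cosh≈ : cosh ≈ ½ · (exp 1ℚ ⊕ exp (- 1ℚ))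
cosh≈ n = begin
  unitS n + (½ * coshSum n - unitS n)  ≡⟨ solve 2 (λ u c → u :+ (con ½ :* c :- u) := con ½ :* c) refl (unitS n) (coshSum n) ⟩
  ½ * coshSum n
    ≡⟨ cong (λ x → ½ * (x + signℚ n * inv! n)) (sym (trans (cong (_* inv! n) (1^n n)) (ℚP.*-identityˡ (inv! n)))) ⟩
  ½ * (exp 1ℚ n + signℚ n * inv! n)  ≡⟨ cong (λ x → ½ * (exp 1ℚ n + x * inv! n)) (signℚ≡-1^ n) ⟩
  ½ * (exp 1ℚ n + exp (- 1ℚ) n) ∎

cosh½≈ : cosh½ ≈ ½ · (exp ½ ⊕ exp (- ½))
cosh½≈ n = begin
  ½ ^ n * cosh n                                       ≡⟨ dilate-cong ½ cosh≈ n ⟩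
  dilate ½ (½ · (exp 1ℚ ⊕ exp (- 1ℚ))) n               ≡⟨ dilate-· ½ ½ (exp 1ℚ ⊕ exp (- 1ℚ)) n ⟩
  ½ * dilate ½ (exp 1ℚ ⊕ exp (- 1ℚ)) n                 ≡⟨ cong (½ *_) (dilate-⊕ ½ (exp 1ℚ) (exp (- 1ℚ)) n) ⟩
  ½ * (dilate ½ (exp 1ℚ) n + dilate ½ (exp (- 1ℚ)) n)  ≡⟨ cong (½ *_) (cong₂ _+_ (dilate-exp ½ 1ℚ n) (dilate-exp ½ (- 1ℚ) n)) ⟩
  ½ * (exp ½ n + exp (- ½) n) ∎

∂cosh½≈ : ∂ cosh½ ≈ ½ · (½ · exp ½ ⊕ (- ½) · exp (- ½))
∂cosh½≈ n = begin
  ∂ cosh½ n                      ≡⟨ ∂-cong cosh½≈ n ⟩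
  ∂ (½ · (exp ½ ⊕ exp (- ½))) n  ≡⟨ ∂-· ½ (exp ½ ⊕ exp (- ½)) n ⟩
  ½ * ∂ (exp ½ ⊕ exp (- ½)) n    ≡⟨ cong (½ *_) (trans (∂-⊕ (exp ½) (exp (- ½)) n) (cong₂ _+_ (∂-exp ½ n) (∂-exp (- ½) n))) ⟩
  ½ * (½ * exp ½ n + - ½ * exp (- ½) n) ∎

exp-½⊛cosh½ : exp (- ½) ⊛ cosh½ ≈ ½ · (unitS ⊕ exp (- 1ℚ))
exp-½⊛cosh½ n = begin
  (exp (- ½) ⊛ cosh½) n                      ≡⟨ ⊛-congʳ (exp (- ½)) cosh½≈ n ⟩
  (exp (- ½) ⊛ (½ · (exp ½ ⊕ exp (- ½)))) n  ≡⟨ ⊛-·ʳ ½ (exp (- ½)) (exp ½ ⊕ exp (- ½)) n ⟩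
  ½ * (exp (- ½) ⊛ (exp ½ ⊕ exp (- ½))) n    ≡⟨ cong (½ *_) (⊛-distribˡ-⊕ (exp (- ½)) (exp ½) (exp (- ½)) n) ⟩
  ½ * ((exp (- ½) ⊛ exp ½) n + (exp (- ½) ⊛ exp (- ½)) n)
    ≡⟨ cong (½ *_) (cong₂ _+_ (trans (exp-+ (- ½) ½ n) (exp-0 n)) (exp-+ (- ½) (- ½) n)) ⟩
  ½ * (unitS n + exp (- 1ℚ) n) ∎

exp-½⊛∂cosh½ : exp (- ½) ⊛ ∂ cosh½ ≈ ½ · (½ · unitS ⊕ (- ½) · exp (- 1ℚ))
exp-½⊛∂cosh½ n = begin
  (exp (- ½) ⊛ ∂ cosh½) n                                ≡⟨ ⊛-congʳ (exp (- ½)) ∂cosh½≈ n ⟩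
  (exp (- ½) ⊛ (½ · (½ · exp ½ ⊕ (- ½) · exp (- ½)))) n  ≡⟨ ⊛-·ʳ ½ (exp (- ½)) (½ · exp ½ ⊕ (- ½) · exp (- ½)) n ⟩
  ½ * (exp (- ½) ⊛ (½ · exp ½ ⊕ (- ½) · exp (- ½))) n    ≡⟨ cong (½ *_) (⊛-distribˡ-⊕ (exp (- ½)) (½ · exp ½) ((- ½) · exp (- ½)) n) ⟩
  ½ * ((exp (- ½) ⊛ (½ · exp ½)) n + (exp (- ½) ⊛ ((- ½) · exp (- ½))) n)
    ≡⟨ cong (½ *_) (cong₂ _+_ (trans (⊛-·ʳ ½ (exp (- ½)) (exp ½) n) (cong (½ *_) (trans (exp-+ (- ½) ½ n) (exp-0 n))))
                              (trans (⊛-·ʳ (- ½) (exp (- ½)) (exp (- ½)) n) (cong (- ½ *_) (exp-+ (- ½) (- ½) n)))) ⟩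
  ½ * (½ * unitS n + - ½ * exp (- 1ℚ) n) ∎

dilate½-∂ : ∀ f → dilate ½ (∂ f) ≈ (1ℚ + 1ℚ) · ∂ (dilate ½ f)
dilate½-∂ f n = sym (trans (cong ((1ℚ + 1ℚ) *_) (∂-dilate ½ f n))
  (solve 1 (λ x → (con 1ℚ :+ con 1ℚ) :* (con ½ :* x) := x) refl (dilate ½ (∂ f) n)))

√sech½-ode-cosh : ∀ n → (cosh½ ⊛ ∂ √sech½) n + (cosh½ ⊛ ∂ √sech½) n + (∂ cosh½ ⊛ √sech½) n ≡ 0ℚ
√sech½-ode-cosh n = begin
  Ψ                    ≡⟨ solve 1 (λ x → x := con ½ :* ((con 1ℚ :+ con 1ℚ) :* x)) refl Ψ ⟩
  ½ * ((1ℚ + 1ℚ) * Ψ)  ≡⟨ cong (½ *_) (sym dilated) ⟩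
  ½ * (½ ^ n * 0ℚ)     ≡⟨ cong (½ *_) (ℚP.*-zeroʳ (½ ^ n)) ⟩
  ½ * 0ℚ               ≡⟨ ℚP.*-zeroʳ ½ ⟩
  0ℚ ∎
  where
  Ψ = (cosh½ ⊛ ∂ √sech½) n + (cosh½ ⊛ ∂ √sech½) n + (∂ cosh½ ⊛ √sech½) n
  ∂cosh-1≈∂cosh : ∂ cosh-1 ≈ ∂ cosh
  ∂cosh-1≈∂cosh k = cong (natℚ (suc k) *_) (sym (ℚP.+-identityˡ (cosh-1 (suc k))))
  cosh-part : dilate ½ (cosh ⊛ ∂ √sech) n ≡ (1ℚ + 1ℚ) * (cosh½ ⊛ ∂ √sech½) n
  cosh-part = trans (dilate-⊛ ½ cosh (∂ √sech) n) (trans (⊛-congʳ cosh½ (dilate½-∂ √sech) n) (⊛-·ʳ (1ℚ + 1ℚ) cosh½ (∂ √sech½) n))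
  sinh-part : dilate ½ (∂ cosh-1 ⊛ √sech) n ≡ (1ℚ + 1ℚ) * (∂ cosh½ ⊛ √sech½) n
  sinh-part = trans (dilate-⊛ ½ (∂ cosh-1) √sech n)
    (trans (⊛-congˡ √sech½ (≈-trans (dilate-cong ½ ∂cosh-1≈∂cosh) (dilate½-∂ cosh)) n) (⊛-·ˡ (1ℚ + 1ℚ) (∂ cosh½) √sech½ n))
  dilated : ½ ^ n * 0ℚ ≡ (1ℚ + 1ℚ) * Ψ
  dilated = begin
    ½ ^ n * 0ℚ
      ≡⟨ cong (½ ^ n *_) (sym (√sech-ode n)) ⟩
    dilate ½ ((cosh ⊛ ∂ √sech) ⊕ (cosh ⊛ ∂ √sech) ⊕ (∂ cosh-1 ⊛ √sech)) n
      ≡⟨ trans (dilate-⊕ ½ ((cosh ⊛ ∂ √sech) ⊕ (cosh ⊛ ∂ √sech)) (∂ cosh-1 ⊛ √sech) n)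
               (cong (_+ dilate ½ (∂ cosh-1 ⊛ √sech) n) (dilate-⊕ ½ (cosh ⊛ ∂ √sech) (cosh ⊛ ∂ √sech) n)) ⟩
    dilate ½ (cosh ⊛ ∂ √sech) n + dilate ½ (cosh ⊛ ∂ √sech) n + dilate ½ (∂ cosh-1 ⊛ √sech) n
      ≡⟨ cong₂ _+_ (cong₂ _+_ cosh-part cosh-part) sinh-part ⟩
    (1ℚ + 1ℚ) * (cosh½ ⊛ ∂ √sech½) n + (1ℚ + 1ℚ) * (cosh½ ⊛ ∂ √sech½) n + (1ℚ + 1ℚ) * (∂ cosh½ ⊛ √sech½) n
      ≡⟨ solve 2 (λ a c → (con 1ℚ :+ con 1ℚ) :* a :+ (con 1ℚ :+ con 1ℚ) :* a :+ (con 1ℚ :+ con 1ℚ) :* c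
                       := (con 1ℚ :+ con 1ℚ) :* (a :+ a :+ c)) refl ((cosh½ ⊛ ∂ √sech½) n) ((∂ cosh½ ⊛ √sech½) n) ⟩
    (1ℚ + 1ℚ) * Ψ ∎

¼ : ℚ
¼ = ½ * ½

exp-½⊛cosh½⊛ : ∀ h n → (exp (- ½) ⊛ (cosh½ ⊛ h)) n ≡ ½ * (h n + (exp (- 1ℚ) ⊛ h) n)
exp-½⊛cosh½⊛ h n = begin
  (exp (- ½) ⊛ (cosh½ ⊛ h)) n         ≡⟨ sym (⊛-assoc (exp (- ½)) cosh½ h n) ⟩
  ((exp (- ½) ⊛ cosh½) ⊛ h) n         ≡⟨ ⊛-congˡ h exp-½⊛cosh½ n ⟩
  ((½ · (unitS ⊕ exp (- 1ℚ))) ⊛ h) n  ≡⟨ ⊛-·ˡ ½ (unitS ⊕ exp (- 1ℚ)) h n ⟩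
  ½ * ((unitS ⊕ exp (- 1ℚ)) ⊛ h) n
    ≡⟨ cong (½ *_) (trans (⊛-distribʳ-⊕ h unitS (exp (- 1ℚ)) n) (cong (_+ (exp (- 1ℚ) ⊛ h) n) (⊛-identityˡ h n))) ⟩
  ½ * (h n + (exp (- 1ℚ) ⊛ h) n) ∎

exp-½⊛∂cosh½⊛ : ∀ h n → (exp (- ½) ⊛ (∂ cosh½ ⊛ h)) n ≡ ½ * (½ * h n + - ½ * (exp (- 1ℚ) ⊛ h) n)
exp-½⊛∂cosh½⊛ h n = begin
  (exp (- ½) ⊛ (∂ cosh½ ⊛ h)) n                   ≡⟨ sym (⊛-assoc (exp (- ½)) (∂ cosh½) h n) ⟩
  ((exp (- ½) ⊛ ∂ cosh½) ⊛ h) n                   ≡⟨ ⊛-congˡ h exp-½⊛∂cosh½ n ⟩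
  ((½ · (½ · unitS ⊕ (- ½) · exp (- 1ℚ))) ⊛ h) n  ≡⟨ ⊛-·ˡ ½ (½ · unitS ⊕ (- ½) · exp (- 1ℚ)) h n ⟩
  ½ * ((½ · unitS ⊕ (- ½) · exp (- 1ℚ)) ⊛ h) n    ≡⟨ cong (½ *_) (⊛-distribʳ-⊕ h (½ · unitS) ((- ½) · exp (- 1ℚ)) n) ⟩
  ½ * (((½ · unitS) ⊛ h) n + ((- ½ · exp (- 1ℚ)) ⊛ h) n)
    ≡⟨ cong (½ *_) (cong₂ _+_ (trans (⊛-·ˡ ½ unitS h n) (cong (½ *_) (⊛-identityˡ h n))) (⊛-·ˡ (- ½) (exp (- 1ℚ)) h n)) ⟩
  ½ * (½ * h n + - ½ * (exp (- 1ℚ) ⊛ h) n) ∎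

√sech½-ode : 𝓛 ¼ 1ℚ √sech½ ≈ exp (- 1ℚ) ⊛ 𝓛 ¼ (- 1ℚ) √sech½
√sech½-ode n = begin
  ¼ * G n + 1ℚ * ∂G n
    ≡⟨ solve 4 (λ g d eg ed → con ¼ :* g :+ con 1ℚ :* d
                 := (con ¼ :* eg :+ (:- con 1ℚ) :* ed) :+ ((d :+ ed) :+ con ½ :* (con ½ :* g :+ (:- con ½) :* eg))) refl (G n) (∂G n) eG eD ⟩
  (¼ * eG + - 1ℚ * eD) + ((∂G n + eD) + ½ * (½ * G n + - ½ * eG))
    ≡⟨ trans (cong ((¼ * eG + - 1ℚ * eD) +_) multiplied) (ℚP.+-identityʳ _) ⟩
  ¼ * eG + - 1ℚ * eD
    ≡⟨ sym (cong₂ _+_ (⊛-·ʳ ¼ e G n) (⊛-·ʳ (- 1ℚ) e ∂G n)) ⟩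
  (e ⊛ (¼ · G)) n + (e ⊛ ((- 1ℚ) · ∂G)) n
    ≡⟨ sym (⊛-distribˡ-⊕ e (¼ · G) ((- 1ℚ) · ∂G) n) ⟩
  (e ⊛ 𝓛 ¼ (- 1ℚ) G) n ∎
  where
  G = √sech½
  ∂G = ∂ √sech½
  e = exp (- 1ℚ)
  e½ = exp (- ½)
  eG = (e ⊛ G) n
  eD = (e ⊛ ∂G) n
  multiplied : (∂G n + eD) + ½ * (½ * G n + - ½ * eG) ≡ 0ℚ
  multiplied = begin
    (∂G n + eD) + ½ * (½ * G n + - ½ * eG)
      ≡⟨ solve 2 (λ a c → a :+ c := con ½ :* a :+ con ½ :* a :+ c) refl (∂G n + eD) (½ * (½ * G n + - ½ * eG)) ⟩
    ½ * (∂G n + eD) + ½ * (∂G n + eD) + ½ * (½ * G n + - ½ * eG)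
      ≡⟨ sym (cong₂ _+_ (cong₂ _+_ (exp-½⊛cosh½⊛ ∂G n) (exp-½⊛cosh½⊛ ∂G n)) (exp-½⊛∂cosh½⊛ G n)) ⟩
    (e½ ⊛ (cosh½ ⊛ ∂G)) n + (e½ ⊛ (cosh½ ⊛ ∂G)) n + (e½ ⊛ (∂ cosh½ ⊛ G)) n
      ≡⟨ sym (trans (⊛-distribˡ-⊕ e½ ((cosh½ ⊛ ∂G) ⊕ (cosh½ ⊛ ∂G)) (∂ cosh½ ⊛ G) n)
                    (cong (_+ (e½ ⊛ (∂ cosh½ ⊛ G)) n) (⊛-distribˡ-⊕ e½ (cosh½ ⊛ ∂G) (cosh½ ⊛ ∂G) n))) ⟩
    (e½ ⊛ ((cosh½ ⊛ ∂G) ⊕ (cosh½ ⊛ ∂G) ⊕ (∂ cosh½ ⊛ G))) n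
      ≡⟨ sum-zero (suc n) (λ i _ → trans (cong (e½ i *_) (√sech½-ode-cosh (n ∸ i))) (ℚP.*-zeroʳ (e½ i))) ⟩
    0ℚ ∎

-- Moments

𝓛-cong : ∀ c e {h h′} → h ≈ h′ → 𝓛 c e h ≈ 𝓛 c e h′
𝓛-cong c e h≈h′ n = cong₂ _+_ (cong (c *_) (h≈h′ n)) (cong (e *_) (∂-cong h≈h′ n))

∂-𝓛 : ∀ c e h → ∂ (𝓛 c e h) ≈ 𝓛 c e (∂ h)
∂-𝓛 c e h n = trans (∂-⊕ (c · h) (e · ∂ h) n) (cong₂ _+_ (∂-· c h n) (∂-· e (∂ h) n))

𝓛-comm : ∀ c e c′ e′ h → 𝓛 c e (𝓛 c′ e′ h) ≈ 𝓛 c′ e′ (𝓛 c e h)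
𝓛-comm c e c′ e′ h n = begin
  c * (c′ * h n + e′ * ∂ h n) + e * ∂ (𝓛 c′ e′ h) n
    ≡⟨ cong (c * (c′ * h n + e′ * ∂ h n) +_) (cong (e *_) (∂-𝓛 c′ e′ h n)) ⟩
  c * (c′ * h n + e′ * ∂ h n) + e * (c′ * ∂ h n + e′ * ∂ (∂ h) n)
    ≡⟨ solve 7 (λ c e c′ e′ x y z → c :* (c′ :* x :+ e′ :* y) :+ e :* (c′ :* y :+ e′ :* z)
                 := c′ :* (c :* x :+ e :* y) :+ e′ :* (c :* y :+ e :* z)) refl c e c′ e′ (h n) (∂ h n) (∂ (∂ h) n) ⟩
  c′ * (c * h n + e * ∂ h n) + e′ * (c * ∂ h n + e * ∂ (∂ h) n)
    ≡⟨ sym (cong (c′ * (c * h n + e * ∂ h n) +_) (cong (e′ *_) (∂-𝓛 c e h n))) ⟩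
  c′ * (c * h n + e * ∂ h n) + e′ * ∂ (𝓛 c e h) n ∎

𝓛-exp-1⊛ : ∀ c e h → 𝓛 c e (exp (- 1ℚ) ⊛ h) ≈ exp (- 1ℚ) ⊛ 𝓛 (c - e) e h
𝓛-exp-1⊛ c e h n = begin
  c * (ε ⊛ h) n + e * ∂ (ε ⊛ h) n
    ≡⟨ cong (c * (ε ⊛ h) n +_) (cong (e *_) (trans (∂-⊛ ε h n)
         (cong (_+ (ε ⊛ ∂ h) n) (trans (⊛-congˡ h (∂-exp (- 1ℚ)) n) (⊛-·ˡ (- 1ℚ) ε h n))))) ⟩
  c * (ε ⊛ h) n + e * (- 1ℚ * (ε ⊛ h) n + (ε ⊛ ∂ h) n)
    ≡⟨ solve 4 (λ c e x y → c :* x :+ e :* ((:- con 1ℚ) :* x :+ y) := (c :- e) :* x :+ e :* y) refl c e ((ε ⊛ h) n) ((ε ⊛ ∂ h) n) ⟩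
  (c - e) * (ε ⊛ h) n + e * (ε ⊛ ∂ h) n
    ≡⟨ sym (cong₂ _+_ (⊛-·ʳ (c - e) ε h n) (⊛-·ʳ e ε (∂ h) n)) ⟩
  (ε ⊛ ((c - e) · h)) n + (ε ⊛ (e · ∂ h)) n
    ≡⟨ sym (⊛-distribˡ-⊕ ε ((c - e) · h) (e · ∂ h) n) ⟩
  (ε ⊛ 𝓛 (c - e) e h) n ∎
  where ε = exp (- 1ℚ)

𝓛↑ : ℚ → ℚ → ℕ → Series → Series
𝓛↑ e a zero    h = h
𝓛↑ e a (suc k) h = 𝓛 (a + natℚ k) e (𝓛↑ e a k h)

𝓛↑-cong : ∀ e a k {h h′} → h ≈ h′ → 𝓛↑ e a k h ≈ 𝓛↑ e a k h′
𝓛↑-cong e a zero    h≈h′ = h≈h′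
𝓛↑-cong e a (suc k) h≈h′ = 𝓛-cong (a + natℚ k) e (𝓛↑-cong e a k h≈h′)

𝓛↑-𝓛 : ∀ e a k c e′ h → 𝓛↑ e a k (𝓛 c e′ h) ≈ 𝓛 c e′ (𝓛↑ e a k h)
𝓛↑-𝓛 e a zero    c e′ h n = refl
𝓛↑-𝓛 e a (suc k) c e′ h   = ≈-trans (𝓛-cong (a + natℚ k) e (𝓛↑-𝓛 e a k c e′ h)) (𝓛-comm (a + natℚ k) e c e′ (𝓛↑ e a k h))

𝓛↑-exp-1⊛ : ∀ e a k h → 𝓛↑ e a k (exp (- 1ℚ) ⊛ h) ≈ exp (- 1ℚ) ⊛ 𝓛↑ e (a - e) k h
𝓛↑-exp-1⊛ e a zero    h n = refl
𝓛↑-exp-1⊛ e a (suc k) h n = begin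
  𝓛 (a + natℚ k) e (𝓛↑ e a k (exp (- 1ℚ) ⊛ h)) n
    ≡⟨ 𝓛-cong (a + natℚ k) e (𝓛↑-exp-1⊛ e a k h) n ⟩
  𝓛 (a + natℚ k) e (exp (- 1ℚ) ⊛ 𝓛↑ e (a - e) k h) n
    ≡⟨ 𝓛-exp-1⊛ (a + natℚ k) e (𝓛↑ e (a - e) k h) n ⟩
  (exp (- 1ℚ) ⊛ 𝓛 (a + natℚ k - e) e (𝓛↑ e (a - e) k h)) n
    ≡⟨ cong (λ c → (exp (- 1ℚ) ⊛ 𝓛 c e (𝓛↑ e (a - e) k h)) n) (solve 3 (λ a k e → a :+ k :- e := a :- e :+ k) refl a (natℚ k) e) ⟩
  (exp (- 1ℚ) ⊛ 𝓛 (a - e + natℚ k) e (𝓛↑ e (a - e) k h)) n ∎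

𝓛↑-shift : ∀ e a k h → 𝓛↑ e a (suc k) h ≈ 𝓛↑ e (a + 1ℚ) k (𝓛 a e h)
𝓛↑-shift e a zero    h n = cong (λ c → 𝓛 c e h n) (ℚP.+-identityʳ a)
𝓛↑-shift e a (suc k) h n = begin
  𝓛 (a + natℚ (suc k)) e (𝓛↑ e a (suc k) h) n
    ≡⟨ 𝓛-cong (a + natℚ (suc k)) e (𝓛↑-shift e a k h) n ⟩
  𝓛 (a + natℚ (suc k)) e (𝓛↑ e (a + 1ℚ) k (𝓛 a e h)) n
    ≡⟨ cong (λ c → 𝓛 c e (𝓛↑ e (a + 1ℚ) k (𝓛 a e h)) n)
            (trans (cong (a +_) (natℚ-suc k)) (sym (ℚP.+-assoc a 1ℚ (natℚ k)))) ⟩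
  𝓛 (a + 1ℚ + natℚ k) e (𝓛↑ e (a + 1ℚ) k (𝓛 a e h)) n ∎

rising : ℚ → ℕ → ℚ
rising a zero    = 1ℚ
rising a (suc d) = a * rising (a + 1ℚ) d

rising-suc : ∀ a d → rising a (suc d) ≡ rising a d * (a + natℚ d)
rising-suc a zero    = trans (ℚP.*-identityʳ a) (sym (trans (ℚP.*-identityˡ (a + 0ℚ)) (ℚP.+-identityʳ a)))
rising-suc a (suc d) = begin
  a * rising (a + 1ℚ) (suc d)  ≡⟨ cong (a *_) (rising-suc (a + 1ℚ) d) ⟩
  a * (rising (a + 1ℚ) d * (a + 1ℚ + natℚ d))
    ≡⟨ cong (λ x → a * (rising (a + 1ℚ) d * x)) (trans (ℚP.+-assoc a 1ℚ (natℚ d)) (cong (a +_) (sym (natℚ-suc d)))) ⟩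
  a * (rising (a + 1ℚ) d * (a + natℚ (suc d)))  ≡⟨ sym (ℚP.*-assoc a (rising (a + 1ℚ) d) (a + natℚ (suc d))) ⟩
  rising a (suc d) * (a + natℚ (suc d)) ∎

μ : ℕ → ℚ
μ s = rising ½ s * ½ ^ s

μ-suc : ∀ s → μ (suc s) ≡ ½ * ((½ + natℚ s) * μ s)
μ-suc s = begin
  rising ½ (suc s) * (½ * ½ ^ s)  ≡⟨ cong (_* (½ * ½ ^ s)) (rising-suc ½ s) ⟩
  rising ½ s * (½ + natℚ s) * (½ * ½ ^ s)
    ≡⟨ solve 3 (λ r k p → r :* (con ½ :+ k) :* (con ½ :* p) := con ½ :* ((con ½ :+ k) :* (r :* p))) refl (rising ½ s) (natℚ s) (½ ^ s) ⟩
  ½ * ((½ + natℚ s) * μ s) ∎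

𝓜 : ℕ → ℕ → ℚ
𝓜 k j = 𝓛↑ (- 1ℚ) ¼ k (𝓛↑ 1ℚ ¼ j √sech½) 0

-- By √sech½-ode; the factor e^(-x) it introduces disappears at x = 0.
𝓜-swap : ∀ k j → 𝓜 k (suc j) ≡ 𝓜 (suc k) j
𝓜-swap k j = begin
  𝓛↑ (- 1ℚ) ¼ k (𝓛↑ 1ℚ ¼ (suc j) √sech½) 0
    ≡⟨ 𝓛↑-cong (- 1ℚ) ¼ k (≈-trans (𝓛↑-shift 1ℚ ¼ j √sech½) (𝓛↑-cong 1ℚ (¼ + 1ℚ) j √sech½-ode)) 0 ⟩
  𝓛↑ (- 1ℚ) ¼ k (𝓛↑ 1ℚ (¼ + 1ℚ) j (exp (- 1ℚ) ⊛ 𝓛 ¼ (- 1ℚ) √sech½)) 0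
    ≡⟨ 𝓛↑-cong (- 1ℚ) ¼ k (𝓛↑-exp-1⊛ 1ℚ (¼ + 1ℚ) j (𝓛 ¼ (- 1ℚ) √sech½)) 0 ⟩
  𝓛↑ (- 1ℚ) ¼ k (exp (- 1ℚ) ⊛ 𝓛↑ 1ℚ ¼ j (𝓛 ¼ (- 1ℚ) √sech½)) 0
    ≡⟨ 𝓛↑-exp-1⊛ (- 1ℚ) ¼ k (𝓛↑ 1ℚ ¼ j (𝓛 ¼ (- 1ℚ) √sech½)) 0 ⟩
  (exp (- 1ℚ) ⊛ 𝓛↑ (- 1ℚ) (¼ + 1ℚ) k (𝓛↑ 1ℚ ¼ j (𝓛 ¼ (- 1ℚ) √sech½))) 0
    ≡⟨ trans (ℚP.+-identityˡ _) (ℚP.*-identityˡ _) ⟩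
  𝓛↑ (- 1ℚ) (¼ + 1ℚ) k (𝓛↑ 1ℚ ¼ j (𝓛 ¼ (- 1ℚ) √sech½)) 0
    ≡⟨ 𝓛↑-cong (- 1ℚ) (¼ + 1ℚ) k (𝓛↑-𝓛 1ℚ ¼ j ¼ (- 1ℚ) √sech½) 0 ⟩
  𝓛↑ (- 1ℚ) (¼ + 1ℚ) k (𝓛 ¼ (- 1ℚ) (𝓛↑ 1ℚ ¼ j √sech½)) 0
    ≡⟨ sym (𝓛↑-shift (- 1ℚ) ¼ k (𝓛↑ 1ℚ ¼ j √sech½) 0) ⟩
  𝓛↑ (- 1ℚ) ¼ (suc k) (𝓛↑ 1ℚ ¼ j √sech½) 0 ∎

𝓜-sum : ∀ k j → 𝓜 (suc k) j + 𝓜 k (suc j) ≡ (½ + (natℚ k + natℚ j)) * 𝓜 k j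
𝓜-sum k j = begin
  𝓛 (¼ + natℚ k) (- 1ℚ) Z 0 + 𝓛↑ (- 1ℚ) ¼ k (𝓛 (¼ + natℚ j) 1ℚ Y) 0
    ≡⟨ cong (𝓛 (¼ + natℚ k) (- 1ℚ) Z 0 +_) (𝓛↑-𝓛 (- 1ℚ) ¼ k (¼ + natℚ j) 1ℚ Y 0) ⟩
  𝓛 (¼ + natℚ k) (- 1ℚ) Z 0 + 𝓛 (¼ + natℚ j) 1ℚ Z 0
    ≡⟨ solve 4 (λ a b z dz → (con ¼ :+ a) :* z :+ (:- con 1ℚ) :* dz :+ ((con ¼ :+ b) :* z :+ con 1ℚ :* dz)
                 := (con ½ :+ (a :+ b)) :* z) refl (natℚ k) (natℚ j) (Z 0) (∂ Z 0) ⟩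
  (½ + (natℚ k + natℚ j)) * 𝓜 k j ∎
  where
  Y = 𝓛↑ 1ℚ ¼ j √sech½
  Z = 𝓛↑ (- 1ℚ) ¼ k Y

𝓜≡μ : ∀ k j → 𝓜 k j ≡ μ (k ℕ.+ j)
𝓜≡μ zero    zero    = refl
𝓜≡μ zero    (suc j) = begin
  𝓜 0 (suc j)                        ≡⟨ 𝓜-swap 0 j ⟩
  𝓜 1 j                              ≡⟨ solve 1 (λ x → x := con ½ :* (x :+ x)) refl (𝓜 1 j) ⟩
  ½ * (𝓜 1 j + 𝓜 1 j)                ≡⟨ cong (λ x → ½ * (𝓜 1 j + x)) (sym (𝓜-swap 0 j)) ⟩
  ½ * (𝓜 1 j + 𝓜 0 (suc j))          ≡⟨ cong (½ *_) (𝓜-sum 0 j) ⟩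
  ½ * ((½ + (0ℚ + natℚ j)) * 𝓜 0 j)  ≡⟨ cong₂ (λ x y → ½ * ((½ + x) * y)) (ℚP.+-identityˡ (natℚ j)) (𝓜≡μ 0 j) ⟩
  ½ * ((½ + natℚ j) * μ j)           ≡⟨ sym (μ-suc j) ⟩
  μ (suc j) ∎
𝓜≡μ (suc k) j = trans (sym (𝓜-swap k j)) (trans (𝓜≡μ k (suc j)) (cong μ (ℕP.+-suc k j)))

mulLinear : ℚ → ℚ → (ℕ → ℚ) → ℕ → ℚ
mulLinear c e p zero    = c * p 0
mulLinear c e p (suc r) = c * p (suc r) + e * p r

-- coeff↑ e a k r is the coefficient of y^r in (a + e y)(a + 1 + e y)⋯(a + k - 1 + e y).
coeff↑ : ℚ → ℚ → ℕ → ℕ → ℚ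
coeff↑ e a zero    = unitS
coeff↑ e a (suc k) = mulLinear (a + natℚ k) e (coeff↑ e a k)

coeff↑-vanishes : ∀ e a k r → k < r → coeff↑ e a k r ≡ 0ℚ
coeff↑-vanishes e a zero    (suc r) _         = refl
coeff↑-vanishes e a (suc k) (suc r) (s≤s k<r) = begin
  (a + natℚ k) * coeff↑ e a k (suc r) + e * coeff↑ e a k r
    ≡⟨ cong₂ (λ x y → (a + natℚ k) * x + e * y) (coeff↑-vanishes e a k (suc r) (ℕP.m<n⇒m<1+n k<r)) (coeff↑-vanishes e a k r k<r) ⟩
  (a + natℚ k) * 0ℚ + e * 0ℚ
    ≡⟨ solve 2 (λ c e → c :* con 0ℚ :+ e :* con 0ℚ := con 0ℚ) refl (a + natℚ k) e ⟩
  0ℚ ∎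

coeff↑-top : ∀ e a k → coeff↑ e a k k ≡ e ^ k
coeff↑-top e a zero    = refl
coeff↑-top e a (suc k) = begin
  (a + natℚ k) * coeff↑ e a k (suc k) + e * coeff↑ e a k k
    ≡⟨ cong₂ (λ x y → (a + natℚ k) * x + e * y) (coeff↑-vanishes e a k (suc k) (ℕP.n<1+n k)) (coeff↑-top e a k) ⟩
  (a + natℚ k) * 0ℚ + e * e ^ k
    ≡⟨ solve 3 (λ c e p → c :* con 0ℚ :+ e :* p := e :* p) refl (a + natℚ k) e (e ^ k) ⟩
  e ^ suc k ∎

coeff↑-scale : ∀ c e a k r → coeff↑ (c * e) a k r ≡ c ^ r * coeff↑ e a k r
coeff↑-scale c e a zero    zero    = refl
coeff↑-scale c e a zero    (suc r) = sym (ℚP.*-zeroʳ (c ^ suc r))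
coeff↑-scale c e a (suc k) zero    = begin
  (a + natℚ k) * coeff↑ (c * e) a k 0  ≡⟨ cong ((a + natℚ k) *_) (coeff↑-scale c e a k 0) ⟩
  (a + natℚ k) * (1ℚ * coeff↑ e a k 0)
    ≡⟨ solve 2 (λ x y → x :* (con 1ℚ :* y) := con 1ℚ :* (x :* y)) refl (a + natℚ k) (coeff↑ e a k 0) ⟩
  1ℚ * ((a + natℚ k) * coeff↑ e a k 0) ∎
coeff↑-scale c e a (suc k) (suc r) = begin
  (a + natℚ k) * coeff↑ (c * e) a k (suc r) + c * e * coeff↑ (c * e) a k r
    ≡⟨ cong₂ (λ x y → (a + natℚ k) * x + c * e * y) (coeff↑-scale c e a k (suc r)) (coeff↑-scale c e a k r) ⟩
  (a + natℚ k) * (c ^ suc r * coeff↑ e a k (suc r)) + c * e * (c ^ r * coeff↑ e a k r)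
    ≡⟨ solve 6 (λ x c p u e v → x :* ((c :* p) :* u) :+ c :* e :* (p :* v) := (c :* p) :* (x :* u :+ e :* v))
               refl (a + natℚ k) c (c ^ r) (coeff↑ e a k (suc r)) e (coeff↑ e a k r) ⟩
  c ^ suc r * ((a + natℚ k) * coeff↑ e a k (suc r) + e * coeff↑ e a k r) ∎

applyPoly : ℕ → (ℕ → ℚ) → Series → Series
applyPoly L p h n = sumℚ L (λ r → p r * ∂^ r h n)

applyPoly-mulLinear : ∀ L c e p h →
  applyPoly (suc L) (mulLinear c e p) h ≈ c · applyPoly (suc L) p h ⊕ e · ∂ (applyPoly L p h)
applyPoly-mulLinear L c e p h n = begin
  applyPoly (suc L) (mulLinear c e p) h n
    ≡⟨ sum-shift L (λ r → mulLinear c e p r * ∂^ r h n) ⟩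
  c * p 0 * h n + sumℚ L (λ r → (c * p (suc r) + e * p r) * ∂^ (suc r) h n)
    ≡⟨ cong (c * p 0 * h n +_) (trans (sum-cong L (λ r → ℚP.*-distribʳ-+ (∂^ (suc r) h n) (c * p (suc r)) (e * p r)))
         (trans (sum-+ L (λ r → c * p (suc r) * ∂^ (suc r) h n) (λ r → e * p r * ∂^ (suc r) h n))
                (cong₂ _+_ (pull c (p ∘ suc) (λ r → ∂^ (suc r) h n)) (pull e p (λ r → ∂^ (suc r) h n))))) ⟩
  c * p 0 * h n + (c * tail + e * shifted)
    ≡⟨ solve 5 (λ c a x t s → c :* a :* x :+ (c :* t :+ s) := c :* (a :* x :+ t) :+ s) refl c (p 0) (h n) tail (e * shifted) ⟩
  c * (p 0 * h n + tail) + e * shifted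
    ≡⟨ cong₂ (λ x y → c * x + e * y) (sym (sum-shift L (λ r → p r * ∂^ r h n))) (sym (∂-sum L p (λ r → ∂^ r h) n)) ⟩
  c * applyPoly (suc L) p h n + e * ∂ (applyPoly L p h) n ∎
  where
  tail = sumℚ L (λ r → p (suc r) * ∂^ (suc r) h n)
  shifted = sumℚ L (λ r → p r * ∂^ (suc r) h n)
  pull : ∀ x (f g : ℕ → ℚ) → sumℚ L (λ r → x * f r * g r) ≡ x * sumℚ L (λ r → f r * g r)
  pull x f g = trans (sum-cong L (λ r → ℚP.*-assoc x (f r) (g r))) (sym (*-distribˡ-sum L x (λ r → f r * g r)))

𝓛↑≈applyPoly : ∀ e a k L h → k < L → 𝓛↑ e a k h ≈ applyPoly L (coeff↑ e a k) h
𝓛↑≈applyPoly e a zero    (suc L) h _         n = sym (begin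
  sumℚ (suc L) (λ r → unitS r * ∂^ r h n)
    ≡⟨ sum-shift L (λ r → unitS r * ∂^ r h n) ⟩
  1ℚ * h n + sumℚ L (λ r → 0ℚ * ∂^ (suc r) h n)
    ≡⟨ cong₂ _+_ (ℚP.*-identityˡ (h n)) (sum-zero L (λ r _ → ℚP.*-zeroˡ (∂^ (suc r) h n))) ⟩
  h n + 0ℚ
    ≡⟨ ℚP.+-identityʳ (h n) ⟩
  h n ∎)
𝓛↑≈applyPoly e a (suc k) (suc L) h (s≤s k<L) n = begin
  c * 𝓛↑ e a k h n + e * ∂ (𝓛↑ e a k h) n
    ≡⟨ cong₂ (λ x y → c * x + e * y) (𝓛↑≈applyPoly e a k (suc L) h (ℕP.m<n⇒m<1+n k<L) n)
                                      (∂-cong (𝓛↑≈applyPoly e a k L h k<L) n) ⟩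
  c * applyPoly (suc L) (coeff↑ e a k) h n + e * ∂ (applyPoly L (coeff↑ e a k) h) n
    ≡⟨ sym (applyPoly-mulLinear L c e (coeff↑ e a k) h n) ⟩
  applyPoly (suc L) (coeff↑ e a (suc k)) h n ∎
  where c = a + natℚ k

ν : ℕ → ℚ
ν m = ∂^ m √sech½ 0

ν≡ : ∀ m → ν m ≡ natℚ (m !) * (½ ^ m * √sech m)
ν≡ m = begin
  ν m                                    ≡⟨ sym (ℚP.*-identityˡ (ν m)) ⟩
  natℚ (0 !) * ∂^ m √sech½ 0             ≡⟨ ∂^-coefficient m √sech½ 0 ⟩
  natℚ ((m ℕ.+ 0) !) * √sech½ (m ℕ.+ 0)  ≡⟨ cong (λ k → natℚ (k !) * √sech½ k) (ℕP.+-identityʳ m) ⟩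
  natℚ (m !) * (½ ^ m * √sech m) ∎

𝓜≡double-sum : ∀ k j L → k < L → j < L →
  𝓜 k j ≡ sumℚ L (λ r → coeff↑ (- 1ℚ) ¼ k r * sumℚ L (λ s → coeff↑ 1ℚ ¼ j s * ν (r ℕ.+ s)))
𝓜≡double-sum k j L k<L j<L = trans (𝓛↑≈applyPoly (- 1ℚ) ¼ k L Y k<L 0) (sum-cong L (λ r → cong (coeff↑ (- 1ℚ) ¼ k r *_) (inner r)))
  where
  Y = 𝓛↑ 1ℚ ¼ j √sech½
  inner : ∀ r → ∂^ r Y 0 ≡ sumℚ L (λ s → coeff↑ 1ℚ ¼ j s * ν (r ℕ.+ s))
  inner r = trans (∂^-cong r (𝓛↑≈applyPoly 1ℚ ¼ j L √sech½ j<L) 0)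
    (trans (∂^-sum r L (coeff↑ 1ℚ ¼ j) (λ s → ∂^ s √sech½) 0)
           (sum-cong L (λ s → cong (coeff↑ 1ℚ ¼ j s *_) (∂^-+ r s √sech½ 0))))

-- Finite differences

binomℚ : ℕ → ℕ → ℚ
binomℚ l t = natℚ (l C t)

binomℚ-suc : ∀ l t → binomℚ (suc l) (suc t) ≡ binomℚ l t + binomℚ l (suc t)
binomℚ-suc l t = trans (cong natℚ (sym (nCk+nC[k+1]≡[n+1]C[k+1] l t))) (natℚ-+ (l C t) (l C suc t))

binomℚ-vanishes : ∀ {l t} → l < t → binomℚ l t ≡ 0ℚ
binomℚ-vanishes l<t = cong natℚ (k>n⇒nCk≡0 l<t)

altBinomSum : ℕ → (ℕ → ℚ) → ℚ
altBinomSum l X = sumℚ (suc l) (λ t → signℚ t * binomℚ l t * X t)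

altBinomSum-head : ∀ l X → altBinomSum l X ≡ X 0 + - sumℚ l (λ t → signℚ t * binomℚ l (suc t) * X (suc t))
altBinomSum-head l X = begin
  altBinomSum l X
    ≡⟨ sum-shift l (λ t → signℚ t * binomℚ l t * X t) ⟩
  1ℚ * 1ℚ * X 0 + sumℚ l (λ t → - signℚ t * binomℚ l (suc t) * X (suc t))
    ≡⟨ cong₂ _+_ (solve 1 (λ x → con 1ℚ :* con 1ℚ :* x := x) refl (X 0))
                 (trans (sum-cong l (λ t → solve 3 (λ s b x → (:- s) :* b :* x := :- (s :* b :* x)) refl (signℚ t) (binomℚ l (suc t)) (X (suc t))))
                        (sym (neg-distrib-sum l (λ t → signℚ t * binomℚ l (suc t) * X (suc t))))) ⟩
  X 0 + - sumℚ l (λ t → signℚ t * binomℚ l (suc t) * X (suc t)) ∎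

altBinomSum-suc : ∀ l X → altBinomSum (suc l) X ≡ altBinomSum l (λ t → X t - X (suc t))
altBinomSum-suc l X = begin
  altBinomSum (suc l) X
    ≡⟨ sum-shift (suc l) (λ t → signℚ t * binomℚ (suc l) t * X t) ⟩
  1ℚ * 1ℚ * X 0 + sumℚ (suc l) (λ t → - signℚ t * binomℚ (suc l) (suc t) * X (suc t))
    ≡⟨ cong (1ℚ * 1ℚ * X 0 +_) (trans (sum-cong (suc l) split) (sum-+ (suc l) (λ t → - (c t * X (suc t))) (λ t → - d t))) ⟩
  1ℚ * 1ℚ * X 0 + (sumℚ (suc l) (λ t → - (c t * X (suc t))) + sumℚ (suc l) (λ t → - d t))
    ≡⟨ cong₂ (λ x y → 1ℚ * 1ℚ * X 0 + (x + y)) (sym (neg-distrib-sum (suc l) (λ t → c t * X (suc t))))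
                                               (trans (sym (neg-distrib-sum (suc l) d)) (cong -_ top-vanishes)) ⟩
  1ℚ * 1ℚ * X 0 + (- S₁ + - S₂)
    ≡⟨ solve 3 (λ x a b → con 1ℚ :* con 1ℚ :* x :+ (:- a :+ :- b) := (x :+ :- b) :+ :- a) refl (X 0) S₁ S₂ ⟩
  (X 0 + - S₂) + - S₁
    ≡⟨ cong₂ _+_ (sym (altBinomSum-head l X)) (neg-distrib-sum (suc l) (λ t → c t * X (suc t))) ⟩
  sumℚ (suc l) (λ t → c t * X t) + sumℚ (suc l) (λ t → - (c t * X (suc t)))
    ≡⟨ sym (sum-+ (suc l) (λ t → c t * X t) (λ t → - (c t * X (suc t)))) ⟩
  sumℚ (suc l) (λ t → c t * X t + - (c t * X (suc t)))
    ≡⟨ sum-cong (suc l) (λ t → solve 3 (λ c x y → c :* x :+ :- (c :* y) := c :* (x :- y)) refl (c t) (X t) (X (suc t))) ⟩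
  altBinomSum l (λ t → X t - X (suc t)) ∎
  where
  c : ℕ → ℚ
  c t = signℚ t * binomℚ l t
  d : ℕ → ℚ
  d t = signℚ t * binomℚ l (suc t) * X (suc t)
  S₁ = sumℚ (suc l) (λ t → c t * X (suc t))
  S₂ = sumℚ l d
  split : ∀ t → - signℚ t * binomℚ (suc l) (suc t) * X (suc t) ≡ - (c t * X (suc t)) + - d t
  split t = trans (cong (λ b → - signℚ t * b * X (suc t)) (binomℚ-suc l t))
    (solve 4 (λ s a b x → (:- s) :* (a :+ b) :* x := (:- (s :* a :* x)) :+ (:- (s :* b :* x))) refl (signℚ t) (binomℚ l t) (binomℚ l (suc t)) (X (suc t)))
  top-vanishes : sumℚ (suc l) d ≡ S₂
  top-vanishes = trans (cong (S₂ +_) (trans (cong (λ b → signℚ l * b * X (suc l)) (binomℚ-vanishes (ℕP.n<1+n l)))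
                                            (solve 2 (λ s x → s :* con 0ℚ :* x := con 0ℚ) refl (signℚ l) (X (suc l)))))
                       (ℚP.+-identityʳ S₂)

rising-difference : ∀ b d → rising b (suc d) - rising (b + 1ℚ) (suc d) ≡ - (natℚ (suc d) * rising (b + 1ℚ) d)
rising-difference b d = begin
  b * rising (b + 1ℚ) d - rising (b + 1ℚ) (suc d)  ≡⟨ cong (λ x → b * rising (b + 1ℚ) d - x) (rising-suc (b + 1ℚ) d) ⟩
  b * rising (b + 1ℚ) d - rising (b + 1ℚ) d * (b + 1ℚ + natℚ d)
    ≡⟨ solve 3 (λ b p n → b :* p :- p :* (b :+ con 1ℚ :+ n) := :- ((con 1ℚ :+ n) :* p)) refl b (rising (b + 1ℚ) d) (natℚ d) ⟩
  - ((1ℚ + natℚ d) * rising (b + 1ℚ) d)  ≡⟨ cong (λ x → - (x * rising (b + 1ℚ) d)) (sym (natℚ-suc d)) ⟩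
  - (natℚ (suc d) * rising (b + 1ℚ) d) ∎

altBinomSum-rising : ℕ → ℚ → ℕ → ℚ
altBinomSum-rising l a d = altBinomSum l (λ t → rising (a + natℚ t) d)

altBinomSum-rising-suc : ∀ l a d → altBinomSum-rising (suc l) a (suc d) ≡ - (natℚ (suc d) * altBinomSum-rising l (a + 1ℚ) d)
altBinomSum-rising-suc l a d = begin
  altBinomSum-rising (suc l) a (suc d)
    ≡⟨ altBinomSum-suc l (λ t → rising (a + natℚ t) (suc d)) ⟩
  sumℚ (suc l) (λ t → c t * (rising (a + natℚ t) (suc d) - rising (a + natℚ (suc t)) (suc d)))
    ≡⟨ sum-cong (suc l) (λ t → cong (c t *_) (trans (cong (λ x → rising (a + natℚ t) (suc d) - rising x (suc d)) (shift t))
                                                     (rising-difference (a + natℚ t) d))) ⟩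
  sumℚ (suc l) (λ t → c t * - (natℚ (suc d) * rising (a + natℚ t + 1ℚ) d))
    ≡⟨ sum-cong (suc l) (λ t → trans (cong (λ x → c t * - (natℚ (suc d) * rising x d)) (reorder t))
         (solve 3 (λ c n p → c :* (:- (n :* p)) := :- n :* (c :* p)) refl (c t) (natℚ (suc d)) (rising (a + 1ℚ + natℚ t) d))) ⟩
  sumℚ (suc l) (λ t → - natℚ (suc d) * (c t * rising (a + 1ℚ + natℚ t) d))
    ≡⟨ sym (*-distribˡ-sum (suc l) (- natℚ (suc d)) (λ t → c t * rising (a + 1ℚ + natℚ t) d)) ⟩
  - natℚ (suc d) * altBinomSum-rising l (a + 1ℚ) d
    ≡⟨ sym (ℚP.neg-distribˡ-* (natℚ (suc d)) (altBinomSum-rising l (a + 1ℚ) d)) ⟩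
  - (natℚ (suc d) * altBinomSum-rising l (a + 1ℚ) d) ∎
  where
  c : ℕ → ℚ
  c t = signℚ t * binomℚ l t
  shift : ∀ t → a + natℚ (suc t) ≡ a + natℚ t + 1ℚ
  shift t = trans (cong (a +_) (natℚ-suc t)) (solve 2 (λ a n → a :+ (con 1ℚ :+ n) := a :+ n :+ con 1ℚ) refl a (natℚ t))
  reorder : ∀ t → a + natℚ t + 1ℚ ≡ a + 1ℚ + natℚ t
  reorder t = solve 2 (λ a n → a :+ n :+ con 1ℚ := a :+ con 1ℚ :+ n) refl a (natℚ t)

altBinomSum-rising-vanishes : ∀ l a d → d < l → altBinomSum-rising l a d ≡ 0ℚ
altBinomSum-rising-vanishes (suc l) a zero    _ = trans (altBinomSum-suc l (λ t → 1ℚ))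
  (sum-zero (suc l) (λ t _ → trans (cong (signℚ t * binomℚ l t *_) (ℚP.+-inverseʳ 1ℚ)) (ℚP.*-zeroʳ (signℚ t * binomℚ l t))))
altBinomSum-rising-vanishes (suc l) a (suc d) (s≤s d<l) = begin
  altBinomSum-rising (suc l) a (suc d)  ≡⟨ altBinomSum-rising-suc l a d ⟩
  - (natℚ (suc d) * altBinomSum-rising l (a + 1ℚ) d)
    ≡⟨ cong (λ x → - (natℚ (suc d) * x)) (altBinomSum-rising-vanishes l (a + 1ℚ) d d<l) ⟩
  - (natℚ (suc d) * 0ℚ)  ≡⟨ cong -_ (ℚP.*-zeroʳ (natℚ (suc d))) ⟩
  0ℚ ∎

altBinomSum-rising-top : ∀ l a → altBinomSum-rising l a l ≡ signℚ l * natℚ (l !)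
altBinomSum-rising-top zero    a = refl
altBinomSum-rising-top (suc l) a = begin
  altBinomSum-rising (suc l) a (suc l)                ≡⟨ altBinomSum-rising-suc l a l ⟩
  - (natℚ (suc l) * altBinomSum-rising l (a + 1ℚ) l)  ≡⟨ cong (λ x → - (natℚ (suc l) * x)) (altBinomSum-rising-top l (a + 1ℚ)) ⟩
  - (natℚ (suc l) * (signℚ l * natℚ (l !)))
    ≡⟨ solve 3 (λ n s f → :- (n :* (s :* f)) := (:- s) :* (n :* f)) refl (natℚ (suc l)) (signℚ l) (natℚ (l !)) ⟩
  - signℚ l * (natℚ (suc l) * natℚ (l !))  ≡⟨ cong (- signℚ l *_) (sym (natℚ-* (suc l) (l !))) ⟩
  signℚ (suc l) * natℚ (suc l !) ∎

-- Orthogonality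

natℚ-2^ : ∀ n → natℚ (2 ℕ.^ n) ≡ natℚ 2 ^ n
natℚ-2^ zero    = refl
natℚ-2^ (suc n) = trans (natℚ-* 2 (2 ℕ.^ n)) (cong (natℚ 2 *_) (natℚ-2^ n))

1/ℕ-2^ : ∀ n → 1/ℕ (2 ℕ.^ n) {{m^n≢0 2 n}} ≡ ½ ^ n
1/ℕ-2^ zero    = refl
1/ℕ-2^ (suc n) = trans (1/ℕ-* 2 (2 ℕ.^ n) {{_}} {{m^n≢0 2 n}}) (cong (½ *_) (1/ℕ-2^ n))

2^3t*½^3t≡1 : ∀ t → natℚ (2 ℕ.^ (3 ℕ.* t)) * (½ ^ t * ½ ^ t * ½ ^ t) ≡ 1ℚ
2^3t*½^3t≡1 t = begin
  natℚ (2 ℕ.^ (3 ℕ.* t)) * (h * h * h)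
    ≡⟨ cong (_* (h * h * h)) (trans (natℚ-2^ (3 ℕ.* t)) (trans (cong (natℚ 2 ^_) 3t≡t+[t+t])
         (trans (^-homo-* (natℚ 2) t (t ℕ.+ t)) (cong (w *_) (^-homo-* (natℚ 2) t t))))) ⟩
  w * (w * w) * (h * h * h)
    ≡⟨ solve 2 (λ a h → a :* (a :* a) :* (h :* h :* h) := (a :* h) :* (a :* h) :* (a :* h)) refl w h ⟩
  (w * h) * (w * h) * (w * h)
    ≡⟨ cong (λ x → x * x * x) (^-inverse (natℚ 2) ½ t refl) ⟩
  1ℚ ∎
  where
  w = natℚ 2 ^ t
  h = ½ ^ t
  3t≡t+[t+t] : 3 ℕ.* t ≡ t ℕ.+ (t ℕ.+ t)
  3t≡t+[t+t] = cong (λ x → t ℕ.+ (t ℕ.+ x)) (ℕP.+-identityʳ t)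

weight≡ : ∀ l t → weight l t ≡ natℚ (2 ℕ.^ (3 ℕ.* t)) * (½ ^ l * (inv! (2 ℕ.* t) * inv! (l ∸ t)))
weight≡ l t = begin
  weight l t                    ≡⟨ /≡natℚ*1/ℕ e (2 ℕ.^ l ℕ.* F) ⟩
  natℚ e * 1/ℕ (2 ℕ.^ l ℕ.* F)  ≡⟨ cong (natℚ e *_) (trans (1/ℕ-* (2 ℕ.^ l) F) (cong₂ _*_ (1/ℕ-2^ l) (1/ℕ-* ((2 ℕ.* t) !) ((l ∸ t) !)))) ⟩
  natℚ e * (½ ^ l * (inv! (2 ℕ.* t) * inv! (l ∸ t))) ∎
  where
  e = 2 ℕ.^ (3 ℕ.* t)
  F = (2 ℕ.* t) ! ℕ.* (l ∸ t) !
  instance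
    _ = m^n≢0 2 l
    _ = (2 ℕ.* t) !≢0
    _ = (l ∸ t) !≢0
    _ = m*n≢0 ((2 ℕ.* t) !) ((l ∸ t) !)
    _ = m*n≢0 (2 ℕ.^ l) F

[2t]!≡ : ∀ t → natℚ ((2 ℕ.* t) !) ≡ natℚ 4 ^ t * (natℚ (t !) * rising ½ t)
[2t]!≡ zero    = refl
[2t]!≡ (suc t) = begin
  natℚ ((2 ℕ.* suc t) !)
    ≡⟨ cong (λ k → natℚ (k !)) (ℕP.*-suc 2 t) ⟩
  natℚ (suc (suc (2 ℕ.* t)) ℕ.* (suc (2 ℕ.* t) ℕ.* (2 ℕ.* t) !))
    ≡⟨ trans (natℚ-* (suc (suc (2 ℕ.* t))) (suc (2 ℕ.* t) ℕ.* (2 ℕ.* t) !))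
             (cong (natℚ (suc (suc (2 ℕ.* t))) *_) (natℚ-* (suc (2 ℕ.* t)) ((2 ℕ.* t) !))) ⟩
  natℚ (suc (suc (2 ℕ.* t))) * (natℚ (suc (2 ℕ.* t)) * natℚ ((2 ℕ.* t) !))
    ≡⟨ cong₂ (λ x y → x * (y * natℚ ((2 ℕ.* t) !))) 2t+2 2t+1 ⟩
  (1ℚ + 1ℚ + (n + n)) * ((1ℚ + (n + n)) * natℚ ((2 ℕ.* t) !))
    ≡⟨ cong (λ z → (1ℚ + 1ℚ + (n + n)) * ((1ℚ + (n + n)) * z)) ([2t]!≡ t) ⟩
  (1ℚ + 1ℚ + (n + n)) * ((1ℚ + (n + n)) * (natℚ 4 ^ t * (natℚ (t !) * rising ½ t)))
    ≡⟨ solve 4 (λ n p f r → (con 1ℚ :+ con 1ℚ :+ (n :+ n)) :* ((con 1ℚ :+ (n :+ n)) :* (p :* (f :* r)))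
                 := (con (natℚ 4) :* p) :* (((con 1ℚ :+ n) :* f) :* (r :* (con ½ :+ n)))) refl n (natℚ 4 ^ t) (natℚ (t !)) (rising ½ t) ⟩
  natℚ 4 ^ suc t * (((1ℚ + n) * natℚ (t !)) * (rising ½ t * (½ + n)))
    ≡⟨ cong₂ (λ x y → natℚ 4 ^ suc t * (x * y)) (trans (cong (_* natℚ (t !)) (sym (natℚ-suc t))) (sym (natℚ-* (suc t) (t !))))
                                                 (sym (rising-suc ½ t)) ⟩
  natℚ 4 ^ suc t * (natℚ (suc t !) * rising ½ (suc t)) ∎
  where
  n = natℚ t
  2t+1 : natℚ (suc (2 ℕ.* t)) ≡ 1ℚ + (n + n)
  2t+1 = trans (natℚ-suc (2 ℕ.* t)) (cong (1ℚ +_) (trans (cong (λ k → natℚ (t ℕ.+ k)) (ℕP.+-identityʳ t)) (natℚ-+ t t)))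
  2t+2 : natℚ (suc (suc (2 ℕ.* t))) ≡ 1ℚ + 1ℚ + (n + n)
  2t+2 = trans (natℚ-suc (suc (2 ℕ.* t))) (trans (cong (1ℚ +_) 2t+1) (sym (ℚP.+-assoc 1ℚ 1ℚ (n + n))))

inv![2t]*rising : ∀ t → inv! (2 ℕ.* t) * rising ½ t ≡ ¼ ^ t * inv! t
inv![2t]*rising t = begin
  i * r  ≡⟨ solve 2 (λ a b → a :* b := a :* b :* con 1ℚ :* con 1ℚ) refl i r ⟩
  i * r * 1ℚ * 1ℚ
    ≡⟨ cong₂ (λ x y → i * r * x * y) (sym (^-inverse (natℚ 4) ¼ t refl)) (sym (natℚ*1/ℕ (t !) {{t !≢0}})) ⟩
  i * r * (natℚ 4 ^ t * ¼ ^ t) * (natℚ (t !) * inv! t)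
    ≡⟨ solve 6 (λ i r a b c d → i :* r :* (a :* b) :* (c :* d) := (i :* (a :* (c :* r))) :* (b :* d)) refl i r (natℚ 4 ^ t) (¼ ^ t) (natℚ (t !)) (inv! t) ⟩
  (i * (natℚ 4 ^ t * (natℚ (t !) * r))) * (¼ ^ t * inv! t)
    ≡⟨ cong (λ z → (i * z) * (¼ ^ t * inv! t)) (sym ([2t]!≡ t)) ⟩
  (i * natℚ ((2 ℕ.* t) !)) * (¼ ^ t * inv! t)
    ≡⟨ trans (cong (_* (¼ ^ t * inv! t)) (1/ℕ*natℚ ((2 ℕ.* t) !) {{(2 ℕ.* t) !≢0}})) (ℚP.*-identityˡ _) ⟩
  ¼ ^ t * inv! t ∎
  where
  i = inv! (2 ℕ.* t)
  r = rising ½ t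

binom*factorials : ∀ {l t} → t ≤ l → binomℚ l t * (natℚ (t !) * natℚ ((l ∸ t) !)) ≡ natℚ (l !)
binom*factorials {l} {t} t≤l = begin
  binomℚ l t * (natℚ (t !) * natℚ ((l ∸ t) !))  ≡⟨ cong (binomℚ l t *_) (sym (natℚ-* (t !) ((l ∸ t) !))) ⟩
  binomℚ l t * natℚ (t ! ℕ.* (l ∸ t) !)         ≡⟨ sym (natℚ-* (l C t) (t ! ℕ.* (l ∸ t) !)) ⟩
  natℚ ((l C t) ℕ.* (t ! ℕ.* (l ∸ t) !))        ≡⟨ cong natℚ (trans (cong (ℕ._* (t ! ℕ.* (l ∸ t) !)) (nCk≡n!/k![n-k]! t≤l))
                                                                      (m/n*n≡m (k![n∸k]!∣n! t≤l))) ⟩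
  natℚ (l !) ∎
  where instance _ = m*n≢0 (t !) ((l ∸ t) !) {{t !≢0}} {{(l ∸ t) !≢0}}

inv!*inv!≡binom*inv! : ∀ {l t} → t ≤ l → inv! t * inv! (l ∸ t) ≡ binomℚ l t * inv! l
inv!*inv!≡binom*inv! {l} {t} t≤l = begin
  i * j                          ≡⟨ solve 2 (λ a b → a :* b := a :* b :* con 1ℚ) refl i j ⟩
  i * j * 1ℚ                     ≡⟨ cong (i * j *_) (sym (natℚ*1/ℕ (l !) {{l !≢0}})) ⟩
  i * j * (natℚ (l !) * inv! l)  ≡⟨ cong (λ x → i * j * (x * inv! l)) (sym (binom*factorials t≤l)) ⟩
  i * j * ((binomℚ l t * (natℚ (t !) * natℚ ((l ∸ t) !))) * inv! l)
    ≡⟨ solve 6 (λ i j b n m k → i :* j :* ((b :* (n :* m)) :* k) := (b :* k) :* ((i :* n) :* (j :* m)))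
               refl i j (binomℚ l t) (natℚ (t !)) (natℚ ((l ∸ t) !)) (inv! l) ⟩
  binomℚ l t * inv! l * ((i * natℚ (t !)) * (j * natℚ ((l ∸ t) !)))
    ≡⟨ cong₂ (λ x y → binomℚ l t * inv! l * (x * y)) (1/ℕ*natℚ (t !) {{t !≢0}}) (1/ℕ*natℚ ((l ∸ t) !) {{(l ∸ t) !≢0}}) ⟩
  binomℚ l t * inv! l * (1ℚ * 1ℚ)  ≡⟨ ℚP.*-identityʳ (binomℚ l t * inv! l) ⟩
  binomℚ l t * inv! l ∎
  where
  i = inv! t
  j = inv! (l ∸ t)

μ-+ : ∀ t t′ → μ (t ℕ.+ t′) ≡ μ t * (rising (½ + natℚ t) t′ * ½ ^ t′)
μ-+ t zero     = trans (cong μ (ℕP.+-identityʳ t)) (solve 1 (λ m → m := m :* (con 1ℚ :* con 1ℚ)) refl (μ t))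
μ-+ t (suc t′) = begin
  μ (t ℕ.+ suc t′)                            ≡⟨ cong μ (ℕP.+-suc t t′) ⟩
  μ (suc (t ℕ.+ t′))                          ≡⟨ μ-suc (t ℕ.+ t′) ⟩
  ½ * ((½ + natℚ (t ℕ.+ t′)) * μ (t ℕ.+ t′))  ≡⟨ cong₂ (λ x y → ½ * ((½ + x) * y)) (natℚ-+ t t′) (μ-+ t t′) ⟩
  ½ * ((½ + (natℚ t + natℚ t′)) * (μ t * (ρ * ½ ^ t′)))
    ≡⟨ solve 5 (λ a b m p w → con ½ :* ((con ½ :+ (a :+ b)) :* (m :* (p :* w))) := m :* ((p :* (con ½ :+ a :+ b)) :* (con ½ :* w)))
               refl (natℚ t) (natℚ t′) (μ t) ρ (½ ^ t′) ⟩
  μ t * ((ρ * (½ + natℚ t + natℚ t′)) * ½ ^ suc t′)  ≡⟨ cong (λ z → μ t * (z * ½ ^ suc t′)) (sym (rising-suc (½ + natℚ t) t′)) ⟩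
  μ t * (rising (½ + natℚ t) (suc t′) * ½ ^ suc t′) ∎
  where ρ = rising (½ + natℚ t) t′

weight*μ : ∀ l t → weight l t * μ t ≡ ½ ^ l * (inv! t * inv! (l ∸ t))
weight*μ l t = begin
  weight l t * (rising ½ t * h)
    ≡⟨ cong (_* (rising ½ t * h)) (weight≡ l t) ⟩
  e * (½ ^ l * (inv! (2 ℕ.* t) * j)) * (rising ½ t * h)
    ≡⟨ solve 6 (λ e a i j r h → e :* (a :* (i :* j)) :* (r :* h) := a :* ((i :* r) :* j) :* (e :* h)) refl e (½ ^ l) (inv! (2 ℕ.* t)) j (rising ½ t) h ⟩
  ½ ^ l * ((inv! (2 ℕ.* t) * rising ½ t) * j) * (e * h)
    ≡⟨ cong₂ (λ x y → ½ ^ l * (x * j) * (e * y)) (inv![2t]*rising t) (sym (ℚP.*-identityˡ h)) ⟩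
  ½ ^ l * ((¼ ^ t * inv! t) * j) * (e * (1ℚ * h))
    ≡⟨ cong (λ x → ½ ^ l * ((x * inv! t) * j) * (e * (1ℚ * h))) (^-distrib-* ½ ½ t) ⟩
  ½ ^ l * ((h * h * inv! t) * j) * (e * (1ℚ * h))
    ≡⟨ solve 5 (λ a h i j e → a :* ((h :* h :* i) :* j) :* (e :* (con 1ℚ :* h)) := a :* (i :* j) :* (e :* (h :* h :* h))) refl (½ ^ l) h (inv! t) j e ⟩
  ½ ^ l * (inv! t * j) * (e * (h * h * h))
    ≡⟨ trans (cong (½ ^ l * (inv! t * j) *_) (2^3t*½^3t≡1 t)) (ℚP.*-identityʳ _) ⟩
  ½ ^ l * (inv! t * j) ∎
  where
  e = natℚ (2 ℕ.^ (3 ℕ.* t))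
  h = ½ ^ t
  j = inv! (l ∸ t)

signedWeight : ℕ → ℕ → ℚ
signedWeight l t = signℚ t * weight l t

signedWeight*μ : ∀ {l t} t′ → t ≤ l →
  signedWeight l t * μ (t ℕ.+ t′) ≡ (½ ^ l * inv! l * ½ ^ t′) * (signℚ t * binomℚ l t * rising (½ + natℚ t) t′)
signedWeight*μ {l} {t} t′ t≤l = begin
  signℚ t * weight l t * μ (t ℕ.+ t′)
    ≡⟨ cong (signℚ t * weight l t *_) (μ-+ t t′) ⟩
  signℚ t * weight l t * (μ t * (ρ * ½ ^ t′))
    ≡⟨ solve 5 (λ s w m r h → s :* w :* (m :* (r :* h)) := s :* (w :* m) :* r :* h) refl (signℚ t) (weight l t) (μ t) ρ (½ ^ t′) ⟩
  signℚ t * (weight l t * μ t) * ρ * ½ ^ t′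
    ≡⟨ cong (λ x → signℚ t * x * ρ * ½ ^ t′) (trans (weight*μ l t) (cong (½ ^ l *_) (inv!*inv!≡binom*inv! t≤l))) ⟩
  signℚ t * (½ ^ l * (binomℚ l t * inv! l)) * ρ * ½ ^ t′
    ≡⟨ solve 6 (λ s a b i r h → s :* (a :* (b :* i)) :* r :* h := (a :* i :* h) :* (s :* b :* r)) refl (signℚ t) (½ ^ l) (binomℚ l t) (inv! l) ρ (½ ^ t′) ⟩
  (½ ^ l * inv! l * ½ ^ t′) * (signℚ t * binomℚ l t * ρ) ∎
  where ρ = rising (½ + natℚ t) t′

gram : ℕ → ℕ → ℚ
gram l m = sumℚ (suc l) (λ t → sumℚ (suc m) (λ t′ → signedWeight l t * signedWeight m t′ * μ (t ℕ.+ t′)))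

gram≡ : ∀ l m → gram l m ≡ sumℚ (suc m) (λ t′ → signedWeight m t′ * ((½ ^ l * inv! l * ½ ^ t′) * altBinomSum-rising l ½ t′))
gram≡ l m = begin
  gram l m
    ≡⟨ sum-swap (suc l) (suc m) (λ t t′ → signedWeight l t * signedWeight m t′ * μ (t ℕ.+ t′)) ⟩
  sumℚ (suc m) (λ t′ → sumℚ (suc l) (λ t → signedWeight l t * signedWeight m t′ * μ (t ℕ.+ t′)))
    ≡⟨ sum-cong (suc m) (λ t′ → trans (sum-cong (suc l) (λ t → solve 3 (λ a b c → a :* b :* c := b :* (a :* c)) refl (signedWeight l t) (signedWeight m t′) (μ (t ℕ.+ t′))))
         (trans (sym (*-distribˡ-sum (suc l) (signedWeight m t′) (λ t → signedWeight l t * μ (t ℕ.+ t′)))) (cong (signedWeight m t′ *_) (inner t′)))) ⟩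
  sumℚ (suc m) (λ t′ → signedWeight m t′ * ((½ ^ l * inv! l * ½ ^ t′) * altBinomSum-rising l ½ t′)) ∎
  where
  inner : ∀ t′ → sumℚ (suc l) (λ t → signedWeight l t * μ (t ℕ.+ t′)) ≡ (½ ^ l * inv! l * ½ ^ t′) * altBinomSum-rising l ½ t′
  inner t′ = trans (sum-cong< (suc l) (λ t t≤l → signedWeight*μ t′ (ℕP.≤-pred t≤l)))
    (sym (*-distribˡ-sum (suc l) (½ ^ l * inv! l * ½ ^ t′) (λ t → signℚ t * binomℚ l t * rising (½ + natℚ t) t′)))

gram-vanishes : ∀ {l m} → m < l → gram l m ≡ 0ℚ
gram-vanishes {l} {m} m<l = trans (gram≡ l m) (sum-zero (suc m) (λ t′ t′≤m → begin
  signedWeight m t′ * ((½ ^ l * inv! l * ½ ^ t′) * altBinomSum-rising l ½ t′)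
    ≡⟨ cong (λ x → signedWeight m t′ * ((½ ^ l * inv! l * ½ ^ t′) * x)) (altBinomSum-rising-vanishes l ½ t′ (ℕP.<-≤-trans t′≤m m<l)) ⟩
  signedWeight m t′ * ((½ ^ l * inv! l * ½ ^ t′) * 0ℚ)
    ≡⟨ solve 2 (λ a b → a :* (b :* con 0ℚ) := con 0ℚ) refl (signedWeight m t′) (½ ^ l * inv! l * ½ ^ t′) ⟩
  0ℚ ∎))

gram-sym : ∀ l m → gram l m ≡ gram m l
gram-sym l m = trans (sum-swap (suc l) (suc m) (λ t t′ → signedWeight l t * signedWeight m t′ * μ (t ℕ.+ t′)))
  (sum-cong (suc m) (λ t′ → sum-cong (suc l) (λ t → cong₂ (λ x y → x * μ y) (ℚP.*-comm (signedWeight l t) (signedWeight m t′)) (ℕP.+-comm t t′))))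

signedWeight-diagonal : ∀ l → signedWeight l l * ((½ ^ l * inv! l * ½ ^ l) * (signℚ l * natℚ (l !))) ≡ inv! (2 ℕ.* l)
signedWeight-diagonal l = begin
  signℚ l * weight l l * ((h * inv! l * h) * (signℚ l * natℚ (l !)))
    ≡⟨ cong (λ x → signℚ l * x * ((h * inv! l * h) * (signℚ l * natℚ (l !)))) (weight≡ l l) ⟩
  signℚ l * (e * (h * (i * j))) * ((h * inv! l * h) * (signℚ l * natℚ (l !)))
    ≡⟨ solve 7 (λ s e h i j f n → s :* (e :* (h :* (i :* j))) :* ((h :* f :* h) :* (s :* n))
                 := i :* (((s :* s) :* (e :* (h :* h :* h))) :* (j :* (f :* n)))) refl (signℚ l) e h i j (inv! l) (natℚ (l !)) ⟩
  i * (((signℚ l * signℚ l) * (e * (h * h * h))) * (j * (inv! l * natℚ (l !))))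
    ≡⟨ cong₂ (λ x y → i * (x * y)) (cong₂ _*_ (signℚ-square l) (2^3t*½^3t≡1 l)) (cong₂ _*_ j≡1 (1/ℕ*natℚ (l !) {{l !≢0}})) ⟩
  i * ((1ℚ * 1ℚ) * (1ℚ * 1ℚ))
    ≡⟨ ℚP.*-identityʳ i ⟩
  i ∎
  where
  h = ½ ^ l
  e = natℚ (2 ℕ.^ (3 ℕ.* l))
  i = inv! (2 ℕ.* l)
  j = inv! (l ∸ l)
  j≡1 : j ≡ 1ℚ
  j≡1 = cong inv! (ℕP.n∸n≡0 l)

gram-diagonal : ∀ l → gram l l ≡ inv! (2 ℕ.* l)
gram-diagonal l = begin
  gram l l
    ≡⟨ gram≡ l l ⟩
  sumℚ l T + T l
    ≡⟨ cong (_+ T l) (sum-zero l (λ t′ t′<l → trans (cong (λ x → signedWeight l t′ * ((½ ^ l * inv! l * ½ ^ t′) * x))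
                                                        (altBinomSum-rising-vanishes l ½ t′ t′<l))
                                                  (solve 2 (λ a b → a :* (b :* con 0ℚ) := con 0ℚ) refl (signedWeight l t′) (½ ^ l * inv! l * ½ ^ t′)))) ⟩
  0ℚ + T l
    ≡⟨ trans (ℚP.+-identityˡ (T l)) (cong (λ x → signedWeight l l * ((½ ^ l * inv! l * ½ ^ l) * x)) (altBinomSum-rising-top l ½)) ⟩
  signedWeight l l * ((½ ^ l * inv! l * ½ ^ l) * (signℚ l * natℚ (l !)))
    ≡⟨ signedWeight-diagonal l ⟩
  inv! (2 ℕ.* l) ∎
  where
  T = λ t′ → signedWeight l t′ * ((½ ^ l * inv! l * ½ ^ t′) * altBinomSum-rising l ½ t′)

gram≡δ : ∀ l m → gram l m ≡ δ l m * inv! (2 ℕ.* l)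
gram≡δ l m = by-cases (ℕP.<-cmp l m)
  where
  by-cases : Tri (l < m) (l ≡ m) (m < l) → gram l m ≡ δ l m * inv! (2 ℕ.* l)
  by-cases (tri< l<m _ _) = trans (gram-sym l m) (trans (gram-vanishes l<m) (sym (trans (cong (_* inv! (2 ℕ.* l)) (δ-≢ (ℕP.<⇒≢ l<m))) (ℚP.*-zeroˡ (inv! (2 ℕ.* l))))))
  by-cases (tri≈ _ refl _) = trans (gram-diagonal l) (sym (trans (cong (_* inv! (2 ℕ.* l)) (δ-refl l)) (ℚP.*-identityˡ (inv! (2 ℕ.* l)))))
  by-cases (tri> _ _ m<l) = trans (gram-vanishes m<l) (sym (trans (cong (_* inv! (2 ℕ.* l)) (δ-≢ (ℕP.>⇒≢ m<l))) (ℚP.*-zeroˡ (inv! (2 ℕ.* l)))))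

-- The inverse of the Hankel matrix of ν

polyCoeff : ℚ → ℕ → ℕ → ℚ
polyCoeff e k l = sumℚ (suc l) (λ t → signedWeight l t * coeff↑ e ¼ t k)

polyCoeff-upper : ∀ e k l → l < k → polyCoeff e k l ≡ 0ℚ
polyCoeff-upper e k l l<k = sum-zero (suc l) (λ t t≤l →
  trans (cong (signedWeight l t *_) (coeff↑-vanishes e ¼ t k (ℕP.<-≤-trans t≤l l<k))) (ℚP.*-zeroʳ (signedWeight l t)))

polyCoeff-diagonal : ∀ e l → polyCoeff e l l ≡ signedWeight l l * e ^ l
polyCoeff-diagonal e l = begin
  sumℚ l (λ t → signedWeight l t * coeff↑ e ¼ t l) + signedWeight l l * coeff↑ e ¼ l l
    ≡⟨ cong₂ _+_ (sum-zero l (λ t t<l → trans (cong (signedWeight l t *_) (coeff↑-vanishes e ¼ t l t<l)) (ℚP.*-zeroʳ (signedWeight l t))))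
                 (cong (signedWeight l l *_) (coeff↑-top e ¼ l)) ⟩
  0ℚ + signedWeight l l * e ^ l
    ≡⟨ ℚP.+-identityˡ (signedWeight l l * e ^ l) ⟩
  signedWeight l l * e ^ l ∎

polyCoeff-diagonal≢0 : ∀ e l → e * e ≡ 1ℚ → polyCoeff e l l ≢ 0ℚ
polyCoeff-diagonal≢0 e l e²≡1 p≡0 = inv!≢0 (2 ℕ.* l) (begin
  inv! (2 ℕ.* l)  ≡⟨ sym (signedWeight-diagonal l) ⟩
  signedWeight l l * c
    ≡⟨ cong (λ x → x * c) (sym (trans (cong (signedWeight l l *_) (^-inverse e e l e²≡1)) (ℚP.*-identityʳ (signedWeight l l)))) ⟩
  signedWeight l l * (e ^ l * e ^ l) * c  ≡⟨ cong (_* c) (sym (ℚP.*-assoc (signedWeight l l) (e ^ l) (e ^ l))) ⟩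
  signedWeight l l * e ^ l * e ^ l * c    ≡⟨ cong (λ x → x * e ^ l * c) (trans (sym (polyCoeff-diagonal e l)) p≡0) ⟩
  0ℚ * e ^ l * c                          ≡⟨ solve 2 (λ a c → con 0ℚ :* a :* c := con 0ℚ) refl (e ^ l) c ⟩
  0ℚ ∎)
  where c = (½ ^ l * inv! l * ½ ^ l) * (signℚ l * natℚ (l !))

polyCoeff-scale : ∀ c e k l → polyCoeff (c * e) k l ≡ c ^ k * polyCoeff e k l
polyCoeff-scale c e k l = trans (sum-cong (suc l) (λ t → trans (cong (signedWeight l t *_) (coeff↑-scale c e ¼ t k))
    (solve 3 (λ w p x → w :* (p :* x) := p :* (w :* x)) refl (signedWeight l t) (c ^ k) (coeff↑ e ¼ t k))))
  (sym (*-distribˡ-sum (suc l) (c ^ k) (λ t → signedWeight l t * coeff↑ e ¼ t k)))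

orthogonality : ∀ L l m → l < L → m < L →
  sumℚ L (λ r → polyCoeff (- 1ℚ) r l * sumℚ L (λ s → ν (r ℕ.+ s) * polyCoeff 1ℚ s m)) ≡ δ l m * inv! (2 ℕ.* l)
orthogonality L l m l<L m<L = begin
  sumℚ L (λ r → polyCoeff (- 1ℚ) r l * sumℚ L (λ s → ν (r ℕ.+ s) * polyCoeff 1ℚ s m))
    ≡⟨ sum-cong L (λ r → trans (cong (polyCoeff (- 1ℚ) r l *_) (sum-*-sum L (suc m) (λ s → ν (r ℕ.+ s)) (signedWeight m) (λ s t′ → B t′ s)))
                               (ℚP.*-comm (polyCoeff (- 1ℚ) r l) (X r))) ⟩
  sumℚ L (λ r → X r * sumℚ (suc l) (λ t → signedWeight l t * A t r))
    ≡⟨ sum-*-sum L (suc l) X (signedWeight l) (λ r t → A t r) ⟩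
  sumℚ (suc l) (λ t → signedWeight l t * sumℚ L (λ r → X r * A t r))
    ≡⟨ sum-cong (suc l) (λ t → cong (signedWeight l t *_) (trans (sum-cong L (λ r → ℚP.*-comm (X r) (A t r)))
                                                                  (sum-*-sum L (suc m) (A t) (signedWeight m) (λ r t′ → sumℚ L (λ s → ν (r ℕ.+ s) * B t′ s))))) ⟩
  sumℚ (suc l) (λ t → signedWeight l t * sumℚ (suc m) (λ t′ → signedWeight m t′ * sumℚ L (λ r → A t r * sumℚ L (λ s → ν (r ℕ.+ s) * B t′ s))))
    ≡⟨ sum-cong< (suc l) (λ t t≤l → cong (signedWeight l t *_) (sum-cong< (suc m) (λ t′ t′≤m → cong (signedWeight m t′ *_) (begin
         sumℚ L (λ r → A t r * sumℚ L (λ s → ν (r ℕ.+ s) * B t′ s))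
           ≡⟨ sum-cong L (λ r → cong (A t r *_) (sum-cong L (λ s → ℚP.*-comm (ν (r ℕ.+ s)) (B t′ s)))) ⟩
         sumℚ L (λ r → A t r * sumℚ L (λ s → B t′ s * ν (r ℕ.+ s)))
           ≡⟨ sym (𝓜≡double-sum t t′ L (ℕP.≤-<-trans (ℕP.≤-pred t≤l) l<L) (ℕP.≤-<-trans (ℕP.≤-pred t′≤m) m<L)) ⟩
         𝓜 t t′
           ≡⟨ 𝓜≡μ t t′ ⟩
         μ (t ℕ.+ t′) ∎)))) ⟩
  sumℚ (suc l) (λ t → signedWeight l t * sumℚ (suc m) (λ t′ → signedWeight m t′ * μ (t ℕ.+ t′)))
    ≡⟨ sum-cong (suc l) (λ t → trans (*-distribˡ-sum (suc m) (signedWeight l t) (λ t′ → signedWeight m t′ * μ (t ℕ.+ t′)))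
                                     (sum-cong (suc m) (λ t′ → sym (ℚP.*-assoc (signedWeight l t) (signedWeight m t′) (μ (t ℕ.+ t′)))))) ⟩
  gram l m
    ≡⟨ gram≡δ l m ⟩
  δ l m * inv! (2 ℕ.* l) ∎
  where
  A = coeff↑ (- 1ℚ) ¼
  B = coeff↑ 1ℚ ¼
  X : ℕ → ℚ
  X r = sumℚ (suc m) (λ t′ → signedWeight m t′ * sumℚ L (λ s → ν (r ℕ.+ s) * B t′ s))

hankelInverse : ℕ → ℕ → ℕ → ℚ
hankelInverse L k j = sumℚ L (λ ℓ → polyCoeff 1ℚ k ℓ * natℚ ((2 ℕ.* ℓ) !) * polyCoeff (- 1ℚ) j ℓ)

hankel-right-inverse : ∀ L i j → i < L → j < L → sumℚ L (λ s → ν (i ℕ.+ s) * hankelInverse L s j) ≡ δ i j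
hankel-right-inverse L = biorthogonal⇒right-inverse L (polyCoeff (- 1ℚ)) (polyCoeff 1ℚ) (λ r s → ν (r ℕ.+ s))
  (λ l → inv! (2 ℕ.* l)) (λ l → natℚ ((2 ℕ.* l) !))
  (λ r l → polyCoeff-upper (- 1ℚ) r l) (λ l → polyCoeff-diagonal≢0 (- 1ℚ) l refl)
  (λ l _ → 1/ℕ*natℚ ((2 ℕ.* l) !) {{(2 ℕ.* l) !≢0}}) (orthogonality L)

-- H is symmetric, so transposing the biorthogonality exchanges the roles of p̂ and p̌.
hankel-left-inverse : ∀ L i j → i < L → j < L → sumℚ L (λ s → hankelInverse L i s * ν (s ℕ.+ j)) ≡ δ i j
hankel-left-inverse L i j i<L j<L = begin
  sumℚ L (λ s → hankelInverse L i s * ν (s ℕ.+ j))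
    ≡⟨ sum-cong L (λ s → trans (ℚP.*-comm (hankelInverse L i s) (ν (s ℕ.+ j)))
         (cong₂ _*_ (cong ν (ℕP.+-comm s j)) (sum-cong L (λ ℓ → solve 3 (λ p w q → p :* w :* q := q :* w :* p) refl
           (polyCoeff 1ℚ i ℓ) (natℚ ((2 ℕ.* ℓ) !)) (polyCoeff (- 1ℚ) s ℓ))))) ⟩
  sumℚ L (λ s → ν (j ℕ.+ s) * sumℚ L (λ ℓ → polyCoeff (- 1ℚ) s ℓ * natℚ ((2 ℕ.* ℓ) !) * polyCoeff 1ℚ i ℓ))
    ≡⟨ biorthogonal⇒right-inverse L (polyCoeff 1ℚ) (polyCoeff (- 1ℚ)) (λ r s → ν (r ℕ.+ s))
         (λ l → inv! (2 ℕ.* l)) (λ l → natℚ ((2 ℕ.* l) !))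
         (λ r l → polyCoeff-upper 1ℚ r l) (λ l → polyCoeff-diagonal≢0 1ℚ l refl)
         (λ l _ → 1/ℕ*natℚ ((2 ℕ.* l) !) {{(2 ℕ.* l) !≢0}}) transposed j i j<L i<L ⟩
  δ j i
    ≡⟨ δ-sym j i ⟩
  δ i j ∎
  where
  transposed : ∀ l m → l < L → m < L →
    sumℚ L (λ r → polyCoeff 1ℚ r l * sumℚ L (λ s → ν (r ℕ.+ s) * polyCoeff (- 1ℚ) s m)) ≡ δ l m * inv! (2 ℕ.* l)
  transposed l m l<L m<L = begin
    sumℚ L (λ r → polyCoeff 1ℚ r l * sumℚ L (λ s → ν (r ℕ.+ s) * polyCoeff (- 1ℚ) s m))
      ≡⟨ sum-cong L (λ r → cong (polyCoeff 1ℚ r l *_) (sum-cong L (λ s →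
           trans (cong (_* polyCoeff (- 1ℚ) s m) (cong ν (ℕP.+-comm r s))) (ℚP.*-comm (ν (s ℕ.+ r)) (polyCoeff (- 1ℚ) s m))))) ⟩
    sumℚ L (λ r → polyCoeff 1ℚ r l * sumℚ L (λ s → polyCoeff (- 1ℚ) s m * ν (s ℕ.+ r)))
      ≡⟨ sum-*-sum L L (λ r → polyCoeff 1ℚ r l) (λ s → polyCoeff (- 1ℚ) s m) (λ r s → ν (s ℕ.+ r)) ⟩
    sumℚ L (λ s → polyCoeff (- 1ℚ) s m * sumℚ L (λ r → polyCoeff 1ℚ r l * ν (s ℕ.+ r)))
      ≡⟨ sum-cong L (λ s → cong (polyCoeff (- 1ℚ) s m *_) (sum-cong L (λ r → ℚP.*-comm (polyCoeff 1ℚ r l) (ν (s ℕ.+ r))))) ⟩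
    sumℚ L (λ s → polyCoeff (- 1ℚ) s m * sumℚ L (λ r → ν (s ℕ.+ r) * polyCoeff 1ℚ r l))
      ≡⟨ orthogonality L m l m<L l<L ⟩
    δ m l * inv! (2 ℕ.* m)
      ≡⟨ δ*-swap l m (λ k → inv! (2 ℕ.* k)) ⟩
    δ l m * inv! (2 ℕ.* l) ∎

-- The matrices of the theorem

ω ζ : ℚ[i]
ω = 0ℚ +i natℚ 2
ζ = 0ℚ +i (- ½)

ω*ζ≡1 : ω *G ζ ≡ 1G
ω*ζ≡1 = refl

ζ*ω≡1 : ζ *G ω ≡ 1G
ζ*ω≡1 = refl

ω*ω≡-4 : ω *G ω ≡ ι (- natℚ 4)
ω*ω≡-4 = refl

⊛P-linFactor-zero : ∀ p t → (p ⊛P linFactor t) 0 ≡ p 0 *G linFactor t 0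
⊛P-linFactor-zero p t = +G-identityˡ (p 0 *G linFactor t 0)

⊛P-linFactor-suc : ∀ p t r → (p ⊛P linFactor t) (suc r) ≡ (p r *G ζ) +G (p (suc r) *G linFactor t 0)
⊛P-linFactor-suc p t r = begin
  (sumG r f +G f r) +G f (suc r)
    ≡⟨ cong₂ (λ x y → (x +G y) +G f (suc r)) (sumG-zero r vanishing) (cong (λ k → p r *G linFactor t k) (ℕP.m+n∸n≡m 1 r)) ⟩
  (0G +G (p r *G ζ)) +G f (suc r)
    ≡⟨ cong₂ _+G_ (+G-identityˡ (p r *G ζ)) (cong (λ k → p (suc r) *G linFactor t k) (ℕP.n∸n≡0 r)) ⟩
  (p r *G ζ) +G (p (suc r) *G linFactor t 0) ∎
  where
  f : ℕ → ℚ[i]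
  f i = p i *G linFactor t (suc r ∸ i)
  vanishing : ∀ i → i < r → f i ≡ 0G
  vanishing i i<r = trans (cong (λ k → p i *G linFactor t k)
                                (trans (ℕP.+-∸-assoc 1 (ℕP.<⇒≤ i<r)) (cong suc (ℕP.+-∸-assoc 1 i<r))))
                          (*G-zeroʳ (p i))

prodLin≡ : ∀ t r → prodLin t r ≡ coeff↑ 1ℚ ¼ t r ·G ζ ^G r
prodLin≡ zero    zero    = refl
prodLin≡ zero    (suc r) = sym (0·G (ζ ^G suc r))
prodLin≡ (suc t) zero    = begin
  (prodLin t ⊛P linFactor t) 0    ≡⟨ ⊛P-linFactor-zero (prodLin t) t ⟩
  prodLin t 0 *G ι c              ≡⟨ cong (_*G ι c) (prodLin≡ t 0) ⟩
  (coeff↑ 1ℚ ¼ t 0 ·G 1G) *G ι c  ≡⟨ trans (*G-ι (coeff↑ 1ℚ ¼ t 0 ·G 1G) c) (·G-assoc c (coeff↑ 1ℚ ¼ t 0) 1G) ⟩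
  (c * coeff↑ 1ℚ ¼ t 0) ·G 1G     ≡⟨ cong (λ x → (x * coeff↑ 1ℚ ¼ t 0) ·G 1G) (ℚP.+-comm (natℚ t) ¼) ⟩
  ((¼ + natℚ t) * coeff↑ 1ℚ ¼ t 0) ·G 1G ∎
  where c = natℚ t + ¼
prodLin≡ (suc t) (suc r) = begin
  (prodLin t ⊛P linFactor t) (suc r)
    ≡⟨ ⊛P-linFactor-suc (prodLin t) t r ⟩
  (prodLin t r *G ζ) +G (prodLin t (suc r) *G ι c)
    ≡⟨ cong₂ (λ x y → (x *G ζ) +G (y *G ι c)) (prodLin≡ t r) (prodLin≡ t (suc r)) ⟩
  ((B r ·G ζ ^G r) *G ζ) +G ((B (suc r) ·G ζ ^G suc r) *G ι c)
    ≡⟨ cong₂ _+G_ (trans (·G-*G (B r) (ζ ^G r) ζ) (cong (B r ·G_) (*G-comm (ζ ^G r) ζ)))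
                  (trans (*G-ι (B (suc r) ·G ζ ^G suc r) c) (·G-assoc c (B (suc r)) (ζ ^G suc r))) ⟩
  (B r ·G ζ ^G suc r) +G ((c * B (suc r)) ·G ζ ^G suc r)
    ≡⟨ ·G-distribʳ (B r) (c * B (suc r)) (ζ ^G suc r) ⟩
  (B r + c * B (suc r)) ·G ζ ^G suc r
    ≡⟨ cong (_·G ζ ^G suc r) (solve 3 (λ a b k → a :+ (k :+ con ¼) :* b := (con ¼ :+ k) :* b :+ con 1ℚ :* a) refl (B r) (B (suc r)) (natℚ t)) ⟩
  ((¼ + natℚ t) * B (suc r) + 1ℚ * B r) ·G ζ ^G suc r ∎
  where
  c = natℚ t + ¼
  B = coeff↑ 1ℚ ¼ t

a≡ : ∀ k ℓ → a k ℓ ≡ polyCoeff 1ℚ k ℓ ·G ζ ^G k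
a≡ k ℓ = begin
  sumG (suc ℓ) (λ t → signedWeight ℓ t ·G prodLin t k)
    ≡⟨ sumG-cong (suc ℓ) (λ t → trans (cong (signedWeight ℓ t ·G_) (prodLin≡ t k)) (·G-assoc (signedWeight ℓ t) (coeff↑ 1ℚ ¼ t k) (ζ ^G k))) ⟩
  sumG (suc ℓ) (λ t → (signedWeight ℓ t * coeff↑ 1ℚ ¼ t k) ·G ζ ^G k)
    ≡⟨ sumG-·G (suc ℓ) (λ t → signedWeight ℓ t * coeff↑ 1ℚ ¼ t k) (ζ ^G k) ⟩
  polyCoeff 1ℚ k ℓ ·G ζ ^G k ∎

conj-a≡ : ∀ j ℓ → conj (a j ℓ) ≡ polyCoeff (- 1ℚ) j ℓ ·G ζ ^G j
conj-a≡ j ℓ = begin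
  conj (a j ℓ)                     ≡⟨ cong conj (a≡ j ℓ) ⟩
  conj (p ·G ζ ^G j)               ≡⟨ conj-·G p (ζ ^G j) ⟩
  p ·G conj (ζ ^G j)               ≡⟨ cong (p ·G_) (trans (conj-^G ζ j) (^G-distrib-* (ι (- 1ℚ)) ζ j)) ⟩
  p ·G (ι (- 1ℚ) ^G j *G ζ ^G j)   ≡⟨ cong (λ x → p ·G (x *G ζ ^G j)) (ι-^ (- 1ℚ) j) ⟩
  p ·G (ι ((- 1ℚ) ^ j) *G ζ ^G j)  ≡⟨ cong (p ·G_) (sym (·G≡ι*G ((- 1ℚ) ^ j) (ζ ^G j))) ⟩
  p ·G (((- 1ℚ) ^ j) ·G ζ ^G j)    ≡⟨ ·G-assoc p ((- 1ℚ) ^ j) (ζ ^G j) ⟩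
  (p * (- 1ℚ) ^ j) ·G ζ ^G j       ≡⟨ cong (_·G ζ ^G j) (trans (ℚP.*-comm p ((- 1ℚ) ^ j)) (sym (polyCoeff-scale (- 1ℚ) 1ℚ j ℓ))) ⟩
  polyCoeff (- 1ℚ) j ℓ ·G ζ ^G j ∎
  where p = polyCoeff 1ℚ j ℓ

BB*≡ : ∀ n k j → BB* n k j ≡ fromG (hankelInverse (suc n) k j ·G ζ ^G (k ℕ.+ j))
BB*≡ n k j = cong fromG (begin
  sumG (suc n) (λ ℓ → natℚ ((2 ℕ.* ℓ) !) ·G (a k ℓ *G conj (a j ℓ)))
    ≡⟨ sumG-cong (suc n) term ⟩
  sumG (suc n) (λ ℓ → (polyCoeff 1ℚ k ℓ * natℚ ((2 ℕ.* ℓ) !) * polyCoeff (- 1ℚ) j ℓ) ·G ζ ^G (k ℕ.+ j))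
    ≡⟨ sumG-·G (suc n) (λ ℓ → polyCoeff 1ℚ k ℓ * natℚ ((2 ℕ.* ℓ) !) * polyCoeff (- 1ℚ) j ℓ) (ζ ^G (k ℕ.+ j)) ⟩
  hankelInverse (suc n) k j ·G ζ ^G (k ℕ.+ j) ∎)
  where
  term : ∀ ℓ → natℚ ((2 ℕ.* ℓ) !) ·G (a k ℓ *G conj (a j ℓ))
             ≡ (polyCoeff 1ℚ k ℓ * natℚ ((2 ℕ.* ℓ) !) * polyCoeff (- 1ℚ) j ℓ) ·G ζ ^G (k ℕ.+ j)
  term ℓ = begin
    f ·G (a k ℓ *G conj (a j ℓ))           ≡⟨ cong₂ (λ x y → f ·G (x *G y)) (a≡ k ℓ) (conj-a≡ j ℓ) ⟩
    f ·G ((p̂ ·G ζ ^G k) *G (p̌ ·G ζ ^G j))  ≡⟨ cong (f ·G_) (·G-*G-·G p̂ p̌ (ζ ^G k) (ζ ^G j)) ⟩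
    f ·G ((p̂ * p̌) ·G (ζ ^G k *G ζ ^G j))   ≡⟨ ·G-assoc f (p̂ * p̌) (ζ ^G k *G ζ ^G j) ⟩
    (f * (p̂ * p̌)) ·G (ζ ^G k *G ζ ^G j)
      ≡⟨ cong₂ _·G_ (solve 3 (λ f p q → f :* (p :* q) := p :* f :* q) refl f p̂ p̌) (sym (^G-homo-* ζ k j)) ⟩
    (p̂ * f * p̌) ·G ζ ^G (k ℕ.+ j) ∎
    where
    f = natℚ ((2 ℕ.* ℓ) !)
    p̂ = polyCoeff 1ℚ k ℓ
    p̌ = polyCoeff (- 1ℚ) j ℓ

ω^even : ∀ m → isEven m ≡ true → ω ^G m ≡ ι (signℚ (half m) * natℚ 2 ^ m)
ω^even zero          _    = refl
ω^even (suc (suc m)) even = begin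
  ω *G (ω *G ω ^G m)                               ≡⟨ sym (*G-assoc ω ω (ω ^G m)) ⟩
  (ω *G ω) *G ω ^G m                               ≡⟨ cong (_*G ω ^G m) ω*ω≡-4 ⟩
  ι (- natℚ 4) *G ω ^G m                           ≡⟨ cong (ι (- natℚ 4) *G_) (ω^even m even) ⟩
  ι (- natℚ 4) *G ι (signℚ (half m) * natℚ 2 ^ m)  ≡⟨ sym (ι-* (- natℚ 4) (signℚ (half m) * natℚ 2 ^ m)) ⟩
  ι (- natℚ 4 * (signℚ (half m) * natℚ 2 ^ m))
    ≡⟨ cong ι (solve 2 (λ s p → :- con (natℚ 4) :* (s :* p) := :- s :* (con (natℚ 2) :* (con (natℚ 2) :* p))) refl (signℚ (half m)) (natℚ 2 ^ m)) ⟩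
  ι (- signℚ (half m) * natℚ 2 ^ suc (suc m)) ∎

-- The zero components are rewritten explicitly rather than left to conversion checking, which
-- would normalise rational arithmetic on open terms.
fromG-*K-√2 : ∀ x y → fromG x *K (0G +√2 y) ≡ 0G +√2 (x *G y)
fromG-*K-√2 x y = cong₂ _+√2_
  (trans (cong₂ _+G_ (*G-zeroʳ x) (trans (cong (natℚ 2 ·G_) (*G-zeroˡ y)) (·G-zeroʳ (natℚ 2)))) (+G-identityˡ 0G))
  (trans (cong ((x *G y) +G_) (*G-zeroˡ 0G)) (+G-identityʳ (x *G y)))

c₀-odd : ∀ m → isEven m ≡ false → c₀ m ≡ 0G +√2 ((½ * ν m) ·G ω ^G m)
c₀-odd m odd = begin
  c₀ m       ≡⟨ cong (λ b → if b then fromG (ι (signℚ (half m))) *K deriv0InvSqrtCosh m else 0K) odd ⟩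
  0G +√2 0G  ≡⟨ cong (0G +√2_) (sym (trans (cong (_·G ω ^G m) ½ν≡0) (0·G (ω ^G m)))) ⟩
  0G +√2 ((½ * ν m) ·G ω ^G m) ∎
  where
  ½ν≡0 : ½ * ν m ≡ 0ℚ
  ½ν≡0 = trans (cong (½ *_) (trans (ν≡ m) (cong (λ x → natℚ (m !) * (½ ^ m * x)) (Even-odd-vanishes Even-√sech m odd))))
               (solve 2 (λ f h → con ½ :* (f :* (h :* con 0ℚ)) := con 0ℚ) refl (natℚ (m !)) (½ ^ m))

c₀-even : ∀ m → isEven m ≡ true → c₀ m ≡ 0G +√2 ((½ * ν m) ·G ω ^G m)
c₀-even m even = begin
  c₀ m
    ≡⟨ cong (λ b → if b then fromG (ι s) *K deriv0InvSqrtCosh m else 0K) even ⟩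
  fromG (ι s) *K (fromG (ι f) *K (0G +√2 ι (½ * √sech m)))
    ≡⟨ cong (fromG (ι s) *K_) (fromG-*K-√2 (ι f) (ι (½ * √sech m))) ⟩
  fromG (ι s) *K (0G +√2 (ι f *G ι (½ * √sech m)))
    ≡⟨ fromG-*K-√2 (ι s) (ι f *G ι (½ * √sech m)) ⟩
  0G +√2 (ι s *G (ι f *G ι (½ * √sech m)))
    ≡⟨ cong (0G +√2_) (trans (cong (ι s *G_) (sym (ι-* f (½ * √sech m)))) (sym (ι-* s (f * (½ * √sech m))))) ⟩
  0G +√2 ι (s * (f * (½ * √sech m)))
    ≡⟨ cong (λ x → 0G +√2 ι x) coefficient ⟩
  0G +√2 ι (½ * ν m * (s * natℚ 2 ^ m))
    ≡⟨ cong (0G +√2_) (trans (ι-* (½ * ν m) (s * natℚ 2 ^ m))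
                             (sym (trans (·G≡ι*G (½ * ν m) (ω ^G m)) (cong (ι (½ * ν m) *G_) (ω^even m even))))) ⟩
  0G +√2 ((½ * ν m) ·G ω ^G m) ∎
  where
  s = signℚ (half m)
  f = natℚ (m !)
  coefficient : s * (f * (½ * √sech m)) ≡ ½ * ν m * (s * natℚ 2 ^ m)
  coefficient = begin
    s * (f * (½ * √sech m))       ≡⟨ sym (ℚP.*-identityʳ (s * (f * (½ * √sech m)))) ⟩
    s * (f * (½ * √sech m)) * 1ℚ  ≡⟨ cong (s * (f * (½ * √sech m)) *_) (sym (^-inverse ½ (natℚ 2) m refl)) ⟩
    s * (f * (½ * √sech m)) * (½ ^ m * natℚ 2 ^ m)
      ≡⟨ solve 5 (λ s f g h t → s :* (f :* (con ½ :* g)) :* (h :* t) := con ½ :* (f :* (h :* g)) :* (s :* t)) refl s f (√sech m) (½ ^ m) (natℚ 2 ^ m) ⟩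
    ½ * (f * (½ ^ m * √sech m)) * (s * natℚ 2 ^ m)  ≡⟨ cong (λ x → ½ * x * (s * natℚ 2 ^ m)) (sym (ν≡ m)) ⟩
    ½ * ν m * (s * natℚ 2 ^ m) ∎

c₀≡ : ∀ m → c₀ m ≡ 0G +√2 ((½ * ν m) ·G ω ^G m)
c₀≡ m = by-parity (isEven m) refl
  where
  by-parity : ∀ b → isEven m ≡ b → c₀ m ≡ 0G +√2 ((½ * ν m) ·G ω ^G m)
  by-parity true  = c₀-even m
  by-parity false = c₀-odd m

√2*K-fromG : ∀ y → √2 *K fromG y ≡ 0G +√2 y
√2*K-fromG y = cong₂ _+√2_
  (trans (cong₂ _+G_ (*G-zeroˡ y) (trans (cong (natℚ 2 ·G_) (*G-zeroʳ 1G)) (·G-zeroʳ (natℚ 2)))) (+G-identityˡ 0G))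
  (trans (cong (_+G (1G *G y)) (*G-zeroˡ 0G)) (trans (+G-identityˡ (1G *G y)) (*G-identityˡ y)))

√2-product : ∀ a b z w → (0G +√2 (a ·G z)) *K (0G +√2 (b ·G w)) ≡ fromG ((natℚ 2 * (a * b)) ·G (z *G w))
√2-product a b z w = cong₂ _+√2_
  (trans (cong (_+G (natℚ 2 ·G ((a ·G z) *G (b ·G w)))) (*G-zeroˡ 0G))
         (trans (+G-identityˡ (natℚ 2 ·G ((a ·G z) *G (b ·G w))))
                (trans (cong (natℚ 2 ·G_) (·G-*G-·G a b z w)) (·G-assoc (natℚ 2) (a * b) (z *G w)))))
  (trans (cong₂ _+G_ (*G-zeroˡ (b ·G w)) (*G-zeroʳ (a ·G z))) (+G-identityˡ 0G))

sumK-fromG-·G : ∀ n (c : ℕ → ℚ) z → sumK n (λ l → fromG (c l ·G z)) ≡ fromG (sumℚ n c ·G z)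
sumK-fromG-·G n c z = trans (sumK-fromG n) (cong fromG (sumG-·G n c z))
  where
  sumK-fromG : ∀ n → sumK n (λ l → fromG (c l ·G z)) ≡ fromG (sumG n (λ l → c l ·G z))
  sumK-fromG zero    = refl
  sumK-fromG (suc n) = cong (_+K fromG (c n ·G z)) (sumK-fromG n)

sumK-cong : ∀ n {f g : ℕ → 𝕂} → (∀ i → f i ≡ g i) → sumK n f ≡ sumK n g
sumK-cong zero    f≡g = refl
sumK-cong (suc n) f≡g = cong₂ _+K_ (sumK-cong n f≡g) (f≡g n)

idM-refl : ∀ i → idM i i ≡ 1K
idM-refl zero    = refl
idM-refl (suc i) = idM-refl i

idM-≢ : ∀ {i j} → i ≢ j → idM i j ≡ 0K
idM-≢ {i} {j} i≢j with i ℕ.≡ᵇ j in eq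
... | true  = ⊥-elim (i≢j (ℕP.≡ᵇ⇒≡ i j (subst Data.Bool.T (sym eq) _)))
... | false = refl

δ-entry : ∀ {x y} → x *G y ≡ 1G → ∀ i j → fromG (δ i j ·G (x ^G i *G y ^G j)) ≡ idM i j
δ-entry {x} {y} xy≡1 i j with i ℕP.≟ j
... | yes refl = begin
  fromG (δ i i ·G (x ^G i *G y ^G i))  ≡⟨ cong (λ d → fromG (d ·G (x ^G i *G y ^G i))) (δ-refl i) ⟩
  fromG (1ℚ ·G (x ^G i *G y ^G i))     ≡⟨ cong fromG (trans (1·G (x ^G i *G y ^G i)) (^G-inverse xy≡1 i)) ⟩
  fromG 1G                             ≡⟨ sym (idM-refl i) ⟩
  idM i i ∎
... | no i≢j = trans (cong (λ d → fromG (d ·G (x ^G i *G y ^G j))) (δ-≢ i≢j))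
                     (trans (cong fromG (0·G (x ^G i *G y ^G j))) (sym (idM-≢ i≢j)))

𝒟*√2BB* : ∀ n i j l → c₀ (i ℕ.+ l) *K (√2 *K BB* n l j) ≡ fromG ((ν (i ℕ.+ l) * hankelInverse (suc n) l j) ·G (ω ^G i *G ζ ^G j))
𝒟*√2BB* n i j l = begin
  c₀ (i ℕ.+ l) *K (√2 *K BB* n l j)
    ≡⟨ cong₂ _*K_ (c₀≡ (i ℕ.+ l)) (trans (cong (√2 *K_) (BB*≡ n l j)) (√2*K-fromG (H ·G ζ ^G (l ℕ.+ j)))) ⟩
  (0G +√2 ((½ * ν (i ℕ.+ l)) ·G ω ^G (i ℕ.+ l))) *K (0G +√2 (H ·G ζ ^G (l ℕ.+ j)))
    ≡⟨ √2-product (½ * ν (i ℕ.+ l)) H (ω ^G (i ℕ.+ l)) (ζ ^G (l ℕ.+ j)) ⟩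
  fromG ((natℚ 2 * (½ * ν (i ℕ.+ l) * H)) ·G (ω ^G (i ℕ.+ l) *G ζ ^G (l ℕ.+ j)))
    ≡⟨ cong fromG (cong₂ _·G_ (solve 2 (λ v h → con (natℚ 2) :* (con ½ :* v :* h) := v :* h) refl (ν (i ℕ.+ l)) H) (^G-cancel ω*ζ≡1 i l j)) ⟩
  fromG ((ν (i ℕ.+ l) * H) ·G (ω ^G i *G ζ ^G j)) ∎
  where H = hankelInverse (suc n) l j

√2BB**𝒟 : ∀ n i j l → (√2 *K BB* n i l) *K c₀ (l ℕ.+ j) ≡ fromG ((hankelInverse (suc n) i l * ν (l ℕ.+ j)) ·G (ζ ^G i *G ω ^G j))
√2BB**𝒟 n i j l = begin
  (√2 *K BB* n i l) *K c₀ (l ℕ.+ j)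
    ≡⟨ cong₂ _*K_ (trans (cong (√2 *K_) (BB*≡ n i l)) (√2*K-fromG (H ·G ζ ^G (i ℕ.+ l)))) (c₀≡ (l ℕ.+ j)) ⟩
  (0G +√2 (H ·G ζ ^G (i ℕ.+ l))) *K (0G +√2 ((½ * ν (l ℕ.+ j)) ·G ω ^G (l ℕ.+ j)))
    ≡⟨ √2-product H (½ * ν (l ℕ.+ j)) (ζ ^G (i ℕ.+ l)) (ω ^G (l ℕ.+ j)) ⟩
  fromG ((natℚ 2 * (H * (½ * ν (l ℕ.+ j)))) ·G (ζ ^G (i ℕ.+ l) *G ω ^G (l ℕ.+ j)))
    ≡⟨ cong fromG (cong₂ _·G_ (solve 2 (λ h v → con (natℚ 2) :* (h :* (con ½ :* v)) := h :* v) refl H (ν (l ℕ.+ j))) (^G-cancel ζ*ω≡1 i l j)) ⟩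
  fromG ((H * ν (l ℕ.+ j)) ·G (ζ ^G i *G ω ^G j)) ∎
  where H = hankelInverse (suc n) i l

lemma5p2 : (n : ℕ) → IsInverse n 𝒟 (scale √2 (BB* n))
lemma5p2 n = left , right
  where
  left : ∀ i j → i ≤ n → j ≤ n → mul n 𝒟 (scale √2 (BB* n)) i j ≡ idM i j
  left i j i≤n j≤n = begin
    sumK (suc n) (λ l → c₀ (i ℕ.+ l) *K (√2 *K BB* n l j))
      ≡⟨ sumK-cong (suc n) (𝒟*√2BB* n i j) ⟩
    sumK (suc n) (λ l → fromG ((ν (i ℕ.+ l) * hankelInverse (suc n) l j) ·G (ω ^G i *G ζ ^G j)))
      ≡⟨ sumK-fromG-·G (suc n) (λ l → ν (i ℕ.+ l) * hankelInverse (suc n) l j) (ω ^G i *G ζ ^G j) ⟩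
    fromG (sumℚ (suc n) (λ l → ν (i ℕ.+ l) * hankelInverse (suc n) l j) ·G (ω ^G i *G ζ ^G j))
      ≡⟨ cong (λ d → fromG (d ·G (ω ^G i *G ζ ^G j))) (hankel-right-inverse (suc n) i j (s≤s i≤n) (s≤s j≤n)) ⟩
    fromG (δ i j ·G (ω ^G i *G ζ ^G j))
      ≡⟨ δ-entry ω*ζ≡1 i j ⟩
    idM i j ∎
  right : ∀ i j → i ≤ n → j ≤ n → mul n (scale √2 (BB* n)) 𝒟 i j ≡ idM i j
  right i j i≤n j≤n = begin
    sumK (suc n) (λ l → (√2 *K BB* n i l) *K c₀ (l ℕ.+ j))
      ≡⟨ sumK-cong (suc n) (√2BB**𝒟 n i j) ⟩
    sumK (suc n) (λ l → fromG ((hankelInverse (suc n) i l * ν (l ℕ.+ j)) ·G (ζ ^G i *G ω ^G j)))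
      ≡⟨ sumK-fromG-·G (suc n) (λ l → hankelInverse (suc n) i l * ν (l ℕ.+ j)) (ζ ^G i *G ω ^G j) ⟩
    fromG (sumℚ (suc n) (λ l → hankelInverse (suc n) i l * ν (l ℕ.+ j)) ·G (ζ ^G i *G ω ^G j))
      ≡⟨ cong (λ d → fromG (d ·G (ζ ^G i *G ω ^G j))) (hankel-left-inverse (suc n) i j (s≤s i≤n) (s≤s j≤n)) ⟩
    fromG (δ i j ·G (ζ ^G i *G ω ^G j))
      ≡⟨ δ-entry ζ*ω≡1 i j ⟩
    idM i j ∎
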